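{- Let $p>3$ be a prime, $n\ge1$, and $M=(a_{i,j})$ a nonsingular $n\times n$ matrix over $\mathbb{F}_p$ with row vectors $a_1,\dots,a_n$; let $e_1,\dots,e_n$ be the standard basis of $\mathbb{F}_p^n$ and $\omega\in\mathbb{C}$ a primitive $p$-th root of unity. For each $i\in[n]$ let $0\le t_i,t'_i\le p-1$ be integers, let $c_{i,k}\in\mathbb{F}_p$ ($k\in[t_i]$) be $t_i$ different residues and $d_{i,k}\in\mathbb{F}_p$ ($k\in[t'_i]$) be $t'_i$ different residues. Consider: (P1) There is no $x\in\mathbb{F}_p^n$ with $x_i\neq c_{i,k}$ for all $i\in[n],k\in[t_i]$ and $(Mx)_i\neq d_{i,k}$ for all $i\in[n],k\in[t'_i]$. (P2) The polynomial $h(x_1,\dots,x_n)=\prod_{i\in[n],k\in[t'_i]}\Big(\sum_{j}a_{i,j}x_j-d_{i,k}\Big)\cdot\prod_{i\in[n],k\in[t_i]}(x_i-c_{i,k})$ vanishes at every point of $\mathbb{F}_p^n$. (P3) $\prod_{i\in[n],k\in[t_i]}(1-\omega^{ -c_{i,k}}g^{e_i})\cdot\prod_{i\in[n],k\in[t'_i]}(1-\omega^{ -d_{i,k}}g^{a_i})=0$ in $\mathbb{C}[\mathbb{F}_p^n]$. (P4) $\prod_{i}(1-g^{e_i})^{t_i}\cdot\prod_i(1-g^{a_i})^{t'_i}=0$ in $\mathbb{F}_p[\mathbb{F}_p^n]$. (P5) For $f(x_1,\dots,x_n)=\prod_{i}\big(\sum_ja_{i,j}x_j\big)^{t'_i}\cdot\prod_ix_i^{t_i}$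 we have $\deg(\overline f)<\sum_it_i+\sum_it'_i$. Then (P1), (P2), (P3) are equivalent; (P3) implies (P4); and (P4) implies (P5).
   Context: For a ring $R$, $R[\mathbb{F}_p^n]$ is the group ring of the additive group $\mathbb{F}_p^n$, written multiplicatively: $g^v$ denotes the element $v$, $g^vg^w=g^{v+w}$. For $f\in\mathbb{F}_p[x_1,\dots,x_n]$, its reduced form $\overline f$ is the unique polynomial of degree at most $p-1$ in each variable obtained by replacing $x^{i(p-1)+j}$ by $x^j$ whenever $i>0$ and $0<j<p$ (so $\overline f$ and $f$ agree as functions on $\mathbb{F}_p^n$). -}

module Defs where

open import Level using (0ℓ)
open import Data.Nat as ℕ using (ℕ; zero; suc; _∸_; NonZero; _%_; _≤_)
open import Data.Nat.DivMod using (_mod_)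
open import Data.Fin as Fin using (Fin; toℕ)
open import Data.Fin.Properties using () renaming (_≟_ to _≟F_)
open import Data.Integer as ℤ using (ℤ)
open import Data.Vec as Vec using (Vec; []; _∷_; lookup; tabulate; zipWith)
open import Data.Vec.Properties using (≡-dec)
open import Data.List as List using (List; []; _∷_; concatMap; allFin; filter)
open import Data.Product using (Σ; _×_; _,_; proj₁; proj₂; ∃)
open import Relation.Nullary using (¬_; Dec; yes; no)
open import Relation.Binary.PropositionalEquality using (_≡_; _≢_)
open import Algebra.Bundles.Raw using (RawRing)

foldFin : {A : Set} → (A → A → A) → A → (m : ℕ) → (Fin m → A) → A
foldFin _∙_ e m f = List.foldr _∙_ e (List.map f (allFin m))

module _ (p : ℕ) .{{_ : NonZero p}} where

  Fp : Set
  Fp = Fin p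

  infixl 6 _+ₚ_ _-ₚ_
  infixl 7 _*ₚ_

  _+ₚ_ : Fp → Fp → Fp
  a +ₚ b = (toℕ a ℕ.+ toℕ b) mod p

  _*ₚ_ : Fp → Fp → Fp
  a *ₚ b = (toℕ a ℕ.* toℕ b) mod p

  -ₚ_ : Fp → Fp
  -ₚ a = (p ∸ toℕ a) mod p

  _-ₚ_ : Fp → Fp → Fp
  a -ₚ b = a +ₚ (-ₚ b)

  0ₚ 1ₚ : Fp
  0ₚ = 0 mod p
  1ₚ = 1 mod p

  sumₚ : (m : ℕ) → (Fin m → Fp) → Fp
  sumₚ = foldFin _+ₚ_ 0ₚ

  prodₚ : (m : ℕ) → (Fin m → Fp) → Fp
  prodₚ = foldFin _*ₚ_ 1ₚ

  FpRing : RawRing 0ℓ 0ℓ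
  FpRing = record
    { Carrier = Fp ; _≈_ = _≡_ ; _+_ = _+ₚ_ ; _*_ = _*ₚ_
    ; -_ = -ₚ_ ; 0# = 0ₚ ; 1# = 1ₚ }

  Vecₚ : ℕ → Set
  Vecₚ n = Vec Fp n

  Matrix : ℕ → Set
  Matrix n = Fin n → Fin n → Fp

  basis : (n : ℕ) → Fin n → Vecₚ n
  basis n i = tabulate λ j → δ i j
    where
    δ : Fin n → Fin n → Fp
    δ i j with i ≟F j
    ... | yes _ = 1ₚ
    ... | no  _ = 0ₚ

  idMat : (n : ℕ) → Matrix n
  idMat n i j = lookup (basis n i) j

  matMul : (n : ℕ) → Matrix n → Matrix n → Matrix n
  matMul n A B i j = sumₚ n λ k → A i k *ₚ B k j

  Nonsingular : (n : ℕ) → Matrix n → Set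
  Nonsingular n M = Σ (Matrix n) λ N →
    ((i j : Fin n) → matMul n M N i j ≡ idMat n i j) ×
    ((i j : Fin n) → matMul n N M i j ≡ idMat n i j)

  row : (n : ℕ) → Matrix n → Fin n → Vecₚ n
  row n M i = tabulate (M i)

  matVec : (n : ℕ) → Matrix n → Vecₚ n → Fin n → Fp
  matVec n M x i = sumₚ n λ j → M i j *ₚ lookup x j

  -- An element of R[𝔽_p^n] is its coefficient function 𝔽_p^n → R;
  -- g^v is the indicator of v, multiplication is convolution.

  allVecs : (n : ℕ) → List (Vecₚ n)
  allVecs zero    = [] ∷ []
  allVecs (suc n) = concatMap (λ a → List.map (a ∷_) (allVecs n)) (allFin p)

  vadd : {n : ℕ} → Vecₚ n → Vecₚ n → Vecₚ n
  vadd = zipWith _+ₚ_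

  vsub : {n : ℕ} → Vecₚ n → Vecₚ n → Vecₚ n
  vsub = zipWith _-ₚ_

  vzero : (n : ℕ) → Vecₚ n
  vzero n = Vec.replicate n 0ₚ

  module GroupRing (R : RawRing 0ℓ 0ℓ) (n : ℕ) where
    open RawRing R

    GR : Set
    GR = Vecₚ n → Carrier

    scaledGen : Carrier → Vecₚ n → GR
    scaledGen r v w with ≡-dec _≟F_ w v
    ... | yes _ = r
    ... | no  _ = 0#

    gen : Vecₚ n → GR
    gen v = scaledGen 1# v

    oneGR : GR
    oneGR = gen (vzero n)

    addGR : GR → GR → GR
    addGR f h v = f v + h v

    subGR : GR → GR → GR
    subGR f h v = f v + (- h v)

    mulGR : GR → GR → GR
    mulGR f h v = List.foldr _+_ 0# (List.map (λ w → f w * h (vsub v w)) (allVecs n))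

    powGR : GR → ℕ → GR
    powGR f zero    = oneGR
    powGR f (suc k) = mulGR f (powGR f k)

    prodGR : (m : ℕ) → (Fin m → GR) → GR
    prodGR = foldFin mulGR oneGR

    IsZero : GR → Set
    IsZero f = (v : Vecₚ n) → f v ≈ 0#

  -- The subring ℤ[ω] ⊂ ℂ generated by a primitive p-th root of unity ω,
  -- realised as ℤ[x]/(1 + x + ... + x^{p-1}) = ℤ[C_p]/(N), N = Σ_k x^k.
  -- An element is a coefficient function Fin p → ℤ (a_k is the
  -- coefficient of ω^k); two representatives are equal in ℤ[ω] iff
  -- their difference lies in the ideal (N), i.e. iff the difference has
  -- all coefficients equal.

  Zω : Set
  Zω = Fp → ℤ

  ωpow : Fp → Zω
  ωpow c k with k ≟F c
  ... | yes _ = ℤ.+ 1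
  ... | no  _ = ℤ.+ 0

  ZωRing : RawRing 0ℓ 0ℓ
  ZωRing = record
    { Carrier = Zω
    ; _≈_ = λ a b → (k l : Fp) → a k ℤ.- b k ≡ a l ℤ.- b l
    ; _+_ = λ a b k → a k ℤ.+ b k
    ; _*_ = λ a b k → List.foldr ℤ._+_ (ℤ.+ 0)
                        (List.map (λ j → a j ℤ.* b (k -ₚ j)) (allFin p))
    ; -_ = λ a k → ℤ.- a k
    ; 0# = λ _ → ℤ.+ 0
    ; 1# = ωpow 0ₚ
    }

  -- Polynomials in n variables over 𝔽_p, as (unnormalised) lists of
  -- terms c·x^e with e ∈ ℕ^n; the coefficient of a monomial is the sum of
  -- the coefficients of all terms with that exponent vector.

  Poly : ℕ → Set
  Poly n = List (Fp × Vec ℕ n)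

  polyMul : {n : ℕ} → Poly n → Poly n → Poly n
  polyMul f g = concatMap (λ t → List.map (λ s → (proj₁ t *ₚ proj₁ s , zipWith ℕ._+_ (proj₂ t) (proj₂ s))) g) f

  polyOne : (n : ℕ) → Poly n
  polyOne n = (1ₚ , Vec.replicate n 0) ∷ []

  polyPow : {n : ℕ} → Poly n → ℕ → Poly n
  polyPow {n} f zero    = polyOne n
  polyPow f (suc k) = polyMul f (polyPow f k)

  polyProd : (n m : ℕ) → (Fin m → Poly n) → Poly n
  polyProd n = foldFin polyMul (polyOne n)

  var : (n : ℕ) → Fin n → Poly n
  var n i = (1ₚ , tabulate λ j → lookup (unitExp i) j) ∷ []
    where
    unitExp : Fin n → Vec ℕ n
    unitExp i = tabulate λ j → δ j
      where
      δ : Fin n → ℕ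
      δ j with i ≟F j
      ... | yes _ = 1
      ... | no  _ = 0

  linForm : (n : ℕ) → (Fin n → Fp) → Poly n
  linForm n a = List.concatMap (λ j → List.map (λ t → (a j *ₚ proj₁ t , proj₂ t)) (var n j)) (allFin n)

  coeff : {n : ℕ} → Poly n → Vec ℕ n → Fp
  coeff f m = List.foldr _+ₚ_ 0ₚ (List.map proj₁ (filter (λ t → ≡-dec ℕ._≟_ (proj₂ t) m) f))

  -- reduction of an exponent: x^{i(p-1)+j} ↦ x^j for i > 0, 0 < j < p
  -- (i.e. 0 ↦ 0 and e ↦ ((e-1) mod (p-1)) + 1 for e ≥ 1)
  redExp : ℕ → ℕ
  redExp e = aux (p ∸ 1) e
    where
    aux : ℕ → ℕ → ℕ
    aux zero    e       = e          -- only when p = 1 (never: p prime)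
    aux (suc q) zero    = zero
    aux (suc q) (suc k) = suc (k % suc q)

  reduce : {n : ℕ} → Poly n → Poly n
  reduce = List.map (λ t → (proj₁ t , Vec.map redExp (proj₂ t)))

  -- deg f < D  (every monomial of total degree ≥ D has coefficient 0;
  -- the zero polynomial has degree -∞)
  DegLt : {n : ℕ} → Poly n → ℕ → Set
  DegLt {n} f D = (m : Vec ℕ n) → D ≤ Vec.sum m → coeff f m ≡ 0ₚ

  module Props (n : ℕ) (M : Matrix n) (t t' : Fin n → ℕ)
               (c : (i : Fin n) → Fin (t i) → Fp)
               (d : (i : Fin n) → Fin (t' i) → Fp) where

    P1 : Set
    P1 = ¬ (Σ (Vecₚ n) λ x →
           ((i : Fin n) (k : Fin (t i)) → lookup x i ≢ c i k) ×
           ((i : Fin n) (k : Fin (t' i)) → matVec n M x i ≢ d i k))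

    hEval : Vecₚ n → Fp
    hEval x = prodₚ n (λ i → prodₚ (t' i) λ k → matVec n M x i -ₚ d i k)
           *ₚ prodₚ n (λ i → prodₚ (t i) λ k → lookup x i -ₚ c i k)

    P2 : Set
    P2 = (x : Vecₚ n) → hEval x ≡ 0ₚ

    module C = GroupRing ZωRing n

    factorℂ : Fp → Vecₚ n → C.GR
    factorℂ a v = C.subGR C.oneGR (C.scaledGen (ωpow (-ₚ a)) v)

    P3 : Set
    P3 = C.IsZero (C.mulGR
           (C.prodGR n λ i → C.prodGR (t i) λ k → factorℂ (c i k) (basis n i))
           (C.prodGR n λ i → C.prodGR (t' i) λ k → factorℂ (d i k) (row n M i)))

    module F = GroupRing FpRing n

    P4 : Set
    P4 = F.IsZero (F.mulGR
           (F.prodGR n λ i → F.powGR (F.subGR F.oneGR (F.gen (basis n i))) (t i))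
           (F.prodGR n λ i → F.powGR (F.subGR F.oneGR (F.gen (row n M i))) (t' i)))

    fPoly : Poly n
    fPoly = polyMul (polyProd n n λ i → polyPow (linForm n (M i)) (t' i))
                    (polyProd n n λ i → polyPow (var n i) (t i))

    P5 : Set
    P5 = DegLt (reduce fPoly) (foldFin ℕ._+_ 0 n t ℕ.+ foldFin ℕ._+_ 0 n t')

module Submission where

-- Write G = 𝔽ₚⁿ. The polynomial h vanishes at x exactly when x takes one of the forbidden values, which is (P1) ⇔ (P2).
-- The character g^v ↦ ω^(x·v) of G sends the element of (P3) to the product of the factors 1 - ω^(xᵢ - cᵢₖ) and
-- 1 - ω^((Mx)ᵢ - dᵢₖ). A factor with exponent 0 vanishes, and every other factor divides p, so the product is 0 exactly
-- when x takes a forbidden value. An element of ℤ[ω][G] all of whose character values vanish is 0, because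
-- Σₓ ω^(x·u) is pⁿ for u = 0 and 0 otherwise and ℤ[ω] has no p-torsion; this gives (P2) ⇔ (P3). Sending ω to 1
-- maps ℤ[ω] onto 𝔽ₚ and the element of (P3) onto that of (P4).
-- For (P4) ⇒ (P5), let 𝔽ₚ[G] act on functions G → 𝔽ₚ by translation, so that 1 - g^u acts as minus the difference
-- operator along u. A product Ψ of k such factors then kills every polynomial function of degree < k, and sends the
-- monomial x^m of degree k to (-1)^k m! times the coefficient of x^m in the product of the corresponding linear forms.
-- For the product in (P4), which is 0, this makes every coefficient of f at a monomial of degree Σtᵢ + Σt′ᵢ with all
-- exponents below p vanish; these are the only coefficients of the reduced form that could violate the degree bound.

open import Level using (0ℓ)
open import Data.Nat as ℕ using (ℕ; zero; suc; NonZero; _∸_; _≤_; _<_; z≤n; s≤s; _!; _%_)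
import Data.Nat.Properties as ℕₚ
open import Data.Nat.DivMod using (_mod_; m%n<n; m%n≤m; m<n⇒m%n≡m; n%n≡0; m*n%n≡0; [m+kn]%n≡m%n; [m+n]%n≡m%n; %-distribˡ-+; %-distribˡ-*)
open import Data.Nat.Divisibility using (_∣_; m%n≡0⇒n∣m; ∣⇒≤)
open import Data.Nat.Primality using (Prime; euclidsLemma; prime⇒nonTrivial)
open import Data.Nat.Coprimality using (prime⇒coprime; coprime-Bézout)
open import Data.Nat.GCD using (module Bézout)
open import Data.Integer as ℤ using (ℤ)
import Data.Integer.Properties as ℤₚ
open import Data.Integer.Solver using () renaming (module +-*-Solver to ℤ-Solver)
open import Data.Fin using (Fin; zero; suc; toℕ)
open import Data.Fin.Properties using (toℕ-injective; toℕ-fromℕ<; toℕ<n; suc-injective) renaming (_≟_ to _≟ᶠ_)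
open import Data.Fin.Permutation using (permutation)
open import Data.Vec as Vec using (Vec; []; _∷_; lookup; tabulate; zipWith; replicate)
import Data.Vec.Properties as Vecₚ
import Data.Vec.Relation.Unary.All as VecAll
import Data.Vec.Relation.Unary.All.Properties as VecAllₚ
open import Data.List using (List; []; _∷_; _++_; map; foldr; concatMap; allFin; length)
import Data.List.Properties as Listₚ
open import Data.List.Relation.Unary.All as All using (All; []; _∷_)
import Data.List.Relation.Unary.All.Properties as Allₚ
open import Data.Product using (∃; _×_; _,_; proj₁; proj₂)
open import Data.Sum using (_⊎_; inj₁; inj₂; [_,_])
open import Data.Empty using (⊥-elim)
open import Relation.Nullary using (¬_; Dec; yes; no)
open import Relation.Nullary.Decidable using (dec⇒maybe)
import Data.Maybe as Maybe
open import Relation.Binary.PropositionalEquality as ≡ using (_≡_; _≢_; cong; cong₂; subst; module ≡-Reasoning)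
open import Function using (_∘_; id; _∋_; _⇔_; mk⇔; Equivalence)
open import Algebra.Bundles using (CommutativeMonoid; CommutativeRing)
open import Algebra.Bundles.Raw using (RawRing)
import Relation.Binary.Reasoning.Setoid
import Algebra.Solver.Ring
open import Algebra.Solver.Ring.AlmostCommutativeRing using (fromCommutativeRing; _-Raw-AlmostCommutative⟶_)
import Algebra.Properties.CommutativeMonoid.Sum as MonoidSum
open import Defs

foldr-map-allFin-suc : ∀ {a} {A : Set a} (_∙_ : A → A → A) (e : A) (m : ℕ) (f : Fin (suc m) → A) →
                       foldr _∙_ e (map f (allFin (suc m))) ≡ f zero ∙ foldr _∙_ e (map (f ∘ suc) (allFin m))
foldr-map-allFin-suc _∙_ e m f =
  cong (λ xs → f zero ∙ foldr _∙_ e xs) (≡.trans (Listₚ.map-tabulate suc f) (≡.sym (Listₚ.map-tabulate id (f ∘ suc))))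

foldFin-suc : {A : Set} (_∙_ : A → A → A) (e : A) (m : ℕ) (f : Fin (suc m) → A) →
              foldFin _∙_ e (suc m) f ≡ f zero ∙ foldFin _∙_ e m (f ∘ suc)
foldFin-suc = foldr-map-allFin-suc

module ListSum {c ℓ} (M : CommutativeMonoid c ℓ) where
  open CommutativeMonoid M
  open import Relation.Binary.Reasoning.Setoid setoid
  open import Algebra.Properties.CommutativeSemigroup commutativeSemigroup using (interchange)

  Sum : {A : Set} → List A → (A → Carrier) → Carrier
  Sum xs f = foldr _∙_ ε (map f xs)

  Sum-cong : {A : Set} (xs : List A) {f g : A → Carrier} → (∀ x → f x ≈ g x) → Sum xs f ≈ Sum xs g
  Sum-cong []       f≈g = refl
  Sum-cong (x ∷ xs) f≈g = ∙-cong (f≈g x) (Sum-cong xs f≈g)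

  Sum-zero : {A : Set} (xs : List A) {f : A → Carrier} → (∀ x → f x ≈ ε) → Sum xs f ≈ ε
  Sum-zero []       f≈ε = refl
  Sum-zero (x ∷ xs) f≈ε = trans (∙-cong (f≈ε x) (Sum-zero xs f≈ε)) (identityˡ ε)

  Sum-∙ : {A : Set} (xs : List A) (f g : A → Carrier) → Sum xs (λ x → f x ∙ g x) ≈ Sum xs f ∙ Sum xs g
  Sum-∙ []       f g = sym (identityˡ ε)
  Sum-∙ (x ∷ xs) f g = begin
    (f x ∙ g x) ∙ Sum xs (λ x → f x ∙ g x)   ≈⟨ ∙-congˡ (Sum-∙ xs f g) ⟩
    (f x ∙ g x) ∙ (Sum xs f ∙ Sum xs g)      ≈⟨ interchange _ _ _ _ ⟩
    (f x ∙ Sum xs f) ∙ (g x ∙ Sum xs g)      ∎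

  Sum-++ : {A : Set} (xs ys : List A) (f : A → Carrier) → Sum (xs ++ ys) f ≈ Sum xs f ∙ Sum ys f
  Sum-++ []       ys f = sym (identityˡ _)
  Sum-++ (x ∷ xs) ys f = trans (∙-congˡ (Sum-++ xs ys f)) (sym (assoc _ _ _))

  Sum-concatMap : {A B : Set} (h : A → List B) (xs : List A) (f : B → Carrier) →
                  Sum (concatMap h xs) f ≈ Sum xs (λ x → Sum (h x) f)
  Sum-concatMap h []       f = refl
  Sum-concatMap h (x ∷ xs) f = trans (Sum-++ (h x) (concatMap h xs) f) (∙-congˡ (Sum-concatMap h xs f))

  Sum-map : {A B : Set} (g : A → B) (xs : List A) (f : B → Carrier) → Sum (map g xs) f ≡ Sum xs (f ∘ g)
  Sum-map g xs f = cong (foldr _∙_ ε) (≡.sym (Listₚ.map-∘ xs))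

  Sum-swap : {A B : Set} (xs : List A) (ys : List B) (f : A → B → Carrier) →
             Sum xs (λ x → Sum ys (f x)) ≈ Sum ys (λ y → Sum xs (λ x → f x y))
  Sum-swap []       ys f = sym (Sum-zero ys (λ _ → refl))
  Sum-swap (x ∷ xs) ys f = trans (∙-congˡ (Sum-swap xs ys f)) (sym (Sum-∙ ys (f x) _))

  Sum-allFin-suc : (n : ℕ) (f : Fin (suc n) → Carrier) → Sum (allFin (suc n)) f ≡ f zero ∙ Sum (allFin n) (f ∘ suc)
  Sum-allFin-suc = foldr-map-allFin-suc _∙_ ε

  Sum-allFin-single : (n : ℕ) (f : Fin n → Carrier) (i : Fin n) → (∀ j → j ≢ i → f j ≈ ε) →
                      Sum (allFin n) f ≈ f i
  Sum-allFin-single (suc n) f zero    f≈ε = begin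
    Sum (allFin (suc n)) f                   ≡⟨ Sum-allFin-suc n f ⟩
    f zero ∙ Sum (allFin n) (f ∘ suc)        ≈⟨ ∙-congˡ (Sum-zero (allFin n) (λ j → f≈ε (suc j) (λ ()))) ⟩
    f zero ∙ ε                               ≈⟨ identityʳ _ ⟩
    f zero                                   ∎
  Sum-allFin-single (suc n) f (suc i) f≈ε = begin
    Sum (allFin (suc n)) f                   ≡⟨ Sum-allFin-suc n f ⟩
    f zero ∙ Sum (allFin n) (f ∘ suc)        ≈⟨ ∙-cong (f≈ε zero (λ ())) (Sum-allFin-single n (f ∘ suc) i (λ j j≢i → f≈ε (suc j) (j≢i ∘ suc-injective))) ⟩
    ε ∙ f (suc i)                            ≈⟨ identityˡ _ ⟩
    f (suc i)                                ∎

  private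
    Sum-allFin≈sum : (n : ℕ) (f : Fin n → Carrier) → Sum (allFin n) f ≈ MonoidSum.sum M f
    Sum-allFin≈sum zero    f = refl
    Sum-allFin≈sum (suc n) f = trans (reflexive (Sum-allFin-suc n f)) (∙-congˡ (Sum-allFin≈sum n (f ∘ suc)))

  Sum-allFin-bijection : (n : ℕ) (σ τ : Fin n → Fin n) → (∀ i → σ (τ i) ≡ i) → (∀ i → τ (σ i) ≡ i) →
                         (f : Fin n → Carrier) → Sum (allFin n) (f ∘ σ) ≈ Sum (allFin n) f
  Sum-allFin-bijection n σ τ στ τσ f = begin
    Sum (allFin n) (f ∘ σ)      ≈⟨ Sum-allFin≈sum n (f ∘ σ) ⟩
    MonoidSum.sum M (f ∘ σ)     ≈⟨ MonoidSum.sum-permute M f (permutation σ τ στ τσ) ⟨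
    MonoidSum.sum M f           ≈⟨ Sum-allFin≈sum n f ⟨
    Sum (allFin n) f            ∎

module RingListSum {c ℓ} (R : CommutativeRing c ℓ) where
  open CommutativeRing R
  open ListSum +-commutativeMonoid public renaming (Sum-∙ to Sum-+)

  Sum-*ˡ : {A : Set} (xs : List A) (a : Carrier) (f : A → Carrier) → a * Sum xs f ≈ Sum xs (λ x → a * f x)
  Sum-*ˡ []       a f = zeroʳ a
  Sum-*ˡ (x ∷ xs) a f = trans (distribˡ a _ _) (+-congˡ (Sum-*ˡ xs a f))

  Sum-*ʳ : {A : Set} (xs : List A) (a : Carrier) (f : A → Carrier) → Sum xs f * a ≈ Sum xs (λ x → f x * a)
  Sum-*ʳ []       a f = zeroˡ a
  Sum-*ʳ (x ∷ xs) a f = trans (distribʳ a _ _) (+-congˡ (Sum-*ʳ xs a f))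

  Sum-neg : {A : Set} (xs : List A) (f : A → Carrier) → - Sum xs f ≈ Sum xs (λ x → - f x)
  Sum-neg []       f = -0#≈0#
    where open import Algebra.Properties.Ring ring using (-0#≈0#)
  Sum-neg (x ∷ xs) f = trans (sym (⁻¹-∙-comm _ _)) (+-congˡ (Sum-neg xs f))
    where open import Algebra.Properties.AbelianGroup +-abelianGroup using (⁻¹-∙-comm)

module RingProduct {c ℓ} (R : CommutativeRing c ℓ) where
  open CommutativeRing R hiding (zero)
  open ListSum *-commutativeMonoid using (Sum; Sum-cong; Sum-allFin-suc)
  open import Relation.Binary.Reasoning.Setoid setoid

  Π : (m : ℕ) → (Fin m → Carrier) → Carrier
  Π m = Sum (allFin m)

  Π-suc : ∀ m (f : Fin (suc m) → Carrier) → Π (suc m) f ≡ f zero * Π m (f ∘ suc)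
  Π-suc = Sum-allFin-suc

  Π-cong : ∀ m {f g : Fin m → Carrier} → (∀ j → f j ≈ g j) → Π m f ≈ Π m g
  Π-cong m = Sum-cong (allFin m)

  Π-zero : ∀ m (f : Fin m → Carrier) j → f j ≈ 0# → Π m f ≈ 0#
  Π-zero (suc m) f zero    fj≈0 = begin
    Π (suc m) f                    ≡⟨ Π-suc m f ⟩
    f zero * Π m (f ∘ suc)         ≈⟨ *-congʳ fj≈0 ⟩
    0# * Π m (f ∘ suc)             ≈⟨ zeroˡ _ ⟩
    0#                             ∎
  Π-zero (suc m) f (suc j) fj≈0 = begin
    Π (suc m) f                    ≡⟨ Π-suc m f ⟩
    f zero * Π m (f ∘ suc)         ≈⟨ *-congˡ (Π-zero m (f ∘ suc) j fj≈0) ⟩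
    f zero * 0#                    ≈⟨ zeroʳ _ ⟩
    0#                             ∎

  Π-closed : ∀ {q} (P : Carrier → Set q) → P 1# → (∀ {a b} → P a → P b → P (a * b)) →
             ∀ m (f : Fin m → Carrier) → (∀ j → P (f j)) → P (Π m f)
  Π-closed P P-1 P-* zero    f Pf = P-1
  Π-closed P P-1 P-* (suc m) f Pf = subst P (≡.sym (Π-suc m f)) (P-* (Pf zero) (Π-closed P P-1 P-* m (f ∘ suc) (Pf ∘ suc)))

-- Group algebras of finite abelian groups

-- That `elements` lists every element exactly once is required only in the form of the three summation laws.
record FiniteAbelianGroup : Set₁ where
  infixl 6 _⊕_ _⊖_
  field
    Carrier  : Set
    _⊕_ _⊖_  : Carrier → Carrier → Carrier
    𝟎        : Carrier
    elements : List Carrier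
    ⊕-assoc      : ∀ x y z → (x ⊕ y) ⊕ z ≡ x ⊕ (y ⊕ z)
    ⊕-identityʳ  : ∀ x → x ⊕ 𝟎 ≡ x
    ⊖-identityʳ  : ∀ x → x ⊖ 𝟎 ≡ x
    x⊕y⊖y≡x      : ∀ x y → (x ⊕ y) ⊖ y ≡ x
    x⊖[y⊕z]      : ∀ x y z → x ⊖ (y ⊕ z) ≡ (x ⊖ z) ⊖ y
    x⊖[x⊖y]≡y    : ∀ x y → x ⊖ (x ⊖ y) ≡ y
    Sum-single   : (M : CommutativeMonoid 0ℓ 0ℓ) (f : Carrier → CommutativeMonoid.Carrier M) (x : Carrier) →
                   (∀ y → y ≢ x → CommutativeMonoid._≈_ M (f y) (CommutativeMonoid.ε M)) →
                   CommutativeMonoid._≈_ M (ListSum.Sum M elements f) (f x)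
    Sum-⊕        : (M : CommutativeMonoid 0ℓ 0ℓ) (f : Carrier → CommutativeMonoid.Carrier M) (x : Carrier) →
                   CommutativeMonoid._≈_ M (ListSum.Sum M elements (λ y → f (y ⊕ x))) (ListSum.Sum M elements f)
    Sum-⊖        : (M : CommutativeMonoid 0ℓ 0ℓ) (f : Carrier → CommutativeMonoid.Carrier M) (x : Carrier) →
                   CommutativeMonoid._≈_ M (ListSum.Sum M elements (λ y → f (x ⊖ y))) (ListSum.Sum M elements f)

module GroupAlgebra (R : CommutativeRing 0ℓ 0ℓ) (G : FiniteAbelianGroup) where
  open CommutativeRing R
  open RingListSum R
  open FiniteAbelianGroup G renaming (Carrier to Elt)
  open import Relation.Binary.Reasoning.Setoid setoid
  open import Algebra.Properties.Ring ring using (-‿distribˡ-*; -‿distribʳ-*)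

  R[G] : Set
  R[G] = Elt → Carrier

  infixl 7 _⋆_
  infixr 6 _▷_

  _⋆_ : R[G] → R[G] → R[G]
  (A ⋆ B) v = Sum elements (λ w → A w * B (v ⊖ w))

  ⟨_,_⟩ : R[G] → (Elt → Carrier) → Carrier
  ⟨ A , f ⟩ = Sum elements (λ w → A w * f w)

  _▷_ : R[G] → (Elt → Carrier) → Elt → Carrier
  (A ▷ f) y = Sum elements (λ w → A w * f (y ⊕ w))

  infix 4 _≗_
  _≗_ : (Elt → Carrier) → (Elt → Carrier) → Set
  f ≗ g = ∀ v → f v ≈ g v

  IsScaledGen : R[G] → Elt → Carrier → Set
  IsScaledGen A v r = A v ≈ r × (∀ w → w ≢ v → A w ≈ 0#)

  ⟨⟩-cong : ∀ {A A′ f f′} → A ≗ A′ → f ≗ f′ → ⟨ A , f ⟩ ≈ ⟨ A′ , f′ ⟩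
  ⟨⟩-cong A≗A′ f≗f′ = Sum-cong elements (λ w → *-cong (A≗A′ w) (f≗f′ w))

  ⋆-cong : ∀ {A A′ B B′} → A ≗ A′ → B ≗ B′ → A ⋆ B ≗ A′ ⋆ B′
  ⋆-cong A≗A′ B≗B′ v = Sum-cong elements (λ w → *-cong (A≗A′ w) (B≗B′ _))

  ▷-cong : ∀ {A A′ f f′} → A ≗ A′ → f ≗ f′ → A ▷ f ≗ A′ ▷ f′
  ▷-cong A≗A′ f≗f′ y = Sum-cong elements (λ w → *-cong (A≗A′ w) (f≗f′ _))

  ⟨⟩-scaledGen : ∀ {A v r} → IsScaledGen A v r → ∀ f → ⟨ A , f ⟩ ≈ r * f v
  ⟨⟩-scaledGen {A} {v} {r} (Av≈r , A≈0) f = begin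
    Sum elements (λ w → A w * f w)   ≈⟨ Sum-single +-commutativeMonoid _ v (λ w w≢v → trans (*-congʳ (A≈0 w w≢v)) (zeroˡ _)) ⟩
    A v * f v                        ≈⟨ *-congʳ Av≈r ⟩
    r * f v                          ∎

  private
    swap-*ˡ : ∀ a b c → a * (b * c) ≈ b * (a * c)
    swap-*ˡ a b c = trans (sym (*-assoc a b c)) (trans (*-congʳ (*-comm a b)) (*-assoc b a c))

  ⟨⋆⟩ : ∀ A B f → ⟨ A ⋆ B , f ⟩ ≈ ⟨ B , A ▷ f ⟩
  ⟨⋆⟩ A B f = begin
    Sum elements (λ v → Sum elements (λ w → A w * B (v ⊖ w)) * f v)
      ≈⟨ Sum-cong elements (λ v → Sum-*ʳ elements (f v) _) ⟩
    Sum elements (λ v → Sum elements (λ w → A w * B (v ⊖ w) * f v))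
      ≈⟨ Sum-swap elements elements _ ⟩
    Sum elements (λ w → Sum elements (λ v → A w * B (v ⊖ w) * f v))
      ≈⟨ Sum-cong elements (λ w → sym (Sum-⊕ +-commutativeMonoid (λ v → A w * B (v ⊖ w) * f v) w)) ⟩
    Sum elements (λ w → Sum elements (λ y → A w * B ((y ⊕ w) ⊖ w) * f (y ⊕ w)))
      ≈⟨ Sum-cong elements (λ w → Sum-cong elements (λ y → begin
           A w * B ((y ⊕ w) ⊖ w) * f (y ⊕ w)  ≡⟨ cong (λ z → A w * B z * f (y ⊕ w)) (x⊕y⊖y≡x y w) ⟩
           A w * B y * f (y ⊕ w)              ≈⟨ trans (*-assoc _ _ _) (swap-*ˡ (A w) (B y) _) ⟩
           B y * (A w * f (y ⊕ w))            ∎)) ⟩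
    Sum elements (λ w → Sum elements (λ y → B y * (A w * f (y ⊕ w))))
      ≈⟨ Sum-swap elements elements _ ⟩
    Sum elements (λ y → Sum elements (λ w → B y * (A w * f (y ⊕ w))))
      ≈⟨ Sum-cong elements (λ y → sym (Sum-*ˡ elements (B y) _)) ⟩
    Sum elements (λ y → B y * (A ▷ f) y) ∎

  ⋆-assoc : ∀ A B C → (A ⋆ B) ⋆ C ≗ A ⋆ (B ⋆ C)
  ⋆-assoc A B C v = begin
    ⟨ A ⋆ B , (λ w → C (v ⊖ w)) ⟩
      ≈⟨ ⟨⋆⟩ A B _ ⟩
    Sum elements (λ y → B y * Sum elements (λ w → A w * C (v ⊖ (y ⊕ w))))
      ≈⟨ Sum-cong elements (λ y → Sum-*ˡ elements (B y) _) ⟩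
    Sum elements (λ y → Sum elements (λ w → B y * (A w * C (v ⊖ (y ⊕ w)))))
      ≈⟨ Sum-swap elements elements _ ⟩
    Sum elements (λ w → Sum elements (λ y → B y * (A w * C (v ⊖ (y ⊕ w)))))
      ≈⟨ Sum-cong elements (λ w → Sum-cong elements (λ y →
           trans (swap-*ˡ (B y) (A w) _) (*-congˡ (*-congˡ (reflexive (cong C (x⊖[y⊕z] v y w))))))) ⟩
    Sum elements (λ w → Sum elements (λ y → A w * (B y * C ((v ⊖ w) ⊖ y))))
      ≈⟨ Sum-cong elements (λ w → sym (Sum-*ˡ elements (A w) _)) ⟩
    (A ⋆ (B ⋆ C)) v ∎

  ⋆-comm : ∀ A B → A ⋆ B ≗ B ⋆ A
  ⋆-comm A B v = begin
    Sum elements (λ w → A w * B (v ⊖ w))               ≈⟨ Sum-⊖ +-commutativeMonoid (λ w → A w * B (v ⊖ w)) v ⟨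
    Sum elements (λ w → A (v ⊖ w) * B (v ⊖ (v ⊖ w)))   ≈⟨ Sum-cong elements (λ w →
                                                          trans (*-congˡ (reflexive (cong B (x⊖[x⊖y]≡y v w)))) (*-comm _ _)) ⟩
    Sum elements (λ w → B w * A (v ⊖ w))               ∎

  ⋆-identityˡ : ∀ {O} → IsScaledGen O 𝟎 1# → ∀ A → O ⋆ A ≗ A
  ⋆-identityˡ O≈1 A v = trans (⟨⟩-scaledGen O≈1 (λ w → A (v ⊖ w))) (trans (*-identityˡ _) (reflexive (cong A (⊖-identityʳ v))))

  ⋆-distribˡ : ∀ A B C → A ⋆ (λ v → B v + C v) ≗ (λ v → (A ⋆ B) v + (A ⋆ C) v)
  ⋆-distribˡ A B C v = trans (Sum-cong elements (λ w → distribˡ (A w) _ _)) (Sum-+ elements _ _)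

  ▷-⋆ : ∀ A B f → (A ⋆ B) ▷ f ≗ B ▷ A ▷ f
  ▷-⋆ A B f y = begin
    ⟨ A ⋆ B , (λ w → f (y ⊕ w)) ⟩                                  ≈⟨ ⟨⋆⟩ A B _ ⟩
    Sum elements (λ z → B z * Sum elements (λ w → A w * f (y ⊕ (z ⊕ w))))
      ≈⟨ Sum-cong elements (λ z → *-congˡ (Sum-cong elements (λ w → *-congˡ (reflexive (cong f (≡.sym (⊕-assoc y z w))))))) ⟩
    (B ▷ A ▷ f) y                                                   ∎

  ▷-+ : ∀ A f g → A ▷ (λ y → f y + g y) ≗ (λ y → (A ▷ f) y + (A ▷ g) y)
  ▷-+ A f g y = trans (Sum-cong elements (λ w → distribˡ (A w) _ _)) (Sum-+ elements _ _)

  ▷-neg : ∀ A f → A ▷ (λ y → - f y) ≗ (λ y → - (A ▷ f) y)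
  ▷-neg A f y = trans (Sum-cong elements (λ w → sym (-‿distribʳ-* (A w) _))) (sym (Sum-neg elements _))

  ▷-Sum : ∀ {I : Set} (is : List I) A (c : I → Carrier) (g : I → Elt → Carrier) →
          A ▷ (λ y → Sum is (λ i → c i * g i y)) ≗ (λ y → Sum is (λ i → c i * (A ▷ g i) y))
  ▷-Sum is A c g y = begin
    Sum elements (λ w → A w * Sum is (λ i → c i * g i (y ⊕ w)))     ≈⟨ Sum-cong elements (λ w → Sum-*ˡ is (A w) _) ⟩
    Sum elements (λ w → Sum is (λ i → A w * (c i * g i (y ⊕ w))))   ≈⟨ Sum-swap elements is _ ⟩
    Sum is (λ i → Sum elements (λ w → A w * (c i * g i (y ⊕ w))))   ≈⟨ Sum-cong is (λ i →
                                                                      trans (Sum-cong elements (λ w → swap-*ˡ (A w) (c i) _))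
                                                                            (sym (Sum-*ˡ elements (c i) _))) ⟩
    Sum is (λ i → c i * (A ▷ g i) y)                                 ∎

  ▷-identity : ∀ {O} → IsScaledGen O 𝟎 1# → ∀ f → O ▷ f ≗ f
  ▷-identity O≈1 f y = trans (⟨⟩-scaledGen O≈1 (λ w → f (y ⊕ w))) (trans (*-identityˡ _) (reflexive (cong f (⊕-identityʳ y))))

  ⟨1-rg⟩ : ∀ {O S u r} → IsScaledGen O 𝟎 1# → IsScaledGen S u r → ∀ f →
           ⟨ (λ w → O w + - S w) , f ⟩ ≈ f 𝟎 + - (r * f u)
  ⟨1-rg⟩ {O} {S} {u} {r} O≈1 S≈r f = begin
    Sum elements (λ w → (O w + - S w) * f w)          ≈⟨ Sum-cong elements (λ w → trans (distribʳ _ _ _) (+-congˡ (sym (-‿distribˡ-* _ _)))) ⟩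
    Sum elements (λ w → O w * f w + - (S w * f w))    ≈⟨ Sum-+ elements _ _ ⟩
    ⟨ O , f ⟩ + Sum elements (λ w → - (S w * f w))    ≈⟨ +-cong (⟨⟩-scaledGen O≈1 f) (sym (Sum-neg elements _)) ⟩
    1# * f 𝟎 + - ⟨ S , f ⟩                            ≈⟨ +-cong (*-identityˡ _) (-‿cong (⟨⟩-scaledGen S≈r f)) ⟩
    f 𝟎 + - (r * f u)                                 ∎

  1-rg▷ : ∀ {O S u r} → IsScaledGen O 𝟎 1# → IsScaledGen S u r → ∀ f →
          (λ w → O w + - S w) ▷ f ≗ (λ y → f y + - (r * f (y ⊕ u)))
  1-rg▷ O≈1 S≈r f y = trans (⟨1-rg⟩ O≈1 S≈r (λ w → f (y ⊕ w))) (+-congʳ (reflexive (cong f (⊕-identityʳ y))))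

  module Character (χ : Elt → Carrier) (χ-hom : ∀ x y → χ (x ⊕ y) ≈ χ x * χ y) where

    ev : R[G] → Carrier
    ev A = ⟨ A , χ ⟩

    ▷-χ : ∀ A → A ▷ χ ≗ (λ y → χ y * ev A)
    ▷-χ A y = begin
      Sum elements (λ w → A w * χ (y ⊕ w))     ≈⟨ Sum-cong elements (λ w → trans (*-congˡ (χ-hom y w)) (swap-*ˡ (A w) (χ y) (χ w))) ⟩
      Sum elements (λ w → χ y * (A w * χ w))   ≈⟨ Sum-*ˡ elements (χ y) _ ⟨
      χ y * ev A                               ∎

    ev-⋆ : ∀ A B → ev (A ⋆ B) ≈ ev A * ev B
    ev-⋆ A B = begin
      ⟨ A ⋆ B , χ ⟩                            ≈⟨ ⟨⋆⟩ A B χ ⟩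
      ⟨ B , A ▷ χ ⟩                            ≈⟨ ⟨⟩-cong {B} (λ _ → refl) (▷-χ A) ⟩
      Sum elements (λ w → B w * (χ w * ev A))  ≈⟨ Sum-cong elements (λ w → sym (*-assoc _ _ _)) ⟩
      Sum elements (λ w → B w * χ w * ev A)    ≈⟨ Sum-*ʳ elements (ev A) _ ⟨
      ev B * ev A                              ≈⟨ *-comm _ _ ⟩
      ev A * ev B                              ∎

-- The prime field 𝔽ₚ and the vector space 𝔽ₚⁿ

module PrimeField (p : ℕ) .{{_ : NonZero p}} where
  open ≡ using (refl; sym; trans; isEquivalence)

  F : Set
  F = Fp p

  infixl 6 _+_ _-_
  infixl 7 _*_
  infix 8 -_

  _+_ _*_ _-_ : F → F → F
  _+_ = _+ₚ_ p
  _*_ = _*ₚ_ p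
  _-_ = _-ₚ_ p

  -_ : F → F
  -_ = -ₚ_ p

  0# 1# : F
  0# = 0ₚ p
  1# = 1ₚ p

  ⟦_⟧ : ℕ → F
  ⟦ m ⟧ = m mod p

  toℕ-⟦⟧ : ∀ m → toℕ ⟦ m ⟧ ≡ m % p
  toℕ-⟦⟧ m = toℕ-fromℕ< (m%n<n m p)

  ⟦⟧-cong-% : ∀ {m n} → m % p ≡ n % p → ⟦ m ⟧ ≡ ⟦ n ⟧
  ⟦⟧-cong-% {m} {n} eq = toℕ-injective (trans (toℕ-⟦⟧ m) (trans eq (sym (toℕ-⟦⟧ n))))

  ⟦toℕ⟧ : ∀ a → ⟦ toℕ a ⟧ ≡ a
  ⟦toℕ⟧ a = toℕ-injective (trans (toℕ-⟦⟧ (toℕ a)) (m<n⇒m%n≡m (toℕ<n a)))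

  ⟦+⟧ : ∀ m n → ⟦ m ℕ.+ n ⟧ ≡ ⟦ m ⟧ + ⟦ n ⟧
  ⟦+⟧ m n = ⟦⟧-cong-% (trans (%-distribˡ-+ m n p)
                        (sym (cong₂ (λ a b → (a ℕ.+ b) % p) (toℕ-⟦⟧ m) (toℕ-⟦⟧ n))))

  ⟦*⟧ : ∀ m n → ⟦ m ℕ.* n ⟧ ≡ ⟦ m ⟧ * ⟦ n ⟧
  ⟦*⟧ m n = ⟦⟧-cong-% (trans (%-distribˡ-* m n p)
                        (sym (cong₂ (λ a b → (a ℕ.* b) % p) (toℕ-⟦⟧ m) (toℕ-⟦⟧ n))))

  ⟦p⟧≡0 : ⟦ p ⟧ ≡ 0#
  ⟦p⟧≡0 = ⟦⟧-cong-% (trans (n%n≡0 p) (sym (m*n%n≡0 0 p)))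

  ⟦m*p⟧≡0 : ∀ m → ⟦ m ℕ.* p ⟧ ≡ 0#
  ⟦m*p⟧≡0 m = ⟦⟧-cong-% (trans (m*n%n≡0 m p) (sym (m*n%n≡0 0 p)))

  ⟦1+m*p⟧≡1 : ∀ m → ⟦ 1 ℕ.+ m ℕ.* p ⟧ ≡ 1#
  ⟦1+m*p⟧≡1 m = ⟦⟧-cong-% ([m+kn]%n≡m%n 1 m p)

  open ≡-Reasoning

  +-comm : ∀ a b → a + b ≡ b + a
  +-comm a b = cong ⟦_⟧ (ℕₚ.+-comm (toℕ a) (toℕ b))

  *-comm : ∀ a b → a * b ≡ b * a
  *-comm a b = cong ⟦_⟧ (ℕₚ.*-comm (toℕ a) (toℕ b))

  +-assoc : ∀ a b c → (a + b) + c ≡ a + (b + c)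
  +-assoc a b c = begin
    (a + b) + c                           ≡⟨ cong ((a + b) +_) (⟦toℕ⟧ c) ⟨
    ⟦ toℕ a ℕ.+ toℕ b ⟧ + ⟦ toℕ c ⟧       ≡⟨ ⟦+⟧ _ (toℕ c) ⟨
    ⟦ (toℕ a ℕ.+ toℕ b) ℕ.+ toℕ c ⟧       ≡⟨ cong ⟦_⟧ (ℕₚ.+-assoc (toℕ a) (toℕ b) (toℕ c)) ⟩
    ⟦ toℕ a ℕ.+ (toℕ b ℕ.+ toℕ c) ⟧       ≡⟨ ⟦+⟧ (toℕ a) _ ⟩
    ⟦ toℕ a ⟧ + ⟦ toℕ b ℕ.+ toℕ c ⟧       ≡⟨ cong (_+ (b + c)) (⟦toℕ⟧ a) ⟩
    a + (b + c)                           ∎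

  *-assoc : ∀ a b c → (a * b) * c ≡ a * (b * c)
  *-assoc a b c = begin
    (a * b) * c                           ≡⟨ cong ((a * b) *_) (⟦toℕ⟧ c) ⟨
    ⟦ toℕ a ℕ.* toℕ b ⟧ * ⟦ toℕ c ⟧       ≡⟨ ⟦*⟧ _ (toℕ c) ⟨
    ⟦ (toℕ a ℕ.* toℕ b) ℕ.* toℕ c ⟧       ≡⟨ cong ⟦_⟧ (ℕₚ.*-assoc (toℕ a) (toℕ b) (toℕ c)) ⟩
    ⟦ toℕ a ℕ.* (toℕ b ℕ.* toℕ c) ⟧       ≡⟨ ⟦*⟧ (toℕ a) _ ⟩
    ⟦ toℕ a ⟧ * ⟦ toℕ b ℕ.* toℕ c ⟧       ≡⟨ cong (_* (b * c)) (⟦toℕ⟧ a) ⟩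
    a * (b * c)                           ∎

  *-distribˡ-+ : ∀ a b c → a * (b + c) ≡ a * b + a * c
  *-distribˡ-+ a b c = begin
    a * (b + c)                           ≡⟨ cong (_* (b + c)) (⟦toℕ⟧ a) ⟨
    ⟦ toℕ a ⟧ * ⟦ toℕ b ℕ.+ toℕ c ⟧       ≡⟨ ⟦*⟧ (toℕ a) _ ⟨
    ⟦ toℕ a ℕ.* (toℕ b ℕ.+ toℕ c) ⟧       ≡⟨ cong ⟦_⟧ (ℕₚ.*-distribˡ-+ (toℕ a) (toℕ b) (toℕ c)) ⟩
    ⟦ toℕ a ℕ.* toℕ b ℕ.+ toℕ a ℕ.* toℕ c ⟧ ≡⟨ ⟦+⟧ _ _ ⟩
    a * b + a * c                         ∎

  *-distribʳ-+ : ∀ a b c → (b + c) * a ≡ b * a + c * a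
  *-distribʳ-+ a b c = begin
    (b + c) * a       ≡⟨ *-comm (b + c) a ⟩
    a * (b + c)       ≡⟨ *-distribˡ-+ a b c ⟩
    a * b + a * c     ≡⟨ cong₂ _+_ (*-comm a b) (*-comm a c) ⟩
    b * a + c * a     ∎

  +-identityˡ : ∀ a → 0# + a ≡ a
  +-identityˡ a = begin
    0# + a            ≡⟨ cong (0# +_) (⟦toℕ⟧ a) ⟨
    ⟦ 0 ⟧ + ⟦ toℕ a ⟧ ≡⟨ ⟦+⟧ 0 (toℕ a) ⟨
    ⟦ toℕ a ⟧         ≡⟨ ⟦toℕ⟧ a ⟩
    a                 ∎

  +-identityʳ : ∀ a → a + 0# ≡ a
  +-identityʳ a = trans (+-comm a 0#) (+-identityˡ a)

  *-identityˡ : ∀ a → 1# * a ≡ a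
  *-identityˡ a = begin
    1# * a            ≡⟨ cong (1# *_) (⟦toℕ⟧ a) ⟨
    ⟦ 1 ⟧ * ⟦ toℕ a ⟧ ≡⟨ ⟦*⟧ 1 (toℕ a) ⟨
    ⟦ 1 ℕ.* toℕ a ⟧   ≡⟨ cong ⟦_⟧ (ℕₚ.*-identityˡ (toℕ a)) ⟩
    ⟦ toℕ a ⟧         ≡⟨ ⟦toℕ⟧ a ⟩
    a                 ∎

  *-identityʳ : ∀ a → a * 1# ≡ a
  *-identityʳ a = trans (*-comm a 1#) (*-identityˡ a)

  -‿inverseˡ : ∀ a → - a + a ≡ 0#
  -‿inverseˡ a = begin
    - a + a                       ≡⟨ cong (- a +_) (⟦toℕ⟧ a) ⟨
    ⟦ p ∸ toℕ a ⟧ + ⟦ toℕ a ⟧     ≡⟨ ⟦+⟧ (p ∸ toℕ a) (toℕ a) ⟨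
    ⟦ p ∸ toℕ a ℕ.+ toℕ a ⟧       ≡⟨ cong ⟦_⟧ (ℕₚ.m∸n+n≡m (ℕₚ.<⇒≤ (toℕ<n a))) ⟩
    ⟦ p ⟧                         ≡⟨ ⟦p⟧≡0 ⟩
    0#                            ∎

  -‿inverseʳ : ∀ a → a + - a ≡ 0#
  -‿inverseʳ a = trans (+-comm a (- a)) (-‿inverseˡ a)

  ring : CommutativeRing 0ℓ 0ℓ
  ring = record
    { Carrier = F ; _≈_ = _≡_ ; _+_ = _+_ ; _*_ = _*_ ; -_ = -_ ; 0# = 0# ; 1# = 1#
    ; isCommutativeRing = record
      { isRing = record
        { +-isAbelianGroup = record
          { isGroup = record
            { isMonoid = record
              { isSemigroup = record
                { isMagma = record { isEquivalence = isEquivalence ; ∙-cong = cong₂ _+_ }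
                ; assoc = +-assoc }
              ; identity = +-identityˡ , +-identityʳ }
            ; inverse = -‿inverseˡ , -‿inverseʳ
            ; ⁻¹-cong = cong (-ₚ_ p) }
          ; comm = +-comm }
        ; *-cong = cong₂ _*_
        ; *-assoc = *-assoc
        ; *-identity = *-identityˡ , *-identityʳ
        ; distrib = *-distribˡ-+ , *-distribʳ-+ }
      ; *-comm = *-comm } }

  open CommutativeRing ring public using (zeroˡ; zeroʳ; +-group; +-abelianGroup)
  open import Algebra.Properties.Ring (CommutativeRing.ring ring) public
    using (-‿distribˡ-*; -‿distribʳ-*; -0#≈0#)
  open import Algebra.Properties.AbelianGroup +-abelianGroup public using (⁻¹-∙-comm; ⁻¹-anti-homo‿-)
  open import Algebra.Properties.Group +-group public
    using (x∙y⁻¹≈ε⇒x≈y; inverseˡ-unique) renaming (⁻¹-involutive to -‿involutive)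

  x-y≡0⇒x≡y : ∀ {a b} → a - b ≡ 0# → a ≡ b
  x-y≡0⇒x≡y = x∙y⁻¹≈ε⇒x≈y _ _

  ι : ℤ → F
  ι (ℤ.+ n)    = ⟦ n ⟧
  ι ℤ.-[1+ n ] = - ⟦ suc n ⟧

  ι-neg : ∀ a → ι (ℤ.- a) ≡ - ι a
  ι-neg (ℤ.+ zero)    = sym -0#≈0#
  ι-neg (ℤ.+ suc n)   = refl
  ι-neg ℤ.-[1+ n ]    = sym (-‿involutive ⟦ suc n ⟧)

  private
    ⟦∸⟧ : ∀ m n → n ≤ m → ⟦ m ∸ n ⟧ ≡ ⟦ m ⟧ - ⟦ n ⟧
    ⟦∸⟧ m n n≤m = begin
      ⟦ m ∸ n ⟧                       ≡⟨ x+y-y≡x ⟦ m ∸ n ⟧ ⟦ n ⟧ ⟨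
      (⟦ m ∸ n ⟧ + ⟦ n ⟧) - ⟦ n ⟧     ≡⟨ cong (_- ⟦ n ⟧) (⟦+⟧ (m ∸ n) n) ⟨
      ⟦ m ∸ n ℕ.+ n ⟧ - ⟦ n ⟧         ≡⟨ cong (λ k → ⟦ k ⟧ - ⟦ n ⟧) (ℕₚ.m∸n+n≡m n≤m) ⟩
      ⟦ m ⟧ - ⟦ n ⟧                   ∎
      where
      x+y-y≡x : ∀ a b → (a + b) - b ≡ a
      x+y-y≡x a b = trans (+-assoc a b (- b)) (trans (cong (a +_) (-‿inverseʳ b)) (+-identityʳ a))

    ι-⊖ : ∀ m n → ι (m ℤ.⊖ n) ≡ ⟦ m ⟧ - ⟦ n ⟧
    ι-⊖ m n with ℕₚ.≤-<-connex n m
    ... | inj₁ n≤m = trans (cong ι (ℤₚ.⊖-≥ n≤m)) (⟦∸⟧ m n n≤m)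
    ... | inj₂ m<n = begin
      ι (m ℤ.⊖ n)             ≡⟨ cong ι (ℤₚ.⊖-< m<n) ⟩
      ι (ℤ.- ℤ.+ (n ∸ m))     ≡⟨ ι-neg (ℤ.+ (n ∸ m)) ⟩
      - ⟦ n ∸ m ⟧             ≡⟨ cong -_ (⟦∸⟧ n m (ℕₚ.<⇒≤ m<n)) ⟩
      - (⟦ n ⟧ - ⟦ m ⟧)       ≡⟨ ⁻¹-anti-homo‿- ⟦ n ⟧ ⟦ m ⟧ ⟩
      ⟦ m ⟧ - ⟦ n ⟧           ∎

  ι-+ : ∀ a b → ι (a ℤ.+ b) ≡ ι a + ι b
  ι-+ (ℤ.+ m)    (ℤ.+ n)    = ⟦+⟧ m n
  ι-+ (ℤ.+ m)    ℤ.-[1+ n ] = ι-⊖ m (suc n)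
  ι-+ ℤ.-[1+ m ] (ℤ.+ n)    = trans (ι-⊖ n (suc m)) (+-comm ⟦ n ⟧ (- ⟦ suc m ⟧))
  ι-+ ℤ.-[1+ m ] ℤ.-[1+ n ] = begin
    - ⟦ suc (suc (m ℕ.+ n)) ⟧          ≡⟨ cong (λ k → - ⟦ k ⟧) (ℕₚ.+-suc (suc m) n) ⟨
    - ⟦ suc m ℕ.+ suc n ⟧              ≡⟨ cong -_ (⟦+⟧ (suc m) (suc n)) ⟩
    - (⟦ suc m ⟧ + ⟦ suc n ⟧)          ≡⟨ ⁻¹-∙-comm ⟦ suc m ⟧ ⟦ suc n ⟧ ⟨
    - ⟦ suc m ⟧ + - ⟦ suc n ⟧          ∎

  private
    ι-+* : ∀ m b → ι (ℤ.+ m ℤ.* b) ≡ ⟦ m ⟧ * ι b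
    ι-+* m (ℤ.+ n)    = trans (cong ι (sym (ℤₚ.pos-* m n))) (⟦*⟧ m n)
    ι-+* m ℤ.-[1+ n ] = begin
      ι (ℤ.+ m ℤ.* ℤ.-[1+ n ])           ≡⟨ cong ι (ℤₚ.neg-distribʳ-* (ℤ.+ m) (ℤ.+ suc n)) ⟨
      ι (ℤ.- (ℤ.+ m ℤ.* ℤ.+ suc n))      ≡⟨ ι-neg (ℤ.+ m ℤ.* ℤ.+ suc n) ⟩
      - ι (ℤ.+ m ℤ.* ℤ.+ suc n)          ≡⟨ cong -_ (ι-+* m (ℤ.+ suc n)) ⟩
      - (⟦ m ⟧ * ⟦ suc n ⟧)              ≡⟨ -‿distribʳ-* ⟦ m ⟧ ⟦ suc n ⟧ ⟩
      ⟦ m ⟧ * - ⟦ suc n ⟧                ∎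

  ι-* : ∀ a b → ι (a ℤ.* b) ≡ ι a * ι b
  ι-* (ℤ.+ m)    b = ι-+* m b
  ι-* ℤ.-[1+ m ] b = begin
    ι (ℤ.-[1+ m ] ℤ.* b)               ≡⟨ cong ι (ℤₚ.neg-distribˡ-* (ℤ.+ suc m) b) ⟨
    ι (ℤ.- (ℤ.+ suc m ℤ.* b))          ≡⟨ ι-neg (ℤ.+ suc m ℤ.* b) ⟩
    - ι (ℤ.+ suc m ℤ.* b)              ≡⟨ cong -_ (ι-+* (suc m) b) ⟩
    - (⟦ suc m ⟧ * ι b)                ≡⟨ -‿distribˡ-* ⟦ suc m ⟧ (ι b) ⟩
    - ⟦ suc m ⟧ * ι b                  ∎

  ι-homomorphism : CommutativeRing.rawRing ℤₚ.+-*-commutativeRing -Raw-AlmostCommutative⟶ fromCommutativeRing ring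
  ι-homomorphism = record
    { ⟦_⟧ = ι ; +-homo = ι-+ ; *-homo = ι-* ; -‿homo = ι-neg ; 0-homo = refl ; 1-homo = refl }

  -- The ring solver takes its constants from ℤ, since equality of constants of 𝔽ₚ does not compute for a variable p.
  module Solver = Algebra.Solver.Ring (CommutativeRing.rawRing ℤₚ.+-*-commutativeRing) (fromCommutativeRing ring) ι-homomorphism (λ a b → Maybe.map (cong ι) (dec⇒maybe (a ℤ.≟ b)))

module PrimeFieldArithmetic (p : ℕ) .{{_ : NonZero p}} (prime : Prime p) where
  open PrimeField p
  open ≡ using (refl; sym; trans)
  open ≡-Reasoning

  1<p : 1 < p
  1<p = ℕ.nonTrivial⇒n>1 p {{prime⇒nonTrivial prime}}

  toℕ-0# : toℕ 0# ≡ 0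
  toℕ-0# = trans (toℕ-⟦⟧ 0) (m*n%n≡0 0 p)

  toℕ-1# : toℕ 1# ≡ 1
  toℕ-1# = trans (toℕ-⟦⟧ 1) (m<n⇒m%n≡m 1<p)

  toℕ≡0⇒≡0 : ∀ a → toℕ a ≡ 0 → a ≡ 0#
  toℕ≡0⇒≡0 a eq = toℕ-injective (trans eq (sym toℕ-0#))

  1≢0 : 1# ≢ 0#
  1≢0 eq with trans (sym toℕ-1#) (trans (cong toℕ eq) toℕ-0#)
  ... | ()

  ⟦n⟧≢0 : ∀ {n} → 0 < n → n < p → ⟦ n ⟧ ≢ 0#
  ⟦n⟧≢0 {n} 0<n n<p eq =
    ℕₚ.<⇒≢ 0<n (sym (trans (sym (m<n⇒m%n≡m n<p)) (trans (sym (toℕ-⟦⟧ n)) (trans (cong toℕ eq) toℕ-0#))))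

  p∣toℕ⇒≡0 : ∀ a → p ∣ toℕ a → a ≡ 0#
  p∣toℕ⇒≡0 a p∣a with toℕ a in eq
  ... | zero  = toℕ≡0⇒≡0 a eq
  ... | suc _ = ⊥-elim (ℕₚ.<⇒≱ (subst (_< p) eq (toℕ<n a)) (∣⇒≤ p∣a))

  x*y≡0⇒x≡0⊎y≡0 : ∀ a b → a * b ≡ 0# → a ≡ 0# ⊎ b ≡ 0#
  x*y≡0⇒x≡0⊎y≡0 a b ab≡0
    with euclidsLemma (toℕ a) (toℕ b) prime
           (m%n≡0⇒n∣m _ p (trans (sym (toℕ-⟦⟧ _)) (trans (cong toℕ ab≡0) toℕ-0#)))
  ... | inj₁ p∣a = inj₁ (p∣toℕ⇒≡0 a p∣a)
  ... | inj₂ p∣b = inj₂ (p∣toℕ⇒≡0 b p∣b)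

  x*y≢0 : ∀ {a b} → a ≢ 0# → b ≢ 0# → a * b ≢ 0#
  x*y≢0 {a} {b} a≢0 b≢0 ab≡0 with x*y≡0⇒x≡0⊎y≡0 a b ab≡0
  ... | inj₁ a≡0 = a≢0 a≡0
  ... | inj₂ b≡0 = b≢0 b≡0

  ⟦n!⟧≢0 : ∀ n → n < p → ⟦ n ! ⟧ ≢ 0#
  ⟦n!⟧≢0 zero    _   = 1≢0
  ⟦n!⟧≢0 (suc n) n<p eq =
    x*y≢0 (⟦n⟧≢0 (s≤s z≤n) n<p) (⟦n!⟧≢0 n (ℕₚ.<-trans (ℕₚ.n<1+n n) n<p)) (trans (sym (⟦*⟧ (suc n) (n !))) eq)

  inverse : ∀ a → a ≢ 0# → ∃ λ b → a * b ≡ 1#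
  inverse a a≢0 with coprime-Bézout (prime⇒coprime prime {{ℕ.≢-nonZero (a≢0 ∘ toℕ≡0⇒≡0 a)}} (toℕ<n a))
  ... | Bézout.-+ x y eq = ⟦ y ⟧ , (begin
    a * ⟦ y ⟧               ≡⟨ cong (_* ⟦ y ⟧) (⟦toℕ⟧ a) ⟨
    ⟦ toℕ a ⟧ * ⟦ y ⟧       ≡⟨ ⟦*⟧ (toℕ a) y ⟨
    ⟦ toℕ a ℕ.* y ⟧         ≡⟨ cong ⟦_⟧ (trans (ℕₚ.*-comm (toℕ a) y) (sym eq)) ⟩
    ⟦ 1 ℕ.+ x ℕ.* p ⟧       ≡⟨ ⟦1+m*p⟧≡1 x ⟩
    1#                      ∎)
  ... | Bézout.+- x y eq = - ⟦ y ⟧ , (begin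
    a * - ⟦ y ⟧             ≡⟨ -‿distribʳ-* a ⟦ y ⟧ ⟨
    - (a * ⟦ y ⟧)           ≡⟨ cong -_ ya≡-1 ⟩
    - - 1#                  ≡⟨ -‿involutive 1# ⟩
    1#                      ∎)
    where
    ya≡-1 : a * ⟦ y ⟧ ≡ - 1#
    ya≡-1 = inverseˡ-unique (a * ⟦ y ⟧) 1# (begin
      a * ⟦ y ⟧ + 1#                ≡⟨ +-comm _ 1# ⟩
      1# + a * ⟦ y ⟧                ≡⟨ cong (1# +_) (*-comm a ⟦ y ⟧) ⟩
      1# + ⟦ y ⟧ * a                ≡⟨ cong (λ b → 1# + ⟦ y ⟧ * b) (⟦toℕ⟧ a) ⟨
      1# + ⟦ y ⟧ * ⟦ toℕ a ⟧        ≡⟨ cong (1# +_) (⟦*⟧ y (toℕ a)) ⟨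
      ⟦ 1 ⟧ + ⟦ y ℕ.* toℕ a ⟧       ≡⟨ ⟦+⟧ 1 _ ⟨
      ⟦ 1 ℕ.+ y ℕ.* toℕ a ⟧         ≡⟨ cong ⟦_⟧ eq ⟩
      ⟦ x ℕ.* p ⟧                   ≡⟨ ⟦m*p⟧≡0 x ⟩
      0#                            ∎)

  toℕ-[-1] : toℕ (- 1#) ≡ p ∸ 1
  toℕ-[-1] = begin
    toℕ (- 1#)               ≡⟨ toℕ-⟦⟧ (p ∸ toℕ 1#) ⟩
    (p ∸ toℕ 1#) % p         ≡⟨ cong (λ n → (p ∸ n) % p) toℕ-1# ⟩
    (p ∸ 1) % p              ≡⟨ m<n⇒m%n≡m (ℕₚ.∸-monoʳ-< {p} {1} {0} (s≤s z≤n) (ℕₚ.<⇒≤ 1<p)) ⟩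
    p ∸ 1                    ∎

  toℕ-[x-1] : ∀ x m → toℕ x ≡ suc m → toℕ (x - 1#) ≡ m
  toℕ-[x-1] x m eq = begin
    toℕ (x - 1#)                   ≡⟨ toℕ-⟦⟧ (toℕ x ℕ.+ toℕ (- 1#)) ⟩
    (toℕ x ℕ.+ toℕ (- 1#)) % p     ≡⟨ cong₂ (λ a b → (a ℕ.+ b) % p) eq toℕ-[-1] ⟩
    (suc m ℕ.+ (p ∸ 1)) % p        ≡⟨ cong (_% p) (trans (sym (ℕₚ.+-suc m (p ∸ 1))) (cong (m ℕ.+_) (ℕₚ.suc-pred p))) ⟩
    (m ℕ.+ p) % p                  ≡⟨ [m+n]%n≡m%n m p ⟩
    m % p                          ≡⟨ m<n⇒m%n≡m (ℕₚ.<-trans (ℕₚ.n<1+n m) (subst (_< p) eq (toℕ<n x))) ⟩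
    m                              ∎

  toℕ-x≡1+toℕ-[x-1] : ∀ x → x ≢ 0# → toℕ x ≡ suc (toℕ (x - 1#))
  toℕ-x≡1+toℕ-[x-1] x x≢0 = split (toℕ x) refl
    where
    split : ∀ n → toℕ x ≡ n → toℕ x ≡ suc (toℕ (x - 1#))
    split zero    eq = ⊥-elim (x≢0 (toℕ≡0⇒≡0 x eq))
    split (suc m) eq = trans eq (cong suc (sym (toℕ-[x-1] x m eq)))

module PrimeFieldProduct (p : ℕ) .{{_ : NonZero p}} (prime : Prime p) where
  open PrimeField p
  open PrimeFieldArithmetic p prime
  open RingProduct ring using (Π)
  open ≡ using (sym; trans)

  Π≡0⇒∃≡0 : ∀ m (f : Fin m → F) → Π m f ≡ 0# → ∃ λ j → f j ≡ 0#
  Π≡0⇒∃≡0 zero    f Π≡0 = ⊥-elim (1≢0 Π≡0)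
  Π≡0⇒∃≡0 (suc m) f Π≡0 with x*y≡0⇒x≡0⊎y≡0 (f zero) _ (trans (sym (foldFin-suc _*_ 1# m f)) Π≡0)
  ... | inj₁ f0≡0 = zero , f0≡0
  ... | inj₂ Π≡0′ with Π≡0⇒∃≡0 m (f ∘ suc) Π≡0′
  ...   | j , fj≡0 = suc j , fj≡0

module PrimeFieldGroup (p : ℕ) .{{_ : NonZero p}} where
  open PrimeField p
  open ≡ using (refl)
  open Solver using (solve; _:+_; _:-_; _:=_; con)

  x+y-y≡x : ∀ a b → (a + b) - b ≡ a
  x+y-y≡x = solve 2 (λ a b → (a :+ b) :- b := a) refl

  x-y+y≡x : ∀ a b → (a - b) + b ≡ a
  x-y+y≡x = solve 2 (λ a b → (a :- b) :+ b := a) refl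

  x-[y+z] : ∀ a b c → a - (b + c) ≡ (a - c) - b
  x-[y+z] = solve 3 (λ a b c → a :- (b :+ c) := (a :- c) :- b) refl

  x-[x-y]≡y : ∀ a b → a - (a - b) ≡ b
  x-[x-y]≡y = solve 2 (λ a b → a :- (a :- b) := b) refl

  x+[y-x]≡y : ∀ a b → a + (b - a) ≡ b
  x+[y-x]≡y = solve 2 (λ a b → a :+ (b :- a) := b) refl

  x+y-x≡y : ∀ a b → (a + b) - a ≡ b
  x+y-x≡y = solve 2 (λ a b → (a :+ b) :- a := b) refl

  x-0≡x : ∀ a → a - 0# ≡ a
  x-0≡x = solve 1 (λ a → a :- con (ℤ.+ 0) := a) refl

  module _ (M : CommutativeMonoid 0ℓ 0ℓ) where
    open ListSum M

    Sum-shift : ∀ f b → CommutativeMonoid._≈_ M (Sum (allFin p) (λ a → f (a + b))) (Sum (allFin p) f)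
    Sum-shift f b = Sum-allFin-bijection p (_+ b) (_- b) (λ a → x-y+y≡x a b) (λ a → x+y-y≡x a b) f

    Sum-reflect : ∀ f b → CommutativeMonoid._≈_ M (Sum (allFin p) (λ a → f (b - a))) (Sum (allFin p) f)
    Sum-reflect f b = Sum-allFin-bijection p (λ a → b - a) (λ a → b - a) (x-[x-y]≡y b) (x-[x-y]≡y b) f

  group : FiniteAbelianGroup
  group = record
    { Carrier = F ; _⊕_ = _+_ ; _⊖_ = _-_ ; 𝟎 = 0# ; elements = allFin p
    ; ⊕-assoc = +-assoc ; ⊕-identityʳ = +-identityʳ ; ⊖-identityʳ = x-0≡x
    ; x⊕y⊖y≡x = x+y-y≡x ; x⊖[y⊕z] = x-[y+z] ; x⊖[x⊖y]≡y = x-[x-y]≡y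
    ; Sum-single = λ M → ListSum.Sum-allFin-single M p
    ; Sum-⊕ = Sum-shift ; Sum-⊖ = Sum-reflect }

module VectorSpace (p : ℕ) .{{_ : NonZero p}} where
  open PrimeField p
  open PrimeFieldGroup p hiding (group)
  open ≡ using (refl; sym; trans)

  V : ℕ → Set
  V = Vecₚ p

  infixl 6 _⊕_ _⊖_
  _⊕_ _⊖_ : ∀ {n} → V n → V n → V n
  _⊕_ = vadd p
  _⊖_ = vsub p

  𝟘 : ∀ n → V n
  𝟘 = vzero p

  ⊕-assoc : ∀ {n} (x y z : V n) → (x ⊕ y) ⊕ z ≡ x ⊕ (y ⊕ z)
  ⊕-assoc = Vecₚ.zipWith-assoc +-assoc

  ⊕-comm : ∀ {n} (x y : V n) → x ⊕ y ≡ y ⊕ x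
  ⊕-comm = Vecₚ.zipWith-comm +-comm

  ⊕-identityˡ : ∀ {n} (x : V n) → 𝟘 n ⊕ x ≡ x
  ⊕-identityˡ = Vecₚ.zipWith-identityˡ +-identityˡ

  ⊕-identityʳ : ∀ {n} (x : V n) → x ⊕ 𝟘 n ≡ x
  ⊕-identityʳ = Vecₚ.zipWith-identityʳ +-identityʳ

  ⊖-identityʳ : ∀ {n} (x : V n) → x ⊖ 𝟘 n ≡ x
  ⊖-identityʳ = Vecₚ.zipWith-identityʳ x-0≡x

  x⊖x≡𝟘 : ∀ {n} (x : V n) → x ⊖ x ≡ 𝟘 n
  x⊖x≡𝟘 []      = refl
  x⊖x≡𝟘 (a ∷ x) = cong₂ _∷_ (-‿inverseʳ a) (x⊖x≡𝟘 x)

  x⊕y⊖y≡x : ∀ {n} (x y : V n) → (x ⊕ y) ⊖ y ≡ x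
  x⊕y⊖y≡x []      []      = refl
  x⊕y⊖y≡x (a ∷ x) (b ∷ y) = cong₂ _∷_ (x+y-y≡x a b) (x⊕y⊖y≡x x y)

  x⊖y⊕y≡x : ∀ {n} (x y : V n) → (x ⊖ y) ⊕ y ≡ x
  x⊖y⊕y≡x []      []      = refl
  x⊖y⊕y≡x (a ∷ x) (b ∷ y) = cong₂ _∷_ (x-y+y≡x a b) (x⊖y⊕y≡x x y)

  x⊖[y⊕z] : ∀ {n} (x y z : V n) → x ⊖ (y ⊕ z) ≡ (x ⊖ z) ⊖ y
  x⊖[y⊕z] []      []      []      = refl
  x⊖[y⊕z] (a ∷ x) (b ∷ y) (c ∷ z) = cong₂ _∷_ (x-[y+z] a b c) (x⊖[y⊕z] x y z)

  x⊖[x⊖y]≡y : ∀ {n} (x y : V n) → x ⊖ (x ⊖ y) ≡ y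
  x⊖[x⊖y]≡y []      []      = refl
  x⊖[x⊖y]≡y (a ∷ x) (b ∷ y) = cong₂ _∷_ (x-[x-y]≡y a b) (x⊖[x⊖y]≡y x y)

  x⊖y≡𝟘⇒x≡y : ∀ {n} (x y : V n) → x ⊖ y ≡ 𝟘 n → x ≡ y
  x⊖y≡𝟘⇒x≡y x y eq = trans (sym (x⊖y⊕y≡x x y)) (trans (cong (_⊕ y) eq) (⊕-identityˡ y))

  _≟_ : ∀ {n} (x y : V n) → Dec (x ≡ y)
  _≟_ = Vecₚ.≡-dec _≟ᶠ_

  module _ {c ℓ} (M : CommutativeMonoid c ℓ) where
    open CommutativeMonoid M using (Carrier; _≈_)
    open ListSum M
    open import Relation.Binary.Reasoning.Setoid (CommutativeMonoid.setoid M)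

    Sum-allVecs-suc : ∀ n (f : V (suc n) → Carrier) →
                      Sum (allVecs p (suc n)) f ≈ Sum (allFin p) (λ a → Sum (allVecs p n) (λ x → f (a ∷ x)))
    Sum-allVecs-suc n f = begin
      Sum (allVecs p (suc n)) f
        ≈⟨ Sum-concatMap (λ a → map (a ∷_) (allVecs p n)) (allFin p) f ⟩
      Sum (allFin p) (λ a → Sum (map (a ∷_) (allVecs p n)) f)
        ≈⟨ Sum-cong (allFin p) (λ a → reflexive (Sum-map (a ∷_) (allVecs p n) f)) ⟩
      Sum (allFin p) (λ a → Sum (allVecs p n) (λ x → f (a ∷ x))) ∎
      where open CommutativeMonoid M using (reflexive)

    Sum-allVecs-single : ∀ n (f : V n → Carrier) (x : V n) → (∀ y → y ≢ x → f y ≈ CommutativeMonoid.ε M) →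
                         Sum (allVecs p n) f ≈ f x
    Sum-allVecs-single zero    f []      f≈ε = CommutativeMonoid.identityʳ M _
    Sum-allVecs-single (suc n) f (b ∷ x) f≈ε = begin
      Sum (allVecs p (suc n)) f                                   ≈⟨ Sum-allVecs-suc n f ⟩
      Sum (allFin p) (λ a → Sum (allVecs p n) (λ y → f (a ∷ y)))  ≈⟨ Sum-allFin-single p _ b (λ a a≢b →
                                                                       Sum-zero (allVecs p n) (λ y → f≈ε (a ∷ y) (a≢b ∘ head-≡))) ⟩
      Sum (allVecs p n) (λ y → f (b ∷ y))                         ≈⟨ Sum-allVecs-single n (λ y → f (b ∷ y)) x (λ y y≢x →
                                                                       f≈ε (b ∷ y) (y≢x ∘ tail-≡)) ⟩
      f (b ∷ x)                                                   ∎
      where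
      head-≡ : ∀ {a b} {y z : V n} → a ∷ y ≡ b ∷ z → a ≡ b
      head-≡ = proj₁ ∘ Vecₚ.∷-injective
      tail-≡ : ∀ {a b} {y z : V n} → a ∷ y ≡ b ∷ z → y ≡ z
      tail-≡ = proj₂ ∘ Vecₚ.∷-injective

    Sum-allVecs-bijection : (op op⁻¹ : F → F → F) → (∀ a b → op b (op⁻¹ b a) ≡ a) → (∀ a b → op⁻¹ b (op b a) ≡ a) →
                            ∀ n (x : V n) (f : V n → Carrier) →
                            Sum (allVecs p n) (λ y → f (zipWith op x y)) ≈ Sum (allVecs p n) f
    Sum-allVecs-bijection op op⁻¹ inv₁ inv₂ zero    []      f = CommutativeMonoid.refl M
    Sum-allVecs-bijection op op⁻¹ inv₁ inv₂ (suc n) (b ∷ x) f = begin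
      Sum (allVecs p (suc n)) (λ y → f (zipWith op (b ∷ x) y))
        ≈⟨ Sum-allVecs-suc n _ ⟩
      Sum (allFin p) (λ a → Sum (allVecs p n) (λ y → f (op b a ∷ zipWith op x y)))
        ≈⟨ Sum-cong (allFin p) (λ a → Sum-allVecs-bijection op op⁻¹ inv₁ inv₂ n x (λ y → f (op b a ∷ y))) ⟩
      Sum (allFin p) (λ a → Sum (allVecs p n) (λ y → f (op b a ∷ y)))
        ≈⟨ Sum-allFin-bijection p (op b) (op⁻¹ b) (λ a → inv₁ a b) (λ a → inv₂ a b) (λ a → Sum (allVecs p n) (λ y → f (a ∷ y))) ⟩
      Sum (allFin p) (λ a → Sum (allVecs p n) (λ y → f (a ∷ y)))
        ≈⟨ Sum-allVecs-suc n f ⟨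
      Sum (allVecs p (suc n)) f ∎

    Sum-allVecs-⊕ : ∀ n (f : V n → Carrier) (x : V n) → Sum (allVecs p n) (λ y → f (y ⊕ x)) ≈ Sum (allVecs p n) f
    Sum-allVecs-⊕ n f x = begin
      Sum (allVecs p n) (λ y → f (y ⊕ x))  ≈⟨ Sum-cong (allVecs p n) (λ y → CommutativeMonoid.reflexive M (cong f (⊕-comm y x))) ⟩
      Sum (allVecs p n) (λ y → f (x ⊕ y))  ≈⟨ Sum-allVecs-bijection _+_ (λ b a → a - b) (λ a b → x+[y-x]≡y b a) (λ a b → x+y-x≡y b a) n x f ⟩
      Sum (allVecs p n) f                  ∎

    Sum-allVecs-⊖ : ∀ n (f : V n → Carrier) (x : V n) → Sum (allVecs p n) (λ y → f (x ⊖ y)) ≈ Sum (allVecs p n) f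
    Sum-allVecs-⊖ n f x = Sum-allVecs-bijection _-_ _-_ (λ a b → x-[x-y]≡y b a) (λ a b → x-[x-y]≡y b a) n x f

  group : ℕ → FiniteAbelianGroup
  group n = record
    { Carrier = V n ; _⊕_ = _⊕_ ; _⊖_ = _⊖_ ; 𝟎 = 𝟘 n ; elements = allVecs p n
    ; ⊕-assoc = ⊕-assoc ; ⊕-identityʳ = ⊕-identityʳ ; ⊖-identityʳ = ⊖-identityʳ
    ; x⊕y⊖y≡x = x⊕y⊖y≡x ; x⊖[y⊕z] = x⊖[y⊕z] ; x⊖[x⊖y]≡y = x⊖[x⊖y]≡y
    ; Sum-single = λ M → Sum-allVecs-single M n
    ; Sum-⊕ = λ M → Sum-allVecs-⊕ M n ; Sum-⊖ = λ M → Sum-allVecs-⊖ M n }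

module InnerProduct (p : ℕ) .{{_ : NonZero p}} where
  open PrimeField p
  open VectorSpace p using (V; _⊕_; _⊖_; 𝟘)
  open RingListSum ring
  open ≡ using (refl; sym; trans)
  open ≡-Reasoning

  infix 7 _·_
  _·_ : ∀ {n} → V n → V n → F
  _·_ {n} x u = sumₚ p n (λ j → lookup x j * lookup u j)

  lookup-basis-≡ : ∀ {n} (i : Fin n) → lookup (basis p n i) i ≡ 1#
  lookup-basis-≡ {n} i rewrite (lookup (basis p n i) i ≡ _ ∋ Vecₚ.lookup∘tabulate _ i) with i ≟ᶠ i
  ... | yes _   = refl
  ... | no  i≢i = ⊥-elim (i≢i refl)

  lookup-basis-≢ : ∀ {n} {i j : Fin n} → i ≢ j → lookup (basis p n i) j ≡ 0#
  lookup-basis-≢ {n} {i} {j} i≢j rewrite (lookup (basis p n i) j ≡ _ ∋ Vecₚ.lookup∘tabulate _ j) with i ≟ᶠ j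
  ... | yes i≡j = ⊥-elim (i≢j i≡j)
  ... | no  _   = refl

  ·-cons : ∀ {n} a b (x u : V n) → (a ∷ x) · (b ∷ u) ≡ a * b + x · u
  ·-cons {n} a b x u = Sum-allFin-suc n _

  ·-⊕ʳ : ∀ {n} (x y w : V n) → x · (y ⊕ w) ≡ x · y + x · w
  ·-⊕ʳ {n} x y w = begin
    Sum (allFin n) (λ j → lookup x j * lookup (y ⊕ w) j)
      ≡⟨ Sum-cong (allFin n) (λ j → trans (cong (lookup x j *_) (Vecₚ.lookup-zipWith _ j y w)) (*-distribˡ-+ (lookup x j) _ _)) ⟩
    Sum (allFin n) (λ j → lookup x j * lookup y j + lookup x j * lookup w j)
      ≡⟨ Sum-+ (allFin n) _ _ ⟩
    x · y + x · w ∎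

  ·-⊖ʳ : ∀ {n} (x w v : V n) → x · (w ⊖ v) ≡ x · w - x · v
  ·-⊖ʳ {n} x w v = begin
    Sum (allFin n) (λ j → lookup x j * lookup (w ⊖ v) j)
      ≡⟨ Sum-cong (allFin n) (λ j → trans (cong (lookup x j *_) (Vecₚ.lookup-zipWith _ j w v))
                                   (trans (*-distribˡ-+ (lookup x j) _ _) (cong (lookup x j * lookup w j +_) (sym (-‿distribʳ-* (lookup x j) (lookup v j)))))) ⟩
    Sum (allFin n) (λ j → lookup x j * lookup w j + - (lookup x j * lookup v j))
      ≡⟨ Sum-+ (allFin n) _ _ ⟩
    x · w + Sum (allFin n) (λ j → - (lookup x j * lookup v j))
      ≡⟨ cong (x · w +_) (Sum-neg (allFin n) _) ⟨
    x · w - x · v ∎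

  ·-𝟘ʳ : ∀ {n} (x : V n) → x · 𝟘 n ≡ 0#
  ·-𝟘ʳ {n} x = Sum-zero (allFin n) (λ j → trans (cong (lookup x j *_) (Vecₚ.lookup-replicate j 0#)) (zeroʳ (lookup x j)))

  ·-basis : ∀ {n} (x : V n) (i : Fin n) → x · basis p n i ≡ lookup x i
  ·-basis {n} x i = begin
    Sum (allFin n) (λ j → lookup x j * lookup (basis p n i) j)
      ≡⟨ Sum-allFin-single n _ i (λ j j≢i → trans (cong (lookup x j *_) (lookup-basis-≢ (j≢i ∘ sym))) (zeroʳ (lookup x j))) ⟩
    lookup x i * lookup (basis p n i) i
      ≡⟨ trans (cong (lookup x i *_) (lookup-basis-≡ i)) (*-identityʳ (lookup x i)) ⟩
    lookup x i ∎

  ·-row : ∀ {n} (x : V n) (M : Matrix p n) i → x · row p n M i ≡ matVec p n M x i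
  ·-row {n} x M i = Sum-cong (allFin n) (λ j → trans (cong (lookup x j *_) (Vecₚ.lookup∘tabulate (M i) j)) (*-comm (lookup x j) (M i j)))

module ScaledGenerators (p : ℕ) .{{_ : NonZero p}} (R : RawRing 0ℓ 0ℓ) (n : ℕ) where
  open GroupRing p R n
  open ≡ using (refl)

  scaledGen-≡ : ∀ r v → scaledGen r v v ≡ r
  scaledGen-≡ r v with Vecₚ.≡-dec _≟ᶠ_ v v
  ... | yes _   = refl
  ... | no  v≢v = ⊥-elim (v≢v refl)

  scaledGen-≢ : ∀ r v w → w ≢ v → scaledGen r v w ≡ RawRing.0# R
  scaledGen-≢ r v w w≢v with Vecₚ.≡-dec _≟ᶠ_ w v
  ... | yes w≡v = ⊥-elim (w≢v w≡v)
  ... | no  _   = refl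

-- The ring ℤ[ω] and the characters of 𝔽ₚⁿ

module CyclotomicIntegers (p : ℕ) .{{_ : NonZero p}} (prime : Prime p) where
  open RawRing (ZωRing p) using (_+_; _*_; -_; 0#; 1#)
  open ≡ using (refl; sym; trans)
  private
    module 𝔽 = PrimeField p
    module ℤ[𝔽ₚ] = GroupAlgebra ℤₚ.+-*-commutativeRing (PrimeFieldGroup.group p)
    module ℤΣ = RingListSum ℤₚ.+-*-commutativeRing
    open ℤ-Solver using (solve; _:+_; _:-_; _:=_; :-_)

  Vanishes : Zω p → Set
  Vanishes z = ∀ k l → z k ≡ z l

  -- The equality of ZωRing, wrapped in a record so that a and b can be inferred from a proof of a ≈ b.
  infix 4 _≈_
  record _≈_ (a b : Zω p) : Set where
    constructor mk≈
    field difference-vanishes : Vanishes (λ k → a k ℤ.- b k)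
  open _≈_ public

  ≗⇒≈ : ∀ {a b} → (∀ k → a k ≡ b k) → a ≈ b
  ≗⇒≈ {a} {b} a≗b = mk≈ λ k l → trans (a-b≡0 k) (sym (a-b≡0 l))
    where
    a-b≡0 : ∀ k → a k ℤ.- b k ≡ ℤ.+ 0
    a-b≡0 k = trans (cong (ℤ._- b k) (a≗b k)) (ℤₚ.+-inverseʳ (b k))

  Vanishes⇒≈0 : ∀ {a} → Vanishes a → a ≈ 0#
  Vanishes⇒≈0 {a} a-const = mk≈ λ k l → trans (ℤₚ.+-identityʳ (a k)) (trans (a-const k l) (sym (ℤₚ.+-identityʳ (a l))))

  ≈0⇒Vanishes : ∀ {a} → a ≈ 0# → Vanishes a
  ≈0⇒Vanishes {a} (mk≈ a≈0) k l = trans (sym (ℤₚ.+-identityʳ (a k))) (trans (a≈0 k l) (ℤₚ.+-identityʳ (a l)))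

  *-distribʳ-minus : ∀ a b c k → ((λ j → a j ℤ.- b j) * c) k ≡ (a * c) k ℤ.- (b * c) k
  *-distribʳ-minus a b c k = begin
    ℤΣ.Sum (allFin p) (λ j → (a j ℤ.- b j) ℤ.* c (k 𝔽.- j))
      ≡⟨ ℤΣ.Sum-cong (allFin p) (λ j → trans (ℤₚ.*-distribʳ-+ _ (a j) _) (cong (λ x → a j ℤ.* c (k 𝔽.- j) ℤ.+ x) (sym (ℤₚ.neg-distribˡ-* (b j) _)))) ⟩
    ℤΣ.Sum (allFin p) (λ j → a j ℤ.* c (k 𝔽.- j) ℤ.+ ℤ.- (b j ℤ.* c (k 𝔽.- j)))
      ≡⟨ ℤΣ.Sum-+ (allFin p) _ _ ⟩
    (a * c) k ℤ.+ ℤΣ.Sum (allFin p) (λ j → ℤ.- (b j ℤ.* c (k 𝔽.- j)))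
      ≡⟨ cong (λ x → (a * c) k ℤ.+ x) (sym (ℤΣ.Sum-neg (allFin p) _)) ⟩
    (a * c) k ℤ.- (b * c) k ∎
    where open ≡-Reasoning

  private
    Vanishes-* : ∀ a b → Vanishes a → Vanishes (a * b)
    Vanishes-* a b a-const k l = trans (*-const k) (sym (*-const l))
      where
      *-const : ∀ k → (a * b) k ≡ a 𝔽.0# ℤ.* ℤΣ.Sum (allFin p) b
      *-const k = trans (ℤΣ.Sum-cong (allFin p) (λ j → cong (ℤ._* b (k 𝔽.- j)) (a-const j 𝔽.0#)))
                  (trans (sym (ℤΣ.Sum-*ˡ (allFin p) (a 𝔽.0#) (λ j → b (k 𝔽.- j))))
                         (cong (a 𝔽.0# ℤ.*_) (PrimeFieldGroup.Sum-reflect p (CommutativeRing.+-commutativeMonoid ℤₚ.+-*-commutativeRing) b k)))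

    ≈-refl : ∀ {a} → a ≈ a
    ≈-refl = ≗⇒≈ (λ _ → refl)

    ≈-sym : ∀ {a b} → a ≈ b → b ≈ a
    ≈-sym {a} {b} (mk≈ a≈b) = mk≈ λ k l → trans (swap (a k) (b k)) (trans (cong ℤ.-_ (a≈b k l)) (sym (swap (a l) (b l))))
      where
      swap : ∀ x y → y ℤ.- x ≡ ℤ.- (x ℤ.- y)
      swap = solve 2 (λ x y → y :- x := :- (x :- y)) refl

    ≈-trans : ∀ {a b c} → a ≈ b → b ≈ c → a ≈ c
    ≈-trans {a} {b} {c} (mk≈ a≈b) (mk≈ b≈c) = mk≈ λ k l →
      trans (split (a k) (b k) (c k)) (trans (cong₂ ℤ._+_ (a≈b k l) (b≈c k l)) (sym (split (a l) (b l) (c l))))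
      where
      split : ∀ x y z → x ℤ.- z ≡ (x ℤ.- y) ℤ.+ (y ℤ.- z)
      split = solve 3 (λ x y z → x :- z := (x :- y) :+ (y :- z)) refl

    +-cong : ∀ {a b c d} → a ≈ b → c ≈ d → a + c ≈ b + d
    +-cong {a} {b} {c} {d} (mk≈ a≈b) (mk≈ c≈d) = mk≈ λ k l →
      trans (split (a k) (b k) (c k) (d k)) (trans (cong₂ ℤ._+_ (a≈b k l) (c≈d k l)) (sym (split (a l) (b l) (c l) (d l))))
      where
      split : ∀ x y z w → (x ℤ.+ z) ℤ.- (y ℤ.+ w) ≡ (x ℤ.- y) ℤ.+ (z ℤ.- w)
      split = solve 4 (λ x y z w → (x :+ z) :- (y :+ w) := (x :- y) :+ (z :- w)) refl

    -‿cong : ∀ {a b} → a ≈ b → - a ≈ - b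
    -‿cong {a} {b} (mk≈ a≈b) = mk≈ λ k l → trans (split (a k) (b k)) (trans (cong ℤ.-_ (a≈b k l)) (sym (split (a l) (b l))))
      where
      split : ∀ x y → ℤ.- x ℤ.- ℤ.- y ≡ ℤ.- (x ℤ.- y)
      split = solve 2 (λ x y → :- x :- :- y := :- (x :- y)) refl

    *-congʳ : ∀ {a b} c → a ≈ b → a * c ≈ b * c
    *-congʳ {a} {b} c (mk≈ a≈b) = mk≈ λ k l →
      trans (sym (*-distribʳ-minus a b c k)) (trans (Vanishes-* _ c a≈b k l) (*-distribʳ-minus a b c l))

    *-cong : ∀ {a b c d} → a ≈ b → c ≈ d → a * c ≈ b * d
    *-cong {a} {b} {c} {d} a≈b c≈d =
      ≈-trans (*-congʳ c a≈b) (≈-trans (≗⇒≈ (ℤ[𝔽ₚ].⋆-comm b c)) (≈-trans (*-congʳ b c≈d) (≗⇒≈ (ℤ[𝔽ₚ].⋆-comm d b))))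

  ω^_ : Fp p → Zω p
  ω^_ = ωpow p

  ω^-isScaledGen : ∀ c → ℤ[𝔽ₚ].IsScaledGen (ω^ c) c (ℤ.+ 1)
  ω^-isScaledGen c = self , other
    where
    self : (ω^ c) c ≡ ℤ.+ 1
    self with c ≟ᶠ c
    ... | yes _   = refl
    ... | no  c≢c = ⊥-elim (c≢c refl)
    other : ∀ k → k ≢ c → (ω^ c) k ≡ ℤ.+ 0
    other k k≢c with k ≟ᶠ c
    ... | yes k≡c = ⊥-elim (k≢c k≡c)
    ... | no  _   = refl

  ℤ[ω] : CommutativeRing 0ℓ 0ℓ
  ℤ[ω] = record
    { Carrier = Zω p ; _≈_ = _≈_ ; _+_ = _+_ ; _*_ = _*_ ; -_ = -_ ; 0# = 0# ; 1# = 1#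
    ; isCommutativeRing = record
      { isRing = record
        { +-isAbelianGroup = record
          { isGroup = record
            { isMonoid = record
              { isSemigroup = record
                { isMagma = record
                  { isEquivalence = record { refl = ≈-refl ; sym = ≈-sym ; trans = ≈-trans }
                  ; ∙-cong = +-cong }
                ; assoc = λ a b c → ≗⇒≈ (λ k → ℤₚ.+-assoc (a k) (b k) (c k)) }
              ; identity = (λ a → ≗⇒≈ (λ k → ℤₚ.+-identityˡ (a k))) , (λ a → ≗⇒≈ (λ k → ℤₚ.+-identityʳ (a k))) }
            ; inverse = (λ a → ≗⇒≈ (λ k → ℤₚ.+-inverseˡ (a k))) , (λ a → ≗⇒≈ (λ k → ℤₚ.+-inverseʳ (a k)))
            ; ⁻¹-cong = -‿cong }
          ; comm = λ a b → ≗⇒≈ (λ k → ℤₚ.+-comm (a k) (b k)) }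
        ; *-cong = *-cong
        ; *-assoc = λ a b c → ≗⇒≈ (ℤ[𝔽ₚ].⋆-assoc a b c)
        ; *-identity = (λ a → ≗⇒≈ (*-identityˡ a)) , (λ a → ≗⇒≈ (λ k → trans (ℤ[𝔽ₚ].⋆-comm a 1# k) (*-identityˡ a k)))
        ; distrib = (λ a b c → ≗⇒≈ (ℤ[𝔽ₚ].⋆-distribˡ a b c))
                  , (λ a b c → ≗⇒≈ (λ k → trans (ℤ[𝔽ₚ].⋆-comm (b + c) a k) (trans (ℤ[𝔽ₚ].⋆-distribˡ a b c k)
                                            (cong₂ ℤ._+_ (ℤ[𝔽ₚ].⋆-comm a b k) (ℤ[𝔽ₚ].⋆-comm a c k))))) }
      ; *-comm = λ a b → ≗⇒≈ (ℤ[𝔽ₚ].⋆-comm a b) } }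
    where
    *-identityˡ : ∀ a k → (1# * a) k ≡ a k
    *-identityˡ = ℤ[𝔽ₚ].⋆-identityˡ (ω^-isScaledGen 𝔽.0#)

module CyclotomicIntegerProperties (p : ℕ) .{{_ : NonZero p}} (prime : Prime p) where
  open CyclotomicIntegers p prime
  open CommutativeRing ℤ[ω] hiding (_≈_)
  private module ≈-Reasoning = Relation.Binary.Reasoning.Setoid setoid
  private
    module 𝔽 = PrimeField p
    module 𝔽ₚ = PrimeFieldArithmetic p prime
    open ℤ-Solver using (solve; _:+_; _:-_; _:=_; :-_; con)
    module ℤ[𝔽ₚ] = GroupAlgebra ℤₚ.+-*-commutativeRing (PrimeFieldGroup.group p)

  ω^-⋆ : ∀ a t k → (ω^ a * t) k ≡ t (k 𝔽.- a)
  ω^-⋆ a t k = ≡.trans (ℤ[𝔽ₚ].⟨⟩-scaledGen (ω^-isScaledGen a) (λ j → t (k 𝔽.- j))) (ℤₚ.*-identityˡ (t (k 𝔽.- a)))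

  ω^-+ : ∀ a b → ω^ (a 𝔽.+ b) ≈ ω^ a * ω^ b
  ω^-+ a b = ≗⇒≈ (λ k → ≡.trans (pointwise k) (≡.sym (ω^-⋆ a (ω^ b) k)))
    where
    pointwise : ∀ k → (ω^ (a 𝔽.+ b)) k ≡ (ω^ b) (k 𝔽.- a)
    pointwise k with k ≟ᶠ a 𝔽.+ b | k 𝔽.- a ≟ᶠ b
    ... | yes _   | yes _   = ≡.refl
    ... | no  _   | no  _   = ≡.refl
    ... | yes k≡  | no  k-a≢ = ⊥-elim (k-a≢ (≡.trans (cong (𝔽._- a) k≡) (PrimeFieldGroup.x+y-x≡y p a b)))
    ... | no  k≢  | yes k-a≡ = ⊥-elim (k≢ (≡.trans (≡.sym (PrimeFieldGroup.x-y+y≡x p k a))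
                                         (≡.trans (cong (𝔽._+ a) k-a≡) (𝔽.+-comm b a))))

  int : ℤ → Carrier
  int N k = N ℤ.* 1# k

  int-isScaledGen : ∀ N → ℤ[𝔽ₚ].IsScaledGen (int N) 𝔽.0# N
  int-isScaledGen N = ≡.trans (cong (N ℤ.*_) (proj₁ (ω^-isScaledGen 𝔽.0#))) (ℤₚ.*-identityʳ N)
                    , λ k k≢0 → ≡.trans (cong (N ℤ.*_) (proj₂ (ω^-isScaledGen 𝔽.0#) k k≢0)) (ℤₚ.*-zeroʳ N)

  int-⋆ : ∀ N a k → (int N * a) k ≡ N ℤ.* a k
  int-⋆ N a k = ≡.trans (ℤ[𝔽ₚ].⟨⟩-scaledGen (int-isScaledGen N) (λ j → a (k 𝔽.- j)))
                        (cong (λ j → N ℤ.* a j) (PrimeFieldGroup.x-0≡x p k))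

  int-* : ∀ M N → int M * int N ≈ int (M ℤ.* N)
  int-* M N = ≗⇒≈ (λ k → ≡.trans (int-⋆ M (int N) k) (≡.sym (ℤₚ.*-assoc M N (1# k))))

  int-1 : int (ℤ.+ 1) ≈ 1#
  int-1 = ≗⇒≈ (λ k → ℤₚ.*-identityˡ (1# k))

  int≉0 : ∀ {N} → N ≢ ℤ.+ 0 → ¬ int N ≈ 0#
  int≉0 {N} N≢0 intN≈0 = N≢0 (≡.trans (≡.sym (proj₁ (int-isScaledGen N)))
                               (≡.trans (≈0⇒Vanishes intN≈0 𝔽.0# 𝔽.1#) (proj₂ (int-isScaledGen N) 𝔽.1# 𝔽ₚ.1≢0)))

  int*x≈0⇒x≈0 : ∀ {N} a → N ≢ ℤ.+ 0 → int N * a ≈ 0# → a ≈ 0#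
  int*x≈0⇒x≈0 {N} a N≢0 Na≈0 = Vanishes⇒≈0 λ k l → ℤₚ.*-cancelˡ-≡ N (a k) (a l) {{ℤ.≢-nonZero N≢0}}
    (≡.trans (≡.sym (int-⋆ N a k)) (≡.trans (≈0⇒Vanishes Na≈0 k l) (int-⋆ N a l)))

  -- A multiplicatively closed certificate of a ≉ 0, as ℤ[ω] is not known here to be a domain.
  record DividesNonzeroInteger (a : Carrier) : Set where
    constructor divides
    field
      {cofactor} : Carrier
      {integer}  : ℤ
      integer≢0  : integer ≢ ℤ.+ 0
      a*cofactor≈integer : a * cofactor ≈ int integer

  DividesNonzeroInteger-cong : ∀ {a b} → a ≈ b → DividesNonzeroInteger a → DividesNonzeroInteger b
  DividesNonzeroInteger-cong {a} {b} a≈b (divides {w} {N} N≢0 aw≈N) = divides {cofactor = w} N≢0 (begin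
    b * w       ≈⟨ *-congʳ {w} (sym a≈b) ⟩
    a * w       ≈⟨ aw≈N ⟩
    int N       ∎)
    where open ≈-Reasoning

  DividesNonzeroInteger-1 : DividesNonzeroInteger 1#
  DividesNonzeroInteger-1 = divides {cofactor = 1#} {integer = ℤ.+ 1} (λ ()) (begin
    1# * 1#          ≈⟨ *-identityˡ 1# ⟩
    1#               ≈⟨ int-1 ⟨
    int (ℤ.+ 1)      ∎)
    where open ≈-Reasoning

  DividesNonzeroInteger-* : ∀ {a b} → DividesNonzeroInteger a → DividesNonzeroInteger b → DividesNonzeroInteger (a * b)
  DividesNonzeroInteger-* {a} {b} (divides {v} {M} M≢0 av≈M) (divides {w} {N} N≢0 bw≈N) = divides {cofactor = v * w} MN≢0 (begin
    (a * b) * (v * w)     ≈⟨ interchange a b v w ⟩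
    (a * v) * (b * w)     ≈⟨ *-cong av≈M bw≈N ⟩
    int M * int N         ≈⟨ int-* M N ⟩
    int (M ℤ.* N)         ∎)
    where
    open ≈-Reasoning
    open import Algebra.Properties.CommutativeSemigroup *-commutativeSemigroup using (interchange)
    MN≢0 : M ℤ.* N ≢ ℤ.+ 0
    MN≢0 MN≡0 with ℤₚ.i*j≡0⇒i≡0∨j≡0 M MN≡0
    ... | inj₁ M≡0 = M≢0 M≡0
    ... | inj₂ N≡0 = N≢0 N≡0

  DividesNonzeroInteger⇒≉0 : ∀ {a} → DividesNonzeroInteger a → ¬ a ≈ 0#
  DividesNonzeroInteger⇒≉0 {a} (divides {w} {N} N≢0 aw≈N) a≈0 = int≉0 N≢0 (begin
    int N       ≈⟨ aw≈N ⟨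
    a * w       ≈⟨ *-congʳ {w} a≈0 ⟩
    0# * w      ≈⟨ zeroˡ w ⟩
    0#          ∎)
    where open ≈-Reasoning

  private
    module Telescoping {a b : 𝔽.F} (ab≡1 : a 𝔽.* b ≡ 𝔽.1#) where
      t : Carrier
      t k = ℤ.+ toℕ (k 𝔽.* b)

      [k-a]b≡kb-1 : ∀ k → (k 𝔽.- a) 𝔽.* b ≡ k 𝔽.* b 𝔽.- 𝔽.1#
      [k-a]b≡kb-1 k = ≡.trans (𝔽.*-distribʳ-+ b k (𝔽.- a)) (cong (k 𝔽.* b 𝔽.+_) (≡.trans (≡.sym (𝔽.-‿distribˡ-* a b)) (cong 𝔽.-_ ab≡1)))

      telescope : ∀ k → ((1# - ω^ a) * t) k ≡ t k ℤ.- t (k 𝔽.- a)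
      telescope k = ≡.trans (*-distribʳ-minus 1# (ω^ a) t k)
                            (cong₂ ℤ._-_ (ℤ[𝔽ₚ].⋆-identityˡ (ω^-isScaledGen 𝔽.0#) t k) (ω^-⋆ a t k))

      b≢0 : b ≢ 𝔽.0#
      b≢0 b≡0 = 𝔽ₚ.1≢0 (≡.trans (≡.sym ab≡1) (≡.trans (cong (a 𝔽.*_) b≡0) (𝔽.zeroʳ a)))

      p≡1+[p-1] : ℤ.+ p ≡ ℤ.+ 1 ℤ.+ ℤ.+ (p ∸ 1)
      p≡1+[p-1] = ≡.trans (cong ℤ.+_ (≡.sym (ℕₚ.suc-pred p))) (ℤₚ.pos-+ 1 (p ∸ 1))

      Difference : Fp p → Set
      Difference k = ((1# - ω^ a) * t) k ℤ.- int (ℤ.- ℤ.+ p) k ≡ ℤ.+ 1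

      difference-0 : Difference 𝔽.0#
      difference-0 = begin
        ((1# - ω^ a) * t) 𝔽.0# ℤ.- int (ℤ.- ℤ.+ p) 𝔽.0#
          ≡⟨ cong₂ ℤ._-_ (telescope 𝔽.0#) (proj₁ (int-isScaledGen (ℤ.- ℤ.+ p))) ⟩
        (t 𝔽.0# ℤ.- t (𝔽.0# 𝔽.- a)) ℤ.- ℤ.- ℤ.+ p
          ≡⟨ cong₂ (λ x y → (x ℤ.- y) ℤ.- ℤ.- ℤ.+ p) t0≡0 t[-a]≡p-1 ⟩
        (ℤ.+ 0 ℤ.- ℤ.+ (p ∸ 1)) ℤ.- ℤ.- ℤ.+ p
          ≡⟨ cong (λ x → (ℤ.+ 0 ℤ.- ℤ.+ (p ∸ 1)) ℤ.- ℤ.- x) p≡1+[p-1] ⟩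
        (ℤ.+ 0 ℤ.- ℤ.+ (p ∸ 1)) ℤ.- ℤ.- (ℤ.+ 1 ℤ.+ ℤ.+ (p ∸ 1))
          ≡⟨ solve 1 (λ q → (con (ℤ.+ 0) :- q) :- :- (con (ℤ.+ 1) :+ q) := con (ℤ.+ 1)) ≡.refl (ℤ.+ (p ∸ 1)) ⟩
        ℤ.+ 1 ∎
        where
        open ≡-Reasoning
        t0≡0 : t 𝔽.0# ≡ ℤ.+ 0
        t0≡0 = cong ℤ.+_ (≡.trans (cong toℕ (𝔽.zeroˡ b)) 𝔽ₚ.toℕ-0#)
        t[-a]≡p-1 : t (𝔽.0# 𝔽.- a) ≡ ℤ.+ (p ∸ 1)
        t[-a]≡p-1 = cong ℤ.+_ (≡.trans (cong toℕ (≡.trans ([k-a]b≡kb-1 𝔽.0#)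
                      (≡.trans (cong (𝔽._- 𝔽.1#) (𝔽.zeroˡ b)) (𝔽.+-identityˡ (𝔽.- 𝔽.1#))))) 𝔽ₚ.toℕ-[-1])

      difference-≢0 : ∀ k → k ≢ 𝔽.0# → Difference k
      difference-≢0 k k≢0 = begin
        ((1# - ω^ a) * t) k ℤ.- int (ℤ.- ℤ.+ p) k
          ≡⟨ cong₂ ℤ._-_ (telescope k) (proj₂ (int-isScaledGen (ℤ.- ℤ.+ p)) k k≢0) ⟩
        (t k ℤ.- t (k 𝔽.- a)) ℤ.- ℤ.+ 0
          ≡⟨ cong₂ (λ x y → (x ℤ.- y) ℤ.- ℤ.+ 0) tk≡1+m (cong (λ x → ℤ.+ toℕ x) ([k-a]b≡kb-1 k)) ⟩
        (ℤ.+ 1 ℤ.+ m) ℤ.- m ℤ.- ℤ.+ 0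
          ≡⟨ solve 1 (λ m → (con (ℤ.+ 1) :+ m) :- m :- con (ℤ.+ 0) := con (ℤ.+ 1)) ≡.refl m ⟩
        ℤ.+ 1 ∎
        where
        open ≡-Reasoning
        m : ℤ
        m = ℤ.+ toℕ (k 𝔽.* b 𝔽.- 𝔽.1#)
        tk≡1+m : t k ≡ ℤ.+ 1 ℤ.+ m
        tk≡1+m = ≡.trans (cong ℤ.+_ (𝔽ₚ.toℕ-x≡1+toℕ-[x-1] (k 𝔽.* b) (𝔽ₚ.x*y≢0 k≢0 b≢0))) (ℤₚ.pos-+ 1 _)

      difference : ∀ k → Difference k
      difference k = by-cases (k ≟ᶠ 𝔽.0#)
        where
        by-cases : Dec (k ≡ 𝔽.0#) → Difference k
        by-cases (yes k≡0) = subst Difference (≡.sym k≡0) difference-0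
        by-cases (no  k≢0) = difference-≢0 k k≢0

      [1-ω^a]t≈-p : (1# - ω^ a) * t ≈ int (ℤ.- ℤ.+ p)
      [1-ω^a]t≈-p = mk≈ (λ k l → ≡.trans (difference k) (≡.sym (difference l)))

  -- With t = Σₖ [k/a] ωᵏ ([x] the least residue of x), the product (1 - ωᵃ) t telescopes to (1 + ω + ⋯ + ωᵖ⁻¹) - p.
  1-ω^a∣p : ∀ a → a ≢ 𝔽.0# → DividesNonzeroInteger (1# - ω^ a)
  1-ω^a∣p a a≢0 with 𝔽ₚ.inverse a a≢0
  ... | b , ab≡1 = divides {cofactor = Telescoping.t {a} ab≡1} -p≢0 (Telescoping.[1-ω^a]t≈-p {a} ab≡1)
    where
    -p≢0 : ℤ.- ℤ.+ p ≢ ℤ.+ 0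
    -p≢0 -p≡0 = ℕ.≢-nonZero⁻¹ p (ℤₚ.+-injective (ℤₚ.neg-injective -p≡0))

module CharacterSums (p : ℕ) .{{_ : NonZero p}} (prime : Prime p) where
  open CyclotomicIntegers p prime using (ℤ[ω]; ω^_; _≈_; ≗⇒≈; Vanishes⇒≈0; ω^-isScaledGen)
  open CyclotomicIntegerProperties p prime
  open CommutativeRing ℤ[ω] hiding (_≈_)
  open RingListSum ℤ[ω]
  open VectorSpace p using (V; 𝟘)
  open InnerProduct p
  private module ≈-Reasoning = Relation.Binary.Reasoning.Setoid setoid
  private
    module 𝔽 = PrimeField p
    module 𝔽ₚ = PrimeFieldArithmetic p prime
    module ℤΣ = RingListSum ℤₚ.+-*-commutativeRing

  Sum-pointwise : ∀ {A : Set} (xs : List A) (f : A → Carrier) k → Sum xs f k ≡ ℤΣ.Sum xs (λ x → f x k)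
  Sum-pointwise []       f k = ≡.refl
  Sum-pointwise (x ∷ xs) f k = cong (λ z → f x k ℤ.+ z) (Sum-pointwise xs f k)

  private
    ℤΣ-const : ∀ {A : Set} (xs : List A) y → ℤΣ.Sum xs (λ _ → y) ≡ ℤ.+ length xs ℤ.* y
    ℤΣ-const []       y = ≡.refl
    ℤΣ-const (x ∷ xs) y = ≡.trans (cong (λ z → y ℤ.+ z) (ℤΣ-const xs y))
                          (≡.trans (cong (ℤ._+ (ℤ.+ length xs ℤ.* y)) (≡.sym (ℤₚ.*-identityˡ y)))
                                   (≡.sym (ℤₚ.*-distribʳ-+ y (ℤ.+ 1) (ℤ.+ length xs))))

  geometricSum : 𝔽.F → Carrier
  geometricSum b = Sum (allFin p) (λ a → ω^ (a 𝔽.* b))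

  geometricSum-0 : geometricSum 𝔽.0# ≈ int (ℤ.+ p)
  geometricSum-0 = ≗⇒≈ λ k → begin
    geometricSum 𝔽.0# k                            ≡⟨ Sum-pointwise (allFin p) _ k ⟩
    ℤΣ.Sum (allFin p) (λ a → (ω^ (a 𝔽.* 𝔽.0#)) k)  ≡⟨ ℤΣ.Sum-cong (allFin p) (λ a → cong (λ c → (ω^ c) k) (𝔽.zeroʳ a)) ⟩
    ℤΣ.Sum (allFin p) (λ _ → 1# k)                 ≡⟨ ℤΣ-const (allFin p) (1# k) ⟩
    ℤ.+ length (allFin p) ℤ.* 1# k                 ≡⟨ cong (λ m → ℤ.+ m ℤ.* 1# k) (Listₚ.length-tabulate {n = p} id) ⟩
    int (ℤ.+ p) k                                  ∎
    where open ≡-Reasoning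

  geometricSum-≢0 : ∀ {b} → b ≢ 𝔽.0# → geometricSum b ≈ 0#
  geometricSum-≢0 {b} b≢0 with 𝔽ₚ.inverse b b≢0
  ... | b⁻¹ , bb⁻¹≡1 = Vanishes⇒≈0 λ k l → ≡.trans (geometricSum≡1 k) (≡.sym (geometricSum≡1 l))
    where
    b⁻¹b≡1 : b⁻¹ 𝔽.* b ≡ 𝔽.1#
    b⁻¹b≡1 = ≡.trans (𝔽.*-comm b⁻¹ b) bb⁻¹≡1
    kb⁻¹b≡k : ∀ k → (k 𝔽.* b⁻¹) 𝔽.* b ≡ k
    kb⁻¹b≡k k = ≡.trans (𝔽.*-assoc k b⁻¹ b) (≡.trans (cong (k 𝔽.*_) b⁻¹b≡1) (𝔽.*-identityʳ k))
    ab≡k⇒a≡kb⁻¹ : ∀ a k → a 𝔽.* b ≡ k → a ≡ k 𝔽.* b⁻¹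
    ab≡k⇒a≡kb⁻¹ a k ab≡k = ≡.trans (≡.sym (≡.trans (𝔽.*-assoc a b b⁻¹) (≡.trans (cong (a 𝔽.*_) bb⁻¹≡1) (𝔽.*-identityʳ a))))
                                  (cong (𝔽._* b⁻¹) ab≡k)
    geometricSum≡1 : ∀ k → geometricSum b k ≡ ℤ.+ 1
    geometricSum≡1 k = ≡.trans (Sum-pointwise (allFin p) _ k)
      (≡.trans (ℤΣ.Sum-allFin-single p _ (k 𝔽.* b⁻¹) (λ a a≢kb⁻¹ → proj₂ (ω^-isScaledGen (a 𝔽.* b)) k (a≢kb⁻¹ ∘ ab≡k⇒a≡kb⁻¹ a k ∘ ≡.sym)))
               (≡.trans (cong (λ c → (ω^ c) k) (kb⁻¹b≡k k)) (proj₁ (ω^-isScaledGen k))))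

  characterSum : ∀ n → V n → Carrier
  characterSum n u = Sum (allVecs p n) (λ x → ω^ (x · u))

  characterSum-cons : ∀ n b (u : V n) → characterSum (suc n) (b ∷ u) ≈ geometricSum b * characterSum n u
  characterSum-cons n b u = begin
    characterSum (suc n) (b ∷ u)
      ≈⟨ VectorSpace.Sum-allVecs-suc p +-commutativeMonoid n _ ⟩
    Sum (allFin p) (λ a → Sum (allVecs p n) (λ x → ω^ ((a ∷ x) · (b ∷ u))))
      ≈⟨ Sum-cong (allFin p) (λ a → Sum-cong (allVecs p n) (λ x → begin
           ω^ ((a ∷ x) · (b ∷ u))         ≡⟨ cong ω^_ (·-cons a b x u) ⟩
           ω^ (a 𝔽.* b 𝔽.+ x · u)         ≈⟨ ω^-+ (a 𝔽.* b) (x · u) ⟩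
           ω^ (a 𝔽.* b) * ω^ (x · u)      ∎)) ⟩
    Sum (allFin p) (λ a → Sum (allVecs p n) (λ x → ω^ (a 𝔽.* b) * ω^ (x · u)))
      ≈⟨ Sum-cong (allFin p) (λ a → sym (Sum-*ˡ (allVecs p n) (ω^ (a 𝔽.* b)) _)) ⟩
    Sum (allFin p) (λ a → ω^ (a 𝔽.* b) * characterSum n u)
      ≈⟨ Sum-*ʳ (allFin p) (characterSum n u) _ ⟨
    geometricSum b * characterSum n u ∎
    where open ≈-Reasoning

  characterSum-𝟘 : ∀ n → characterSum n (𝟘 n) ≈ int ((ℤ.+ p) ℤ.^ n)
  characterSum-𝟘 zero    = trans (+-identityʳ 1#) (sym int-1)
  characterSum-𝟘 (suc n) = begin
    characterSum (suc n) (𝟘 (suc n))                ≈⟨ characterSum-cons n 𝔽.0# (𝟘 n) ⟩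
    geometricSum 𝔽.0# * characterSum n (𝟘 n)        ≈⟨ *-cong geometricSum-0 (characterSum-𝟘 n) ⟩
    int (ℤ.+ p) * int ((ℤ.+ p) ℤ.^ n)                 ≈⟨ int-* (ℤ.+ p) _ ⟩
    int ((ℤ.+ p) ℤ.^ suc n)                           ∎
    where open ≈-Reasoning

  characterSum-≢𝟘 : ∀ n (u : V n) → u ≢ 𝟘 n → characterSum n u ≈ 0#
  characterSum-≢𝟘 zero    []      []≢[] = ⊥-elim ([]≢[] ≡.refl)
  characterSum-≢𝟘 (suc n) (b ∷ u) u≢𝟘 = trans (characterSum-cons n b u) (by-cases (b ≟ᶠ 𝔽.0#))
    where
    by-cases : Dec (b ≡ 𝔽.0#) → geometricSum b * characterSum n u ≈ 0#
    by-cases (no  b≢0) = trans (*-congʳ {characterSum n u} (geometricSum-≢0 b≢0)) (zeroˡ (characterSum n u))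
    by-cases (yes b≡0) = trans (*-congˡ {geometricSum b} (characterSum-≢𝟘 n u (λ u≡𝟘 → u≢𝟘 (cong₂ _∷_ b≡0 u≡𝟘))))
                               (zeroʳ (geometricSum b))

module CharactersOf𝔽ₚⁿ (p : ℕ) .{{_ : NonZero p}} (prime : Prime p) (n : ℕ) where
  open CyclotomicIntegers p prime using (ℤ[ω]; ω^_)
  open CyclotomicIntegerProperties p prime
  open CharacterSums p prime
  open CommutativeRing ℤ[ω] hiding (zero)
  open RingListSum ℤ[ω]
  open RingProduct ℤ[ω] using (Π; Π-suc)
  open VectorSpace p using (V; _⊕_; _⊖_; 𝟘; x⊖x≡𝟘; x⊖y≡𝟘⇒x≡y; group)
  open InnerProduct p
  open GroupAlgebra ℤ[ω] (group n)
  open ScaledGenerators p (ZωRing p) n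
  open import Relation.Binary.Reasoning.Setoid setoid
  private
    module 𝔽 = PrimeField p
    module C = GroupRing p (ZωRing p) n

  χ : V n → V n → Carrier
  χ x v = ω^ (x · v)

  χ-hom : ∀ x y w → χ x (y ⊕ w) ≈ χ x y * χ x w
  χ-hom x y w = trans (reflexive (cong ω^_ (·-⊕ʳ x y w))) (ω^-+ (x · y) (x · w))

  ev : V n → R[G] → Carrier
  ev x = Character.ev (χ x) (χ-hom x)

  ev-⋆ : ∀ x A B → ev x (A ⋆ B) ≈ ev x A * ev x B
  ev-⋆ x = Character.ev-⋆ (χ x) (χ-hom x)

  fourier-inversion : ∀ E v → Sum (allVecs p n) (λ x → ev x E * ω^ (𝔽.- (x · v))) ≈ int ((ℤ.+ p) ℤ.^ n) * E v
  fourier-inversion E v = begin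
    Sum (allVecs p n) (λ x → ev x E * ω^ (𝔽.- (x · v)))
      ≈⟨ Sum-cong (allVecs p n) (λ x → trans (Sum-*ʳ (allVecs p n) (ω^ (𝔽.- (x · v))) (λ w → E w * χ x w)) (Sum-cong (allVecs p n) (λ w → shift x w))) ⟩
    Sum (allVecs p n) (λ x → Sum (allVecs p n) (λ w → E w * ω^ (x · (w ⊖ v))))
      ≈⟨ Sum-swap (allVecs p n) (allVecs p n) (λ x w → E w * ω^ (x · (w ⊖ v))) ⟩
    Sum (allVecs p n) (λ w → Sum (allVecs p n) (λ x → E w * ω^ (x · (w ⊖ v))))
      ≈⟨ Sum-cong (allVecs p n) (λ w → sym (Sum-*ˡ (allVecs p n) (E w) (λ x → ω^ (x · (w ⊖ v))))) ⟩
    Sum (allVecs p n) (λ w → E w * characterSum n (w ⊖ v))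
      ≈⟨ FiniteAbelianGroup.Sum-single (group n) +-commutativeMonoid (λ w → E w * characterSum n (w ⊖ v)) v (λ w w≢v →
           trans (*-congˡ {E w} (characterSum-≢𝟘 n (w ⊖ v) (w≢v ∘ x⊖y≡𝟘⇒x≡y w v))) (zeroʳ (E w))) ⟩
    E v * characterSum n (v ⊖ v)
      ≈⟨ *-congˡ {E v} (trans (reflexive (cong (characterSum n) (x⊖x≡𝟘 v))) (characterSum-𝟘 n)) ⟩
    E v * int ((ℤ.+ p) ℤ.^ n)
      ≈⟨ *-comm (E v) (int ((ℤ.+ p) ℤ.^ n)) ⟩
    int ((ℤ.+ p) ℤ.^ n) * E v ∎
    where
    shift : ∀ x w → E w * χ x w * ω^ (𝔽.- (x · v)) ≈ E w * ω^ (x · (w ⊖ v))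
    shift x w = begin
      E w * χ x w * ω^ (𝔽.- (x · v))              ≈⟨ *-assoc (E w) (χ x w) (ω^ (𝔽.- (x · v))) ⟩
      E w * (ω^ (x · w) * ω^ (𝔽.- (x · v)))       ≈⟨ *-congˡ {E w} (ω^-+ (x · w) (𝔽.- (x · v))) ⟨
      E w * ω^ (x · w 𝔽.- x · v)                  ≡⟨ cong (λ c → E w * ω^ c) (·-⊖ʳ x w v) ⟨
      E w * ω^ (x · (w ⊖ v))                      ∎

  vanishing-characters⇒≈0 : ∀ E → (∀ x → ev x E ≈ 0#) → ∀ v → E v ≈ 0#
  vanishing-characters⇒≈0 E ev≈0 v = int*x≈0⇒x≈0 (E v) pⁿ≢0 (begin
    int ((ℤ.+ p) ℤ.^ n) * E v                                ≈⟨ fourier-inversion E v ⟨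
    Sum (allVecs p n) (λ x → ev x E * ω^ (𝔽.- (x · v)))      ≈⟨ Sum-zero (allVecs p n) (λ x → trans (*-congʳ {ω^ (𝔽.- (x · v))} (ev≈0 x)) (zeroˡ (ω^ (𝔽.- (x · v))))) ⟩
    0#                                                       ∎)
    where
    pⁿ≢0 : (ℤ.+ p) ℤ.^ n ≢ ℤ.+ 0
    pⁿ≢0 pⁿ≡0 = ℕ.≢-nonZero⁻¹ p (ℤₚ.+-injective (ℤₚ.i^n≡0⇒i≡0 (ℤ.+ p) n pⁿ≡0))

  scaledGen-isScaledGen : ∀ r v → IsScaledGen (C.scaledGen r v) v r
  scaledGen-isScaledGen r v = reflexive (scaledGen-≡ r v) , λ w w≢v → reflexive (scaledGen-≢ r v w w≢v)

  ev-oneGR : ∀ x → ev x C.oneGR ≈ 1#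
  ev-oneGR x = begin
    ev x C.oneGR            ≈⟨ ⟨⟩-scaledGen (scaledGen-isScaledGen 1# (𝟘 n)) (χ x) ⟩
    1# * ω^ (x · 𝟘 n)       ≡⟨ cong (λ c → 1# * ω^ c) (·-𝟘ʳ x) ⟩
    1# * 1#                 ≈⟨ *-identityˡ 1# ⟩
    1#                      ∎

  ev-prodGR : ∀ x m fs → ev x (C.prodGR m fs) ≈ Π m (λ j → ev x (fs j))
  ev-prodGR x zero    fs = ev-oneGR x
  ev-prodGR x (suc m) fs = begin
    ev x (C.prodGR (suc m) fs)                           ≡⟨ cong (ev x) (foldFin-suc C.mulGR C.oneGR m fs) ⟩
    ev x (fs zero ⋆ C.prodGR m (fs ∘ suc))               ≈⟨ ev-⋆ x (fs zero) (C.prodGR m (fs ∘ suc)) ⟩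
    ev x (fs zero) * ev x (C.prodGR m (fs ∘ suc))        ≈⟨ *-congˡ {ev x (fs zero)} (ev-prodGR x m (fs ∘ suc)) ⟩
    ev x (fs zero) * Π m (λ j → ev x (fs (suc j)))       ≡⟨ Π-suc m (λ j → ev x (fs j)) ⟨
    Π (suc m) (λ j → ev x (fs j))                        ∎

  ev-1-g : ∀ x a u → ev x (C.subGR C.oneGR (C.scaledGen (ω^ (𝔽.- a)) u)) ≈ 1# - ω^ (x · u 𝔽.- a)
  ev-1-g x a u = begin
    ev x (C.subGR C.oneGR (C.scaledGen (ω^ (𝔽.- a)) u))
      ≈⟨ ⟨1-rg⟩ (scaledGen-isScaledGen 1# (𝟘 n)) (scaledGen-isScaledGen (ω^ (𝔽.- a)) u) (χ x) ⟩
    ω^ (x · 𝟘 n) - ω^ (𝔽.- a) * ω^ (x · u)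
      ≈⟨ +-cong (reflexive (cong ω^_ (·-𝟘ʳ x))) (-‿cong (sym (ω^-+ (𝔽.- a) (x · u)))) ⟩
    1# - ω^ (𝔽.- a 𝔽.+ x · u)
      ≡⟨ cong (λ c → 1# - ω^ c) (𝔽.+-comm (𝔽.- a) (x · u)) ⟩
    1# - ω^ (x · u 𝔽.- a) ∎

-- (P1) ⇔ (P2) ⇔ (P3) ⇒ (P4)

module PolynomialCriterion (p : ℕ) .{{_ : NonZero p}} (prime : Prime p) (n : ℕ) (M : Matrix p n) (t t′ : Fin n → ℕ)
                           (c : (i : Fin n) → Fin (t i) → Fp p) (d : (i : Fin n) → Fin (t′ i) → Fp p) where
  open Props p n M t t′ c d
  open PrimeField p
  open PrimeFieldArithmetic p prime
  open PrimeFieldProduct p prime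
  open RingProduct ring using (Π-zero)
  open ≡ using (trans)

  Hits : Vecₚ p n → Set
  Hits x = (∃ λ i → ∃ λ k → lookup x i ≡ c i k) ⊎ (∃ λ i → ∃ λ k → matVec p n M x i ≡ d i k)

  hEval≡0⇒Hits : ∀ x → hEval x ≡ 0# → Hits x
  hEval≡0⇒Hits x hx≡0 with x*y≡0⇒x≡0⊎y≡0 _ _ hx≡0
  ... | inj₁ zero-on-rows with Π≡0⇒∃≡0 n _ zero-on-rows
  ...   | i , zero-at-i with Π≡0⇒∃≡0 (t′ i) _ zero-at-i
  ...     | k , zero-at-k = inj₂ (i , k , x-y≡0⇒x≡y zero-at-k)
  hEval≡0⇒Hits x hx≡0 | inj₂ zero-on-coordinates with Π≡0⇒∃≡0 n _ zero-on-coordinates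
  ...   | i , zero-at-i with Π≡0⇒∃≡0 (t i) _ zero-at-i
  ...     | k , zero-at-k = inj₁ (i , k , x-y≡0⇒x≡y zero-at-k)

  Hits⇒hEval≡0 : ∀ x → Hits x → hEval x ≡ 0#
  Hits⇒hEval≡0 x (inj₁ (i , k , xᵢ≡c)) = trans (cong (rows *_) coordinates≡0) (zeroʳ rows)
    where
    rows = prodₚ p n (λ i → prodₚ p (t′ i) λ k → matVec p n M x i - d i k)
    coordinates≡0 : prodₚ p n (λ i → prodₚ p (t i) λ k → lookup x i - c i k) ≡ 0#
    coordinates≡0 = Π-zero n _ i (Π-zero (t i) (λ k → lookup x i - c i k) k (trans (cong (_- c i k) xᵢ≡c) (-‿inverseʳ (c i k))))
  Hits⇒hEval≡0 x (inj₂ (i , k , Mxᵢ≡d)) = trans (cong (_* coordinates) rows≡0) (zeroˡ coordinates)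
    where
    coordinates = prodₚ p n (λ i → prodₚ p (t i) λ k → lookup x i - c i k)
    rows≡0 : prodₚ p n (λ i → prodₚ p (t′ i) λ k → matVec p n M x i - d i k) ≡ 0#
    rows≡0 = Π-zero n _ i (Π-zero (t′ i) (λ k → matVec p n M x i - d i k) k (trans (cong (_- d i k) Mxᵢ≡d) (-‿inverseʳ (d i k))))

  P1⇒P2 : P1 → P2
  P1⇒P2 no-avoiding-point x with hEval x ≟ᶠ 0#
  ... | yes hx≡0 = hx≡0
  ... | no  hx≢0 = ⊥-elim (no-avoiding-point (x , (λ i k xᵢ≡c → hx≢0 (Hits⇒hEval≡0 x (inj₁ (i , k , xᵢ≡c))))
                                                , (λ i k Mxᵢ≡d → hx≢0 (Hits⇒hEval≡0 x (inj₂ (i , k , Mxᵢ≡d))))))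

  P2⇒P1 : P2 → P1
  P2⇒P1 h≡0 (x , avoids-c , avoids-d) with hEval≡0⇒Hits x (h≡0 x)
  ... | inj₁ (i , k , xᵢ≡c)  = avoids-c i k xᵢ≡c
  ... | inj₂ (i , k , Mxᵢ≡d) = avoids-d i k Mxᵢ≡d

  P1⇔P2 : P1 ⇔ P2
  P1⇔P2 = mk⇔ P1⇒P2 P2⇒P1

module CharacterCriterion (p : ℕ) .{{_ : NonZero p}} (prime : Prime p) (n : ℕ) (M : Matrix p n) (t t′ : Fin n → ℕ)
                          (c : (i : Fin n) → Fin (t i) → Fp p) (d : (i : Fin n) → Fin (t′ i) → Fp p) where
  open Props p n M t t′ c d
  open CyclotomicIntegers p prime using (ℤ[ω]; ω^_; mk≈; difference-vanishes)
  open CyclotomicIntegerProperties p prime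
  open CommutativeRing ℤ[ω] hiding (zero)
  open RingProduct ℤ[ω] using (Π; Π-cong; Π-zero; Π-closed)
  open CharactersOf𝔽ₚⁿ p prime n
  open InnerProduct p using (·-basis; ·-row)
  open GroupAlgebra ℤ[ω] (VectorSpace.group p n) using (R[G]; _⋆_)
  open PolynomialCriterion p prime n M t t′ c d using (hEval≡0⇒Hits; P1⇔P2)
  open import Relation.Binary.Reasoning.Setoid setoid
  private
    module 𝔽 = PrimeField p

  X Y : R[G]
  X = C.prodGR n λ i → C.prodGR (t i) λ k → factorℂ (c i k) (basis p n i)
  Y = C.prodGR n λ i → C.prodGR (t′ i) λ k → factorℂ (d i k) (row p n M i)

  coordinateFactors rowFactors : Vecₚ p n → Carrier
  coordinateFactors x = Π n λ i → Π (t i) λ k → 1# - ω^ (lookup x i 𝔽.- c i k)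
  rowFactors        x = Π n λ i → Π (t′ i) λ k → 1# - ω^ (matVec p n M x i 𝔽.- d i k)

  ev-X : ∀ x → ev x X ≈ coordinateFactors x
  ev-X x = begin
    ev x X
      ≈⟨ ev-prodGR x n _ ⟩
    Π n (λ i → ev x (C.prodGR (t i) λ k → factorℂ (c i k) (basis p n i)))
      ≈⟨ Π-cong n (λ i → trans (ev-prodGR x (t i) _) (Π-cong (t i) λ k →
           trans (ev-1-g x (c i k) (basis p n i)) (reflexive (cong (λ a → 1# - ω^ (a 𝔽.- c i k)) (·-basis x i))))) ⟩
    coordinateFactors x ∎

  ev-Y : ∀ x → ev x Y ≈ rowFactors x
  ev-Y x = begin
    ev x Y
      ≈⟨ ev-prodGR x n _ ⟩
    Π n (λ i → ev x (C.prodGR (t′ i) λ k → factorℂ (d i k) (row p n M i)))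
      ≈⟨ Π-cong n (λ i → trans (ev-prodGR x (t′ i) _) (Π-cong (t′ i) λ k →
           trans (ev-1-g x (d i k) (row p n M i)) (reflexive (cong (λ a → 1# - ω^ (a 𝔽.- d i k)) (·-row x M i))))) ⟩
    rowFactors x ∎

  ev-X⋆Y : ∀ x → ev x (X ⋆ Y) ≈ coordinateFactors x * rowFactors x
  ev-X⋆Y x = trans (ev-⋆ x X Y) (*-cong (ev-X x) (ev-Y x))

  1-ω^0≈0 : ∀ {a b} → a ≡ b → 1# - ω^ (a 𝔽.- b) ≈ 0#
  1-ω^0≈0 {a} {b} a≡b = trans (reflexive (cong (λ e → 1# - ω^ e) (≡.trans (cong (𝔽._- b) a≡b) (𝔽.-‿inverseʳ b)))) (-‿inverseʳ 1#)

  1-ω^≢0∣p : ∀ {a b} → a ≢ b → DividesNonzeroInteger (1# - ω^ (a 𝔽.- b))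
  1-ω^≢0∣p a≢b = 1-ω^a∣p _ (a≢b ∘ 𝔽.x-y≡0⇒x≡y)

  Π-DividesNonzeroInteger : ∀ m (f : Fin m → Carrier) → (∀ j → DividesNonzeroInteger (f j)) → DividesNonzeroInteger (Π m f)
  Π-DividesNonzeroInteger = Π-closed DividesNonzeroInteger DividesNonzeroInteger-1 DividesNonzeroInteger-*

  P3⇒P1 : P3 → P1
  P3⇒P1 X⋆Y≈0 (x , avoids-c , avoids-d) = DividesNonzeroInteger⇒≉0 evx∣N evx≈0
    where
    evx∣N : DividesNonzeroInteger (ev x (X ⋆ Y))
    evx∣N = DividesNonzeroInteger-cong (sym (ev-X⋆Y x)) (DividesNonzeroInteger-* {coordinateFactors x} {rowFactors x}
      (Π-DividesNonzeroInteger n _ λ i → Π-DividesNonzeroInteger (t i) (λ k → 1# - ω^ (lookup x i 𝔽.- c i k))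
                                                                         λ k → 1-ω^≢0∣p (avoids-c i k))
      (Π-DividesNonzeroInteger n _ λ i → Π-DividesNonzeroInteger (t′ i) (λ k → 1# - ω^ (matVec p n M x i 𝔽.- d i k))
                                                                          λ k → 1-ω^≢0∣p (avoids-d i k)))
    evx≈0 : ev x (X ⋆ Y) ≈ 0#
    evx≈0 = RingListSum.Sum-zero ℤ[ω] (allVecs p n) λ w →
      trans (*-congʳ {χ x w} (mk≈ {(X ⋆ Y) w} {0#} (X⋆Y≈0 w))) (zeroˡ (χ x w))

  P1⇒P3 : P1 → P3
  P1⇒P3 no-avoiding-point v = difference-vanishes (vanishing-characters⇒≈0 (X ⋆ Y) evx≈0 v)
    where
    evx≈0 : ∀ x → ev x (X ⋆ Y) ≈ 0#
    evx≈0 x with hEval≡0⇒Hits x (Equivalence.to P1⇔P2 no-avoiding-point x)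
    ... | inj₁ (i , k , xᵢ≡c) = trans (ev-X⋆Y x) (trans (*-congʳ {rowFactors x} coordinateFactors≈0) (zeroˡ (rowFactors x)))
      where
      coordinateFactors≈0 : coordinateFactors x ≈ 0#
      coordinateFactors≈0 = Π-zero n _ i (Π-zero (t i) _ k (1-ω^0≈0 xᵢ≡c))
    ... | inj₂ (i , k , Mxᵢ≡d) = trans (ev-X⋆Y x) (trans (*-congˡ {coordinateFactors x} rowFactors≈0) (zeroʳ (coordinateFactors x)))
      where
      rowFactors≈0 : rowFactors x ≈ 0#
      rowFactors≈0 = Π-zero n _ i (Π-zero (t′ i) _ k (1-ω^0≈0 Mxᵢ≡d))

  P2⇔P3 : P2 ⇔ P3
  P2⇔P3 = mk⇔ (P1⇒P3 ∘ Equivalence.from P1⇔P2) (Equivalence.to P1⇔P2 ∘ P3⇒P1)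

module Augmentation (p : ℕ) .{{_ : NonZero p}} (prime : Prime p) where
  open PrimeField p
  open CyclotomicIntegers p prime using (ℤ[ω]; ω^_; ω^-isScaledGen; Vanishes)
  open RingListSum ring
  open ≡ using (refl; sym; trans)
  open ≡-Reasoning
  private
    module ℤω = CommutativeRing ℤ[ω]
    module ℤΣ = RingListSum ℤₚ.+-*-commutativeRing

  φ : Zω p → F
  φ a = Sum (allFin p) (λ k → ι (a k))

  ι-Sum : ∀ {A : Set} (xs : List A) f → ι (ℤΣ.Sum xs f) ≡ Sum xs (ι ∘ f)
  ι-Sum []       f = refl
  ι-Sum (x ∷ xs) f = trans (ι-+ (f x) _) (cong (ι (f x) +_) (ι-Sum xs f))

  φ-+ : ∀ a b → φ (a ℤω.+ b) ≡ φ a + φ b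
  φ-+ a b = trans (Sum-cong (allFin p) (λ k → ι-+ (a k) (b k))) (Sum-+ (allFin p) _ _)

  φ-neg : ∀ a → φ (ℤω.- a) ≡ - φ a
  φ-neg a = trans (Sum-cong (allFin p) (λ k → ι-neg (a k))) (sym (Sum-neg (allFin p) _))

  φ-Sum : ∀ {A : Set} (xs : List A) f → φ (RingListSum.Sum ℤ[ω] xs f) ≡ Sum xs (φ ∘ f)
  φ-Sum []       f = Sum-zero (allFin p) (λ _ → refl)
  φ-Sum (x ∷ xs) f = trans (φ-+ (f x) _) (cong (φ (f x) +_) (φ-Sum xs f))

  φ-* : ∀ a b → φ (a ℤω.* b) ≡ φ a * φ b
  φ-* a b = begin
    Sum (allFin p) (λ k → ι (ℤΣ.Sum (allFin p) (λ j → a j ℤ.* b (k - j))))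
      ≡⟨ Sum-cong (allFin p) (λ k → trans (ι-Sum (allFin p) _) (Sum-cong (allFin p) (λ j → ι-* (a j) (b (k - j))))) ⟩
    Sum (allFin p) (λ k → Sum (allFin p) (λ j → ι (a j) * ι (b (k - j))))
      ≡⟨ Sum-swap (allFin p) (allFin p) _ ⟩
    Sum (allFin p) (λ j → Sum (allFin p) (λ k → ι (a j) * ι (b (k - j))))
      ≡⟨ Sum-cong (allFin p) (λ j → trans (sym (Sum-*ˡ (allFin p) (ι (a j)) _))
                                        (cong (ι (a j) *_) (PrimeFieldGroup.Sum-shift p (CommutativeRing.+-commutativeMonoid ring) (ι ∘ b) (- j)))) ⟩
    Sum (allFin p) (λ j → ι (a j) * φ b)
      ≡⟨ Sum-*ʳ (allFin p) (φ b) _ ⟨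
    φ a * φ b ∎

  φ-ω^ : ∀ c → φ (ω^ c) ≡ 1#
  φ-ω^ c = trans (Sum-allFin-single p _ c (λ k k≢c → cong ι (proj₂ (ω^-isScaledGen c) k k≢c)))
                 (cong ι (proj₁ (ω^-isScaledGen c)))

  φ-Vanishes : ∀ {a} → Vanishes a → φ a ≡ 0#
  φ-Vanishes {a} a-const = begin
    Sum (allFin p) (λ k → ι (a k))          ≡⟨ Sum-cong (allFin p) (λ k → cong ι (a-const k 0#)) ⟩
    Sum (allFin p) (λ _ → ι (a 0#))         ≡⟨ Sum-const (allFin p) ⟩
    ⟦ length (allFin p) ⟧ * ι (a 0#)        ≡⟨ cong (λ m → ⟦ m ⟧ * ι (a 0#)) (Listₚ.length-tabulate {n = p} id) ⟩
    ⟦ p ⟧ * ι (a 0#)                        ≡⟨ cong (_* ι (a 0#)) ⟦p⟧≡0 ⟩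
    0# * ι (a 0#)                           ≡⟨ zeroˡ (ι (a 0#)) ⟩
    0#                                      ∎
    where
    Sum-const : ∀ {A : Set} (xs : List A) {c} → Sum xs (λ _ → c) ≡ ⟦ length xs ⟧ * c
    Sum-const []       {c} = sym (zeroˡ c)
    Sum-const (x ∷ xs) {c} = begin
      c + Sum xs (λ _ → c)            ≡⟨ cong₂ _+_ (sym (*-identityˡ c)) (Sum-const xs) ⟩
      1# * c + ⟦ length xs ⟧ * c      ≡⟨ *-distribʳ-+ c 1# _ ⟨
      (1# + ⟦ length xs ⟧) * c        ≡⟨ cong (_* c) (⟦+⟧ 1 (length xs)) ⟨
      ⟦ suc (length xs) ⟧ * c         ∎

module AugmentedGroupRing (p : ℕ) .{{_ : NonZero p}} (prime : Prime p) (n : ℕ) where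
  open PrimeField p
  open Augmentation p prime
  open CyclotomicIntegers p prime using (ℤ[ω]; ω^_)
  open VectorSpace p using (𝟘; group)
  open GroupAlgebra ring (group n) using (⋆-cong)
  open ≡ using (refl; trans)
  open ≡-Reasoning
  private
    module C = GroupRing p (ZωRing p) n
    module 𝔽[G] = GroupRing p (FpRing p) n
    module ℤω = CommutativeRing ℤ[ω]
    module ℤωGen = ScaledGenerators p (ZωRing p) n
    module 𝔽Gen = ScaledGenerators p (FpRing p) n

  Φ : C.GR → 𝔽[G].GR
  Φ f v = φ (f v)

  Φ-mulGR : ∀ f h v → Φ (C.mulGR f h) v ≡ 𝔽[G].mulGR (Φ f) (Φ h) v
  Φ-mulGR f h v = trans (φ-Sum (allVecs p n) (λ w → f w ℤω.* h (vsub p v w))) (RingListSum.Sum-cong ring (allVecs p n) (λ w → φ-* (f w) (h (vsub p v w))))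

  Φ-scaledGen : ∀ r u → φ r ≡ 1# → ∀ w → Φ (C.scaledGen r u) w ≡ 𝔽[G].gen u w
  Φ-scaledGen r u φr≡1 w = by-cases (VectorSpace._≟_ p w u)
    where
    by-cases : Dec (w ≡ u) → Φ (C.scaledGen r u) w ≡ 𝔽[G].gen u w
    by-cases (yes w≡u) = begin
      φ (C.scaledGen r u w)      ≡⟨ cong (λ v → φ (C.scaledGen r u v)) w≡u ⟩
      φ (C.scaledGen r u u)      ≡⟨ cong φ (ℤωGen.scaledGen-≡ r u) ⟩
      φ r                        ≡⟨ φr≡1 ⟩
      1#                         ≡⟨ 𝔽Gen.scaledGen-≡ 1# u ⟨
      𝔽[G].gen u u               ≡⟨ cong (𝔽[G].gen u) w≡u ⟨
      𝔽[G].gen u w               ∎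
    by-cases (no  w≢u) = begin
      φ (C.scaledGen r u w)      ≡⟨ cong φ (ℤωGen.scaledGen-≢ r u w w≢u) ⟩
      φ ℤω.0#                    ≡⟨ RingListSum.Sum-zero ring (allFin p) (λ _ → refl) ⟩
      0#                         ≡⟨ 𝔽Gen.scaledGen-≢ 1# u w w≢u ⟨
      𝔽[G].gen u w               ∎

  Φ-oneGR : ∀ w → Φ C.oneGR w ≡ 𝔽[G].oneGR w
  Φ-oneGR = Φ-scaledGen ℤω.1# (𝟘 n) (φ-ω^ 0#)

  Φ-1-g : ∀ a u w → Φ (C.subGR C.oneGR (C.scaledGen (ω^ (- a)) u)) w ≡ 𝔽[G].subGR 𝔽[G].oneGR (𝔽[G].gen u) w
  Φ-1-g a u w = trans (φ-+ (C.oneGR w) (ℤω.- C.scaledGen (ω^ (- a)) u w))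
                      (cong₂ _+_ (Φ-oneGR w) (trans (φ-neg (C.scaledGen (ω^ (- a)) u w)) (cong -_ (Φ-scaledGen (ω^ (- a)) u (φ-ω^ (- a)) w))))

  prodGR-cong : ∀ m {fs gs : Fin m → 𝔽[G].GR} → (∀ j w → fs j w ≡ gs j w) → ∀ w → 𝔽[G].prodGR m fs w ≡ 𝔽[G].prodGR m gs w
  prodGR-cong zero    fs≗gs w = refl
  prodGR-cong (suc m) {fs} {gs} fs≗gs w = begin
    𝔽[G].prodGR (suc m) fs w                              ≡⟨ cong (λ A → A w) (foldFin-suc 𝔽[G].mulGR 𝔽[G].oneGR m fs) ⟩
    𝔽[G].mulGR (fs zero) (𝔽[G].prodGR m (fs ∘ suc)) w     ≡⟨ ⋆-cong {fs zero} {gs zero} (fs≗gs zero) (prodGR-cong m (fs≗gs ∘ suc)) w ⟩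
    𝔽[G].mulGR (gs zero) (𝔽[G].prodGR m (gs ∘ suc)) w     ≡⟨ cong (λ A → A w) (foldFin-suc 𝔽[G].mulGR 𝔽[G].oneGR m gs) ⟨
    𝔽[G].prodGR (suc m) gs w                              ∎

  Φ-prodGR : ∀ m fs w → Φ (C.prodGR m fs) w ≡ 𝔽[G].prodGR m (Φ ∘ fs) w
  Φ-prodGR zero    fs w = Φ-oneGR w
  Φ-prodGR (suc m) fs w = begin
    Φ (C.prodGR (suc m) fs) w                              ≡⟨ cong (λ A → Φ A w) (foldFin-suc C.mulGR C.oneGR m fs) ⟩
    Φ (C.mulGR (fs zero) (C.prodGR m (fs ∘ suc))) w        ≡⟨ Φ-mulGR (fs zero) (C.prodGR m (fs ∘ suc)) w ⟩
    𝔽[G].mulGR (Φ (fs zero)) (Φ (C.prodGR m (fs ∘ suc))) w ≡⟨ ⋆-cong {Φ (fs zero)} {Φ (fs zero)} (λ _ → refl) (Φ-prodGR m (fs ∘ suc)) w ⟩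
    𝔽[G].mulGR (Φ (fs zero)) (𝔽[G].prodGR m (Φ ∘ fs ∘ suc)) w ≡⟨ cong (λ A → A w) (foldFin-suc 𝔽[G].mulGR 𝔽[G].oneGR m (Φ ∘ fs)) ⟨
    𝔽[G].prodGR (suc m) (Φ ∘ fs) w                         ∎

  prodGR-const : ∀ m A w → 𝔽[G].prodGR m (λ _ → A) w ≡ 𝔽[G].powGR A m w
  prodGR-const zero    A w = refl
  prodGR-const (suc m) A w = trans (cong (λ B → B w) (foldFin-suc 𝔽[G].mulGR 𝔽[G].oneGR m (λ _ → A)))
                                   (⋆-cong {A} {A} (λ _ → refl) (prodGR-const m A) w)

module AugmentationCriterion (p : ℕ) .{{_ : NonZero p}} (prime : Prime p) (n : ℕ) (M : Matrix p n) (t t′ : Fin n → ℕ)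
                             (c : (i : Fin n) → Fin (t i) → Fp p) (d : (i : Fin n) → Fin (t′ i) → Fp p) where
  open Props p n M t t′ c d
  open AugmentedGroupRing p prime n
  open Augmentation p prime using (φ-Vanishes)
  open CyclotomicIntegers p prime using (mk≈; ≈0⇒Vanishes)
  open CharacterCriterion p prime n M t t′ c d using (X; Y)
  open GroupAlgebra (PrimeField.ring p) (VectorSpace.group p n) using (⋆-cong)
  open ≡ using (sym; trans)
  open ≡-Reasoning

  1-gᵘ : Vecₚ p n → F.GR
  1-gᵘ u = F.subGR F.oneGR (F.gen u)

  Φ-prodGR-1-g : ∀ m (a : Fin m → Fp p) u w →
                 Φ (C.prodGR m λ k → factorℂ (a k) u) w ≡ F.powGR (1-gᵘ u) m w
  Φ-prodGR-1-g m a u w = begin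
    Φ (C.prodGR m λ k → factorℂ (a k) u) w           ≡⟨ Φ-prodGR m _ w ⟩
    F.prodGR m (λ k → Φ (factorℂ (a k) u)) w         ≡⟨ prodGR-cong m (λ k → Φ-1-g (a k) u) w ⟩
    F.prodGR m (λ _ → 1-gᵘ u) w                      ≡⟨ prodGR-const m (1-gᵘ u) w ⟩
    F.powGR (1-gᵘ u) m w                             ∎

  P3⇒P4 : P3 → P4
  P3⇒P4 X⋆Y≈0 v = begin
    F.mulGR (F.prodGR n λ i → F.powGR (1-gᵘ (basis p n i)) (t i)) (F.prodGR n λ i → F.powGR (1-gᵘ (row p n M i)) (t′ i)) v
      ≡⟨ ⋆-cong (λ w → sym (trans (Φ-prodGR n _ w) (prodGR-cong n (λ i → Φ-prodGR-1-g (t i) (c i) (basis p n i)) w)))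
                (λ w → sym (trans (Φ-prodGR n _ w) (prodGR-cong n (λ i → Φ-prodGR-1-g (t′ i) (d i) (row p n M i)) w))) v ⟩
    F.mulGR (Φ X) (Φ Y) v    ≡⟨ Φ-mulGR X Y v ⟨
    Φ (C.mulGR X Y) v        ≡⟨ φ-Vanishes (≈0⇒Vanishes (mk≈ {C.mulGR X Y v} (X⋆Y≈0 v))) ⟩
    0ₚ p                     ∎

-- Polynomial functions, difference operators and the dual pairing with polynomials

module PolynomialFunctions (p : ℕ) .{{_ : NonZero p}} where
  open PrimeField p
  open VectorSpace p using (V; _⊕_)
  open Solver using (solve; _:+_; _:-_; _:*_; _:=_; :-_; con)
  open ≡ using (refl; sym; trans)

  data DegreeBelow {n : ℕ} : ℕ → (V n → F) → Set where
    deg-zero  : ∀ {d} → DegreeBelow d (λ _ → 0#)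
    deg-const : ∀ {d} c → DegreeBelow (suc d) (λ _ → c)
    deg-+     : ∀ {d f g} → DegreeBelow d f → DegreeBelow d g → DegreeBelow d (λ y → f y + g y)
    deg-scale : ∀ {d f} c → DegreeBelow d f → DegreeBelow d (λ y → c * f y)
    deg-coord : ∀ {d f} i → DegreeBelow d f → DegreeBelow (suc d) (λ y → lookup y i * f y)
    deg-ext   : ∀ {d f g} → (∀ y → f y ≡ g y) → DegreeBelow d f → DegreeBelow d g

  DegreeBelow-0 : ∀ {n f} → DegreeBelow {n} 0 f → ∀ y → f y ≡ 0#
  DegreeBelow-0 deg-zero          y = refl
  DegreeBelow-0 (deg-+ df dg)     y = trans (cong₂ _+_ (DegreeBelow-0 df y) (DegreeBelow-0 dg y)) (+-identityʳ 0#)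
  DegreeBelow-0 (deg-scale c df)  y = trans (cong (c *_) (DegreeBelow-0 df y)) (zeroʳ c)
  DegreeBelow-0 (deg-ext f≗g df)  y = trans (sym (f≗g y)) (DegreeBelow-0 df y)

  ≗0⇒DegreeBelow : ∀ {n d f} → (∀ y → f y ≡ 0#) → DegreeBelow {n} d f
  ≗0⇒DegreeBelow f≗0 = deg-ext (λ y → sym (f≗0 y)) deg-zero

  DegreeBelow-suc : ∀ {n d f} → DegreeBelow {n} d f → DegreeBelow (suc d) f
  DegreeBelow-suc deg-zero          = deg-zero
  DegreeBelow-suc (deg-const c)     = deg-const c
  DegreeBelow-suc (deg-+ df dg)     = deg-+ (DegreeBelow-suc df) (DegreeBelow-suc dg)
  DegreeBelow-suc (deg-scale c df)  = deg-scale c (DegreeBelow-suc df)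
  DegreeBelow-suc (deg-coord i df)  = deg-coord i (DegreeBelow-suc df)
  DegreeBelow-suc (deg-ext f≗g df)  = deg-ext f≗g (DegreeBelow-suc df)

  DegreeBelow-mono : ∀ {n d d′ f} → d ≤ d′ → DegreeBelow {n} d f → DegreeBelow d′ f
  DegreeBelow-mono {d = d} {d′} d≤d′ df = subst (λ e → DegreeBelow e _) (ℕₚ.m∸n+n≡m d≤d′) (raise (d′ ∸ d) df)
    where
    raise : ∀ {n d f} k → DegreeBelow {n} d f → DegreeBelow (k ℕ.+ d) f
    raise zero    df = df
    raise (suc k) df = DegreeBelow-suc (raise k df)

  deg-coord′ : ∀ {n d f} i → DegreeBelow {n} (ℕ.pred d) f → DegreeBelow d (λ y → lookup y i * f y)
  deg-coord′ {d = zero}  i df = ≗0⇒DegreeBelow (λ y → trans (cong (lookup y i *_) (DegreeBelow-0 df y)) (zeroʳ (lookup y i)))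
  deg-coord′ {d = suc d} i df = deg-coord i df

  DegreeBelow-neg : ∀ {n d f} → DegreeBelow {n} d f → DegreeBelow d (λ y → - f y)
  DegreeBelow-neg {f = f} df = deg-ext (λ y → solve 1 (λ x → con (ℤ.- ℤ.+ 1) :* x := :- x) refl (f y)) (deg-scale (- 1#) df)

  translate : ∀ {n} → V n → (V n → F) → V n → F
  translate u f y = f (y ⊕ u)

  Δ : ∀ {n} → V n → (V n → F) → V n → F
  Δ u f y = f (y ⊕ u) - f y

  DegreeBelow-translate : ∀ {n d f} (u : V n) → DegreeBelow d f → DegreeBelow d (translate u f)
  DegreeBelow-translate u deg-zero         = deg-zero
  DegreeBelow-translate u (deg-const c)    = deg-const c
  DegreeBelow-translate u (deg-+ df dg)    = deg-+ (DegreeBelow-translate u df) (DegreeBelow-translate u dg)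
  DegreeBelow-translate u (deg-scale c df) = deg-scale c (DegreeBelow-translate u df)
  DegreeBelow-translate u (deg-coord {f = f} i df) =
    deg-ext (λ y → sym (trans (cong (_* f (y ⊕ u)) (Vecₚ.lookup-zipWith _ i y u)) (*-distribʳ-+ (f (y ⊕ u)) (lookup y i) (lookup u i))))
            (deg-+ (deg-coord i (DegreeBelow-translate u df)) (deg-scale (lookup u i) (DegreeBelow-suc (DegreeBelow-translate u df))))
  DegreeBelow-translate u (deg-ext f≗g df) = deg-ext (λ y → f≗g _) (DegreeBelow-translate u df)

  DegreeBelow-Δ : ∀ {n d f} (u : V n) → DegreeBelow d f → DegreeBelow (ℕ.pred d) (Δ u f)
  DegreeBelow-Δ u deg-zero      = ≗0⇒DegreeBelow (λ _ → -‿inverseʳ 0#)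
  DegreeBelow-Δ u (deg-const c) = ≗0⇒DegreeBelow (λ _ → -‿inverseʳ c)
  DegreeBelow-Δ u (deg-+ {f = f} {g} df dg) =
    deg-ext (λ y → solve 4 (λ a b c d → (a :- b) :+ (c :- d) := (a :+ c) :- (b :+ d)) refl (f (y ⊕ u)) (f y) (g (y ⊕ u)) (g y))
            (deg-+ (DegreeBelow-Δ u df) (DegreeBelow-Δ u dg))
  DegreeBelow-Δ u (deg-scale {f = f} c df) =
    deg-ext (λ y → solve 3 (λ c a b → c :* (a :- b) := c :* a :- c :* b) refl c (f (y ⊕ u)) (f y)) (deg-scale c (DegreeBelow-Δ u df))
  DegreeBelow-Δ u (deg-coord {f = f} i df) =
    deg-ext product-rule (deg-+ (deg-coord′ i (DegreeBelow-Δ u df)) (deg-scale (lookup u i) (DegreeBelow-translate u df)))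
    where
    product-rule : ∀ y → lookup y i * Δ u f y + lookup u i * f (y ⊕ u) ≡ Δ u (λ y → lookup y i * f y) y
    product-rule y = trans (solve 4 (λ a b c d → a :* (c :- d) :+ b :* c := (a :+ b) :* c :- a :* d) refl
                                 (lookup y i) (lookup u i) (f (y ⊕ u)) (f y))
                           (cong (λ z → z * f (y ⊕ u) - lookup y i * f y) (sym (Vecₚ.lookup-zipWith _ i y u)))
  DegreeBelow-Δ u (deg-ext f≗g df) = deg-ext (λ y → cong₂ _-_ (f≗g _) (f≗g y)) (DegreeBelow-Δ u df)

  DegreeBelow-* : ∀ {n a b f g} → DegreeBelow {n} a f → DegreeBelow b g → DegreeBelow (ℕ.pred (a ℕ.+ b)) (λ y → f y * g y)
  DegreeBelow-* {g = g} deg-zero dg = ≗0⇒DegreeBelow (λ y → zeroˡ (g y))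
  DegreeBelow-* {b = b} (deg-const {d = a} c) dg = DegreeBelow-mono (ℕₚ.m≤n+m b a) (deg-scale c dg)
  DegreeBelow-* {g = g} (deg-+ {f = f₁} {f₂} df₁ df₂) dg =
    deg-ext (λ y → sym (*-distribʳ-+ (g y) (f₁ y) (f₂ y))) (deg-+ (DegreeBelow-* df₁ dg) (DegreeBelow-* df₂ dg))
  DegreeBelow-* {g = g} (deg-scale {f = f} c df) dg = deg-ext (λ y → sym (*-assoc c (f y) (g y))) (deg-scale c (DegreeBelow-* df dg))
  DegreeBelow-* {g = g} (deg-coord {f = f} i df) dg =
    deg-ext (λ y → sym (*-assoc (lookup y i) (f y) (g y))) (deg-coord′ i (DegreeBelow-* df dg))
  DegreeBelow-* {g = g} (deg-ext f≗f′ df) dg = deg-ext (λ y → cong (_* g y) (f≗f′ y)) (DegreeBelow-* df dg)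

  DegreeBelow-*-≤ : ∀ {n a b d f g} → DegreeBelow {n} a f → DegreeBelow b g → a ≡ 0 ⊎ b ≡ 0 ⊎ ℕ.pred (a ℕ.+ b) ≤ d →
                    DegreeBelow d (λ y → f y * g y)
  DegreeBelow-*-≤ {g = g} df dg (inj₁ refl) = ≗0⇒DegreeBelow (λ y → trans (cong (_* g y) (DegreeBelow-0 df y)) (zeroˡ (g y)))
  DegreeBelow-*-≤ {f = f} df dg (inj₂ (inj₁ refl)) = ≗0⇒DegreeBelow (λ y → trans (cong (f y *_) (DegreeBelow-0 dg y)) (zeroʳ (f y)))
  DegreeBelow-*-≤ df dg (inj₂ (inj₂ ≤d)) = DegreeBelow-mono ≤d (DegreeBelow-* df dg)

  DegreeBelow-tail : ∀ {n d f} → DegreeBelow {n} d f → DegreeBelow {suc n} d (λ y → f (Vec.tail y))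
  DegreeBelow-tail deg-zero         = deg-zero
  DegreeBelow-tail (deg-const c)    = deg-const c
  DegreeBelow-tail (deg-+ df dg)    = deg-+ (DegreeBelow-tail df) (DegreeBelow-tail dg)
  DegreeBelow-tail (deg-scale c df) = deg-scale c (DegreeBelow-tail df)
  DegreeBelow-tail (deg-coord i df) = deg-ext (λ { (a ∷ y) → refl }) (deg-coord (suc i) (DegreeBelow-tail df))
  DegreeBelow-tail (deg-ext f≗g df) = deg-ext (λ y → f≗g (Vec.tail y)) (DegreeBelow-tail df)

module MonomialFunctions (p : ℕ) .{{_ : NonZero p}} where
  open PrimeField p
  open VectorSpace p using (V; _⊕_; 𝟘)
  open PolynomialFunctions p
  open RingListSum ring using (Sum-cong; Sum-*ˡ; Sum-allFin-suc)
  open Solver using (solve; _:+_; _:-_; _:*_; _:=_; :-_; con)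
  open ≡ using (refl; sym; trans)

  infixr 8 _^_
  _^_ : F → ℕ → F
  a ^ zero  = 1#
  a ^ suc e = a * a ^ e

  monomial : ∀ {n} → Vec ℕ n → V n → F
  monomial []      []      = 1#
  monomial (e ∷ m) (a ∷ y) = a ^ e * monomial m y

  decrement : ∀ {n} → Fin n → Vec ℕ n → Vec ℕ n
  decrement zero    (e ∷ m) = (e ∸ 1) ∷ m
  decrement (suc j) (e ∷ m) = e ∷ decrement j m

  ∂ : ∀ {n} → V n → Vec ℕ n → V n → F
  ∂ {n} u m y = sumₚ p n (λ j → (lookup u j * ⟦ lookup m j ⟧) * monomial (decrement j m) y)

  DegreeBelow-head^ : ∀ {n} e → DegreeBelow {suc n} (suc e) (λ y → Vec.head y ^ e)
  DegreeBelow-head^ zero    = deg-const 1#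
  DegreeBelow-head^ (suc e) = deg-ext (λ { (a ∷ y) → refl }) (deg-coord zero (DegreeBelow-head^ e))

  DegreeBelow-monomial : ∀ {n} (m : Vec ℕ n) → DegreeBelow (suc (Vec.sum m)) (monomial m)
  DegreeBelow-monomial []      = deg-ext (λ { [] → refl }) (deg-const 1#)
  DegreeBelow-monomial (e ∷ m) = subst (λ d → DegreeBelow d (monomial (e ∷ m))) (ℕₚ.+-suc e (Vec.sum m))
    (deg-ext (λ { (a ∷ y) → refl }) (DegreeBelow-* (DegreeBelow-head^ e) (DegreeBelow-tail (DegreeBelow-monomial m))))

  ∂-cons : ∀ {n} b (u : V n) e m a y →
           ∂ (b ∷ u) (e ∷ m) (a ∷ y) ≡ (b * ⟦ e ⟧) * (a ^ (e ∸ 1) * monomial m y) + a ^ e * ∂ u m y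
  ∂-cons {n} b u e m a y = trans (Sum-allFin-suc n _) (cong ((b * ⟦ e ⟧) * (a ^ (e ∸ 1) * monomial m y) +_)
    (trans (Sum-cong (allFin n) (λ j → solve 3 (λ x q z → x :* (q :* z) := q :* (x :* z)) refl
                                               (lookup u j * ⟦ lookup m j ⟧) (a ^ e) (monomial (decrement j m) y)))
           (sym (Sum-*ˡ (allFin n) (a ^ e) (λ j → (lookup u j * ⟦ lookup m j ⟧) * monomial (decrement j m) y)))))

  binomialRemainder : ∀ {n} → F → ℕ → V (suc n) → F
  binomialRemainder b e y = (Vec.head y + b) ^ e - Vec.head y ^ e - (⟦ e ⟧ * b) * Vec.head y ^ (e ∸ 1)

  DegreeBelow-binomialRemainder : ∀ {n} b e → DegreeBelow {suc n} (ℕ.pred e) (binomialRemainder b e)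
  DegreeBelow-binomialRemainder b zero =
    ≗0⇒DegreeBelow (λ _ → solve 1 (λ b → con (ℤ.+ 1) :- con (ℤ.+ 1) :- (con (ℤ.+ 0) :* b) :* con (ℤ.+ 1) := con (ℤ.+ 0)) refl b)
  DegreeBelow-binomialRemainder {n} b (suc e) =
    deg-ext step (deg-+ (deg-coord′ zero (DegreeBelow-binomialRemainder b e)) (deg-scale b (DegreeBelow-Δ (b ∷ 𝟘 n) (DegreeBelow-head^ e))))
    where
    e*a*a^[e-1] : ∀ a → ⟦ e ⟧ * (a * a ^ (e ∸ 1)) ≡ ⟦ e ⟧ * a ^ e
    e*a*a^[e-1] a = ⟦k⟧*a*a^[k-1] e
      where
      ⟦k⟧*a*a^[k-1] : ∀ k → ⟦ k ⟧ * (a * a ^ (k ∸ 1)) ≡ ⟦ k ⟧ * a ^ k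
      ⟦k⟧*a*a^[k-1] zero    = trans (zeroˡ (a * 1#)) (sym (zeroˡ 1#))
      ⟦k⟧*a*a^[k-1] (suc _) = refl
    step : ∀ y → lookup y zero * binomialRemainder b e y + b * Δ (b ∷ 𝟘 n) (λ y → Vec.head y ^ e) y ≡ binomialRemainder b (suc e) y
    step (a ∷ y) = begin
      a * ((a + b) ^ e - a ^ e - (⟦ e ⟧ * b) * a ^ (e ∸ 1)) + b * ((a + b) ^ e - a ^ e)
        ≡⟨ solve 6 (λ a b q r k x → a :* (q :- r :- (k :* b) :* x) :+ b :* (q :- r)
                                    := (a :+ b) :* q :- a :* r :- b :* r :- b :* (k :* (a :* x))) refl
                   a b ((a + b) ^ e) (a ^ e) ⟦ e ⟧ (a ^ (e ∸ 1)) ⟩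
      (a + b) * (a + b) ^ e - a * a ^ e - b * a ^ e - b * (⟦ e ⟧ * (a * a ^ (e ∸ 1)))
        ≡⟨ cong (λ z → (a + b) * (a + b) ^ e - a * a ^ e - b * a ^ e - b * z) (e*a*a^[e-1] a) ⟩
      (a + b) * (a + b) ^ e - a * a ^ e - b * a ^ e - b * (⟦ e ⟧ * a ^ e)
        ≡⟨ solve 5 (λ a b q r k → (a :+ b) :* q :- a :* r :- b :* r :- b :* (k :* r)
                                  := (a :+ b) :* q :- a :* r :- ((con (ℤ.+ 1) :+ k) :* b) :* r) refl
                   a b ((a + b) ^ e) (a ^ e) ⟦ e ⟧ ⟩
      (a + b) * (a + b) ^ e - a * a ^ e - ((1# + ⟦ e ⟧) * b) * a ^ e
        ≡⟨ cong (λ z → (a + b) * (a + b) ^ e - a * a ^ e - (z * b) * a ^ e) (⟦+⟧ 1 e) ⟨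
      binomialRemainder b (suc e) (a ∷ y) ∎
      where open ≡-Reasoning

  DegreeBelow-Δ-monomial-∂ : ∀ {n} (u : V n) (m : Vec ℕ n) → DegreeBelow (ℕ.pred (Vec.sum m)) (λ y → Δ u (monomial m) y - ∂ u m y)
  DegreeBelow-Δ-monomial-∂ []      []      = ≗0⇒DegreeBelow (λ { [] → solve 0 (con (ℤ.+ 1) :- con (ℤ.+ 1) :- con (ℤ.+ 0) := con (ℤ.+ 0)) refl })
  DegreeBelow-Δ-monomial-∂ {suc n} (b ∷ u) (e ∷ m) = deg-ext leibniz (deg-+ (deg-+ remainder-part derivative-part) lower-part)
    where
    s = Vec.sum m
    remainder-part : DegreeBelow (ℕ.pred (e ℕ.+ s)) (λ y → binomialRemainder b e y * monomial m (Vec.tail y ⊕ u))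
    remainder-part = DegreeBelow-*-≤ (DegreeBelow-binomialRemainder b e) (DegreeBelow-tail (DegreeBelow-translate u (DegreeBelow-monomial m)))
                                     (bound e)
      where
      bound : ∀ e → ℕ.pred e ≡ 0 ⊎ suc s ≡ 0 ⊎ ℕ.pred (ℕ.pred e ℕ.+ suc s) ≤ ℕ.pred (e ℕ.+ s)
      bound zero    = inj₁ refl
      bound (suc e) = inj₂ (inj₂ (ℕₚ.≤-reflexive (cong ℕ.pred (ℕₚ.+-suc e s))))
    derivative-part : DegreeBelow (ℕ.pred (e ℕ.+ s)) (λ y → ((⟦ e ⟧ * b) * Vec.head y ^ (e ∸ 1)) * Δ u (monomial m) (Vec.tail y))
    derivative-part = DegreeBelow-*-≤ (coefficient e) (DegreeBelow-tail (DegreeBelow-Δ u (DegreeBelow-monomial m))) (inj₂ (inj₂ ℕₚ.≤-refl))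
      where
      coefficient : ∀ e → DegreeBelow {suc n} e (λ y → (⟦ e ⟧ * b) * Vec.head y ^ (e ∸ 1))
      coefficient zero    = ≗0⇒DegreeBelow (λ y → trans (cong (_* Vec.head y ^ 0) (zeroˡ b)) (zeroˡ _))
      coefficient (suc e) = deg-scale (⟦ suc e ⟧ * b) (DegreeBelow-head^ e)
    lower-part : DegreeBelow (ℕ.pred (e ℕ.+ s)) (λ y → Vec.head y ^ e * (Δ u (monomial m) (Vec.tail y) - ∂ u m (Vec.tail y)))
    lower-part = DegreeBelow-*-≤ (DegreeBelow-head^ e) (DegreeBelow-tail (DegreeBelow-Δ-monomial-∂ u m)) (bound s)
      where
      bound : ∀ s → suc e ≡ 0 ⊎ ℕ.pred s ≡ 0 ⊎ ℕ.pred (suc e ℕ.+ ℕ.pred s) ≤ ℕ.pred (e ℕ.+ s)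
      bound zero    = inj₂ (inj₁ refl)
      bound (suc k) = inj₂ (inj₂ (ℕₚ.≤-reflexive (cong ℕ.pred (sym (ℕₚ.+-suc e k)))))
    leibniz : ∀ y → (binomialRemainder b e y * monomial m (Vec.tail y ⊕ u)
                     + ((⟦ e ⟧ * b) * Vec.head y ^ (e ∸ 1)) * Δ u (monomial m) (Vec.tail y))
                    + Vec.head y ^ e * (Δ u (monomial m) (Vec.tail y) - ∂ u m (Vec.tail y))
                  ≡ Δ (b ∷ u) (monomial (e ∷ m)) y - ∂ (b ∷ u) (e ∷ m) y
    leibniz (a ∷ y) = trans
      (solve 8 (λ q r x k b t s d →
                  ((q :- r :- (k :* b) :* x) :* t :+ ((k :* b) :* x) :* (t :- s)) :+ r :* ((t :- s) :- d)
                  := (q :* t :- r :* s) :- ((b :* k) :* (x :* s) :+ r :* d)) refl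
             ((a + b) ^ e) (a ^ e) (a ^ (e ∸ 1)) ⟦ e ⟧ b (monomial m (y ⊕ u)) (monomial m y) (∂ u m y))
      (cong (λ z → (a + b) ^ e * monomial m (y ⊕ u) - a ^ e * monomial m y - z) (sym (∂-cons b u e m a y)))

module Polynomials (p : ℕ) .{{_ : NonZero p}} (n : ℕ) where
  open PrimeField p
  open RingListSum ring using (Sum; Sum-cong; Sum-allFin-single)
  open MonomialFunctions p using (decrement)
  open InnerProduct p using (lookup-basis-≡; lookup-basis-≢)
  open ≡ using (refl; sym; trans)
  open ≡-Reasoning

  P : Set
  P = Poly p n

  Term : Set
  Term = F × Vec ℕ n

  infixl 7 _⊗_
  _⊗_ : Term → Term → Term
  t ⊗ s = proj₁ t * proj₁ s , zipWith ℕ._+_ (proj₂ t) (proj₂ s)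

  coeff-∷-≡ : ∀ a e (f : P) m → e ≡ m → coeff p ((a , e) ∷ f) m ≡ a + coeff p f m
  coeff-∷-≡ a e f m e≡m with Vecₚ.≡-dec ℕ._≟_ e m
  ... | yes _   = refl
  ... | no  e≢m = ⊥-elim (e≢m e≡m)

  coeff-∷-≢ : ∀ a e (f : P) m → e ≢ m → coeff p ((a , e) ∷ f) m ≡ coeff p f m
  coeff-∷-≢ a e f m e≢m with Vecₚ.≡-dec ℕ._≟_ e m
  ... | yes e≡m = ⊥-elim (e≢m e≡m)
  ... | no  _   = refl

  coeff-++ : ∀ (f g : P) m → coeff p (f ++ g) m ≡ coeff p f m + coeff p g m
  coeff-++ []            g m = sym (+-identityˡ (coeff p g m))
  coeff-++ ((a , e) ∷ f) g m with Vecₚ.≡-dec ℕ._≟_ e m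
  ... | yes _ = trans (cong (a +_) (coeff-++ f g m)) (sym (+-assoc a (coeff p f m) (coeff p g m)))
  ... | no  _ = coeff-++ f g m

  coeff-concatMap : ∀ {A : Set} (h : A → P) (xs : List A) m → coeff p (concatMap h xs) m ≡ Sum xs (λ x → coeff p (h x) m)
  coeff-concatMap h []       m = refl
  coeff-concatMap h (x ∷ xs) m = trans (coeff-++ (h x) (concatMap h xs) m) (cong (coeff p (h x) m +_) (coeff-concatMap h xs m))

  unitExp : ∀ {k} → Fin k → Vec ℕ k
  unitExp {suc k} zero    = 1 ∷ replicate k 0
  unitExp         (suc j) = 0 ∷ unitExp j

  private
    exponent : P → Vec ℕ n
    exponent []            = replicate n 0
    exponent ((_ , e) ∷ _) = e

    lookup-unitExp-≡ : ∀ {k} (i : Fin k) → 1 ≡ lookup (unitExp i) i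
    lookup-unitExp-≡ zero    = refl
    lookup-unitExp-≡ (suc i) = lookup-unitExp-≡ i

    lookup-unitExp-≢ : ∀ {k} (i j : Fin k) → i ≢ j → 0 ≡ lookup (unitExp i) j
    lookup-unitExp-≢         zero    zero    i≢j = ⊥-elim (i≢j refl)
    lookup-unitExp-≢ {suc k} zero    (suc j) i≢j = sym (Vecₚ.lookup-replicate j 0)
    lookup-unitExp-≢         (suc i) zero    i≢j = refl
    lookup-unitExp-≢         (suc i) (suc j) i≢j = lookup-unitExp-≢ i j (i≢j ∘ cong suc)

    lookup-exponent-var : ∀ i j → lookup (exponent (var p n i)) j ≡ lookup (unitExp i) j
    lookup-exponent-var i j
      rewrite (lookup (exponent (var p n i)) j ≡ _ ∋ trans (Vecₚ.lookup∘tabulate _ j) (Vecₚ.lookup∘tabulate _ j))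
      with i ≟ᶠ j
    ... | yes refl = lookup-unitExp-≡ i
    ... | no  i≢j  = lookup-unitExp-≢ i j i≢j

  var≡ : ∀ i → var p n i ≡ (1# , unitExp i) ∷ []
  var≡ i = cong (λ e → (1# , e) ∷ [])
    (trans (sym (Vecₚ.tabulate∘lookup _)) (trans (Vecₚ.tabulate-cong (lookup-exponent-var i)) (Vecₚ.tabulate∘lookup (unitExp i))))

  coeff÷x : P → Vec ℕ n → Fin n → F
  coeff÷x Q m j with lookup m j
  ... | zero  = 0#
  ... | suc _ = coeff p Q (decrement j m)

  private
    unitExp+e≢m : ∀ {k} (j : Fin k) e m → lookup m j ≡ 0 → zipWith ℕ._+_ (unitExp j) e ≢ m
    unitExp+e≢m zero    (x ∷ e) (y ∷ m) mⱼ≡0 eq with trans (proj₁ (Vecₚ.∷-injective eq)) mⱼ≡0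
    ... | ()
    unitExp+e≢m (suc j) (x ∷ e) (y ∷ m) mⱼ≡0 eq = unitExp+e≢m j e m mⱼ≡0 (proj₂ (Vecₚ.∷-injective eq))

    unitExp+e≡m⇒ : ∀ {k} (j : Fin k) e m → zipWith ℕ._+_ (unitExp j) e ≡ m → e ≡ decrement j m
    unitExp+e≡m⇒ zero    (x ∷ e) (y ∷ m) eq with Vecₚ.∷-injective eq
    ... | x+1≡y , e≡m = cong₂ _∷_ (cong (_∸ 1) x+1≡y) (trans (sym (Vecₚ.zipWith-identityˡ ℕₚ.+-identityˡ e)) e≡m)
    unitExp+e≡m⇒ (suc j) (x ∷ e) (y ∷ m) eq with Vecₚ.∷-injective eq
    ... | x≡y , e≡m = cong₂ _∷_ x≡y (unitExp+e≡m⇒ j e m e≡m)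

    unitExp+e≡m⇐ : ∀ {k} (j : Fin k) e m r → lookup m j ≡ suc r → e ≡ decrement j m → zipWith ℕ._+_ (unitExp j) e ≡ m
    unitExp+e≡m⇐ zero    (x ∷ e) (.(suc r) ∷ m) r refl eq with Vecₚ.∷-injective eq
    ... | x≡r , e≡m = cong₂ _∷_ (cong suc x≡r) (trans (Vecₚ.zipWith-identityˡ ℕₚ.+-identityˡ e) e≡m)
    unitExp+e≡m⇐ (suc j) (x ∷ e) (y ∷ m) r mⱼ≡1+r eq with Vecₚ.∷-injective eq
    ... | x≡y , e≡m = cong₂ _∷_ x≡y (unitExp+e≡m⇐ j e m r mⱼ≡1+r e≡m)

  coeff-x* : ∀ a j (Q : P) m → coeff p (map ((a , unitExp j) ⊗_) Q) m ≡ a * coeff÷x Q m j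
  coeff-x* a j Q m with lookup m j in mⱼ
  ... | zero  = trans (no-term Q) (sym (zeroʳ a))
    where
    no-term : ∀ (Q : P) → coeff p (map ((a , unitExp j) ⊗_) Q) m ≡ 0#
    no-term []            = refl
    no-term ((b , e) ∷ Q) = trans (coeff-∷-≢ (a * b) _ _ m (unitExp+e≢m j e m mⱼ)) (no-term Q)
  ... | suc r = shifted Q
    where
    shifted : ∀ (Q : P) → coeff p (map ((a , unitExp j) ⊗_) Q) m ≡ a * coeff p Q (decrement j m)
    shifted []            = sym (zeroʳ a)
    shifted ((b , e) ∷ Q) with Vecₚ.≡-dec ℕ._≟_ e (decrement j m)
    ... | yes e≡m-eⱼ = trans (coeff-∷-≡ (a * b) _ _ m (unitExp+e≡m⇐ j e m r mⱼ e≡m-eⱼ))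
                             (trans (cong (a * b +_) (shifted Q)) (sym (*-distribˡ-+ a b _)))
    ... | no  e≢m-eⱼ = trans (coeff-∷-≢ (a * b) _ _ m (e≢m-eⱼ ∘ unitExp+e≡m⇒ j e m)) (shifted Q)

  coeff-term* : ∀ a j (Q : P) m → coeff p (polyMul p ((a , unitExp j) ∷ []) Q) m ≡ a * coeff÷x Q m j
  coeff-term* a j Q m = begin
    coeff p (map ((a , unitExp j) ⊗_) Q ++ []) m         ≡⟨ coeff-++ (map ((a , unitExp j) ⊗_) Q) [] m ⟩
    coeff p (map ((a , unitExp j) ⊗_) Q) m + 0#          ≡⟨ +-identityʳ _ ⟩
    coeff p (map ((a , unitExp j) ⊗_) Q) m               ≡⟨ coeff-x* a j Q m ⟩
    a * coeff÷x Q m j                                    ∎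

  polyMul-concatMap : ∀ {A : Set} (g : A → P) xs Q → polyMul p (concatMap g xs) Q ≡ concatMap (λ x → polyMul p (g x) Q) xs
  polyMul-concatMap g []       Q = refl
  polyMul-concatMap g (x ∷ xs) Q =
    trans (Listₚ.concatMap-++ (λ t → map (t ⊗_) Q) (g x) (concatMap g xs)) (cong (polyMul p (g x) Q ++_) (polyMul-concatMap g xs Q))

  IsLinearForm : P → Vecₚ p n → Set
  IsLinearForm L u = ∀ Q m → coeff p (polyMul p L Q) m ≡ sumₚ p n (λ j → lookup u j * coeff÷x Q m j)

  var-isLinearForm : ∀ i → IsLinearForm (var p n i) (basis p n i)
  var-isLinearForm i Q m = begin
    coeff p (polyMul p (var p n i) Q) m                              ≡⟨ cong (λ L → coeff p (polyMul p L Q) m) (var≡ i) ⟩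
    coeff p (polyMul p ((1# , unitExp i) ∷ []) Q) m                  ≡⟨ coeff-term* 1# i Q m ⟩
    1# * coeff÷x Q m i                                               ≡⟨ cong (_* coeff÷x Q m i) (lookup-basis-≡ i) ⟨
    lookup (basis p n i) i * coeff÷x Q m i                           ≡⟨ Sum-allFin-single n _ i (λ j j≢i →
                                                                      trans (cong (_* coeff÷x Q m j) (lookup-basis-≢ (j≢i ∘ sym))) (zeroˡ _)) ⟨
    sumₚ p n (λ j → lookup (basis p n i) j * coeff÷x Q m j)          ∎

  linForm≡ : ∀ (a : Fin n → F) → linForm p n a ≡ concatMap (λ j → (a j * 1# , unitExp j) ∷ []) (allFin n)
  linForm≡ a = Listₚ.concatMap-cong (λ j → cong (map (λ t → a j * proj₁ t , proj₂ t)) (var≡ j)) (allFin n)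

  linForm-isLinearForm : ∀ (a : Fin n → F) → IsLinearForm (linForm p n a) (tabulate a)
  linForm-isLinearForm a Q m = begin
    coeff p (polyMul p (linForm p n a) Q) m
      ≡⟨ cong (λ L → coeff p (polyMul p L Q) m) (linForm≡ a) ⟩
    coeff p (polyMul p (concatMap (λ j → (a j * 1# , unitExp j) ∷ []) (allFin n)) Q) m
      ≡⟨ cong (λ L → coeff p L m) (polyMul-concatMap _ (allFin n) Q) ⟩
    coeff p (concatMap (λ j → polyMul p ((a j * 1# , unitExp j) ∷ []) Q) (allFin n)) m
      ≡⟨ coeff-concatMap _ (allFin n) m ⟩
    Sum (allFin n) (λ j → coeff p (polyMul p ((a j * 1# , unitExp j) ∷ []) Q) m)
      ≡⟨ Sum-cong (allFin n) (λ j → trans (coeff-term* (a j * 1#) j Q m)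
                                         (cong (_* coeff÷x Q m j) (trans (*-identityʳ (a j)) (sym (Vecₚ.lookup∘tabulate a j))))) ⟩
    sumₚ p n (λ j → lookup (tabulate a) j * coeff÷x Q m j) ∎

  polyMul-identityˡ : ∀ (Q : P) → polyMul p (polyOne p n) Q ≡ Q
  polyMul-identityˡ Q = trans (Listₚ.++-identityʳ _) (map-1⊗ Q)
    where
    map-1⊗ : ∀ (Q : P) → map ((1# , replicate n 0) ⊗_) Q ≡ Q
    map-1⊗ []            = refl
    map-1⊗ ((a , e) ∷ Q) = cong₂ _∷_ (cong₂ _,_ (*-identityˡ a) (Vecₚ.zipWith-identityˡ ℕₚ.+-identityˡ e)) (map-1⊗ Q)

  polyMul-assoc : ∀ (A B C : P) → polyMul p (polyMul p A B) C ≡ polyMul p A (polyMul p B C)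
  polyMul-assoc []      B C = refl
  polyMul-assoc (a ∷ A) B C = begin
    polyMul p (map (a ⊗_) B ++ polyMul p A B) C                 ≡⟨ Listₚ.concatMap-++ (λ t → map (t ⊗_) C) (map (a ⊗_) B) _ ⟩
    polyMul p (map (a ⊗_) B) C ++ polyMul p (polyMul p A B) C   ≡⟨ cong₂ _++_ (map-⊗-polyMul B) (polyMul-assoc A B C) ⟩
    map (a ⊗_) (polyMul p B C) ++ polyMul p A (polyMul p B C)   ∎
    where
    ⊗-assoc : ∀ t s r → (t ⊗ s) ⊗ r ≡ t ⊗ (s ⊗ r)
    ⊗-assoc t s r = cong₂ _,_ (*-assoc (proj₁ t) (proj₁ s) (proj₁ r)) (Vecₚ.zipWith-assoc ℕₚ.+-assoc (proj₂ t) (proj₂ s) (proj₂ r))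
    map-⊗-polyMul : ∀ (B : P) → polyMul p (map (a ⊗_) B) C ≡ map (a ⊗_) (polyMul p B C)
    map-⊗-polyMul []      = refl
    map-⊗-polyMul (b ∷ B) = begin
      map ((a ⊗ b) ⊗_) C ++ polyMul p (map (a ⊗_) B) C    ≡⟨ cong₂ _++_ (trans (Listₚ.map-cong (⊗-assoc a b) C) (Listₚ.map-∘ C))
                                                                          (map-⊗-polyMul B) ⟩
      map (a ⊗_) (map (b ⊗_) C) ++ map (a ⊗_) (polyMul p B C) ≡⟨ Listₚ.map-++ (a ⊗_) (map (b ⊗_) C) _ ⟨
      map (a ⊗_) (map (b ⊗_) C ++ polyMul p B C)           ∎

  Homogeneous : ℕ → P → Set
  Homogeneous k = All (λ t → Vec.sum (proj₂ t) ≡ k)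

  private
    sum-zipWith-+ : ∀ {k} (e f : Vec ℕ k) → Vec.sum (zipWith ℕ._+_ e f) ≡ Vec.sum e ℕ.+ Vec.sum f
    sum-zipWith-+ []      []      = refl
    sum-zipWith-+ (a ∷ e) (b ∷ f) = trans (cong ((a ℕ.+ b) ℕ.+_) (sum-zipWith-+ e f)) (interchange a b (Vec.sum e) (Vec.sum f))
      where open import Algebra.Properties.CommutativeSemigroup ℕₚ.+-commutativeSemigroup using (interchange)

    sum-replicate-0 : ∀ k → Vec.sum (replicate k 0) ≡ 0
    sum-replicate-0 zero    = refl
    sum-replicate-0 (suc k) = sum-replicate-0 k

    sum-unitExp : ∀ {k} (j : Fin k) → Vec.sum (unitExp j) ≡ 1
    sum-unitExp {suc k} zero    = cong suc (sum-replicate-0 k)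
    sum-unitExp         (suc j) = sum-unitExp j

  Homogeneous-polyMul : ∀ {a b} {A B : P} → Homogeneous a A → Homogeneous b B → Homogeneous (a ℕ.+ b) (polyMul p A B)
  Homogeneous-polyMul                  []             hB = []
  Homogeneous-polyMul {a} {b} {t ∷ A} {B} (ht ∷ hA) hB =
    Allₚ.++⁺ (Allₚ.map⁺ (All.map (λ {s} hs → trans (sum-zipWith-+ (proj₂ t) (proj₂ s)) (cong₂ ℕ._+_ ht hs)) hB)) (Homogeneous-polyMul hA hB)

  Homogeneous-polyOne : Homogeneous 0 (polyOne p n)
  Homogeneous-polyOne = sum-replicate-0 n ∷ []

  Homogeneous-var : ∀ i → Homogeneous 1 (var p n i)
  Homogeneous-var i = subst (Homogeneous 1) (sym (var≡ i)) (sum-unitExp i ∷ [])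

  Homogeneous-linForm : ∀ a → Homogeneous 1 (linForm p n a)
  Homogeneous-linForm a = subst (Homogeneous 1) (sym (linForm≡ a)) (go (allFin n))
    where
    go : ∀ js → Homogeneous 1 (concatMap (λ j → (a j * 1# , unitExp j) ∷ []) js)
    go []       = []
    go (j ∷ js) = sum-unitExp j ∷ go js

module ExponentVectors (p : ℕ) .{{_ : NonZero p}} where
  open PrimeField p
  open MonomialFunctions p using (decrement; monomial)
  open ≡ using (refl; sym; trans)

  factorial : ∀ {k} → Vec ℕ k → F
  factorial []      = 1#
  factorial (e ∷ m) = ⟦ e ! ⟧ * factorial m

  factorial-decrement : ∀ {k} (j : Fin k) (m : Vec ℕ k) r → lookup m j ≡ suc r → factorial m ≡ ⟦ suc r ⟧ * factorial (decrement j m)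
  factorial-decrement zero    (.(suc r) ∷ m) r refl = trans (cong (_* factorial m) (⟦*⟧ (suc r) (r !))) (*-assoc ⟦ suc r ⟧ ⟦ r ! ⟧ (factorial m))
  factorial-decrement (suc j) (e ∷ m)        r mⱼ≡1+r = trans (cong (⟦ e ! ⟧ *_) (factorial-decrement j m r mⱼ≡1+r))
    (trans (sym (*-assoc ⟦ e ! ⟧ ⟦ suc r ⟧ _)) (trans (cong (_* factorial (decrement j m)) (*-comm ⟦ e ! ⟧ ⟦ suc r ⟧)) (*-assoc ⟦ suc r ⟧ ⟦ e ! ⟧ _)))

  sum-decrement : ∀ {k} (j : Fin k) (m : Vec ℕ k) r → lookup m j ≡ suc r → Vec.sum m ≡ suc (Vec.sum (decrement j m))
  sum-decrement zero    (.(suc r) ∷ m) r refl    = refl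
  sum-decrement (suc j) (e ∷ m)        r mⱼ≡1+r = trans (cong (e ℕ.+_) (sum-decrement j m r mⱼ≡1+r)) (ℕₚ.+-suc e _)

  sum≡0⇒≡0 : ∀ {k} (m : Vec ℕ k) → Vec.sum m ≡ 0 → m ≡ replicate k 0
  sum≡0⇒≡0 []      _     = refl
  sum≡0⇒≡0 (e ∷ m) Σm≡0 = cong₂ _∷_ (ℕₚ.m+n≡0⇒m≡0 e Σm≡0) (sum≡0⇒≡0 m (ℕₚ.m+n≡0⇒n≡0 e Σm≡0))

  factorial-0 : ∀ k → factorial (replicate k 0) ≡ 1#
  factorial-0 zero    = refl
  factorial-0 (suc k) = trans (cong (⟦ 1 ⟧ *_) (factorial-0 k)) (*-identityʳ ⟦ 1 ⟧)

  monomial-0 : ∀ {k} (y : Vec F k) → monomial (replicate k 0) y ≡ 1#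
  monomial-0 []      = refl
  monomial-0 (a ∷ y) = trans (cong (1# *_) (monomial-0 y)) (*-identityˡ 1#)

  sign : ℕ → F
  sign zero    = 1#
  sign (suc k) = - sign k

  module _ (prime : Prime p) where
    open PrimeFieldArithmetic p prime

    factorial≢0 : ∀ {k} (m : Vec ℕ k) → (∀ i → lookup m i < p) → factorial m ≢ 0#
    factorial≢0 []      _      = 1≢0
    factorial≢0 (e ∷ m) m<p = x*y≢0 (⟦n!⟧≢0 e (m<p zero)) (factorial≢0 m (m<p ∘ suc))

    sign≢0 : ∀ k → sign k ≢ 0#
    sign≢0 zero    = 1≢0
    sign≢0 (suc k) -s≡0 = sign≢0 k (trans (sym (-‿involutive (sign k))) (trans (cong -_ -s≡0) -0#≈0#))

module Duality (p : ℕ) .{{_ : NonZero p}} (n : ℕ) where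
  open PrimeField p
  open VectorSpace p using (V; _⊕_; 𝟘; group)
  open PolynomialFunctions p
  open MonomialFunctions p
  open Polynomials p n
  open ExponentVectors p
  open GroupAlgebra ring (group n)
  open ScaledGenerators p (FpRing p) n
  open RingListSum ring using (Sum-cong; Sum-*ˡ)
  open Solver using (solve; _:+_; _:-_; _:*_; _:=_; :-_; con)
  open ≡ using (refl; sym; trans)
  open ≡-Reasoning
  private
    module 𝔽[G] = GroupRing p (FpRing p) n

  1-gᵘ : V n → R[G]
  1-gᵘ u = 𝔽[G].subGR 𝔽[G].oneGR (𝔽[G].gen u)

  private
    isScaledGen : ∀ r v → IsScaledGen (𝔽[G].scaledGen r v) v r
    isScaledGen r v = scaledGen-≡ r v , scaledGen-≢ r v

  1-gᵘ▷ : ∀ u f y → (1-gᵘ u ▷ f) y ≡ f y - f (y ⊕ u)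
  1-gᵘ▷ u f y = trans (1-rg▷ (isScaledGen 1# (𝟘 n)) (isScaledGen 1# u) f y) (cong (λ z → f y + - z) (*-identityˡ (f (y ⊕ u))))

  oneGR▷ : ∀ f y → (𝔽[G].oneGR ▷ f) y ≡ f y
  oneGR▷ = ▷-identity (isScaledGen 1# (𝟘 n))

  record Dual (Q : P) (Ψ : R[G]) (k : ℕ) : Set where
    field
      annihilates : ∀ f → DegreeBelow k f → (Ψ ▷ f) (𝟘 n) ≡ 0#
      on-monomial : ∀ m → Vec.sum m ≡ k → (Ψ ▷ monomial m) (𝟘 n) ≡ sign k * (factorial m * coeff p Q m)
      homogeneous : Homogeneous k Q

  Dual-polyOne : Dual (polyOne p n) 𝔽[G].oneGR 0
  Dual-polyOne = record
    { annihilates = λ f df → trans (oneGR▷ f (𝟘 n)) (DegreeBelow-0 df (𝟘 n))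
    ; on-monomial = on-monomial
    ; homogeneous = Homogeneous-polyOne }
    where
    on-monomial : ∀ m → Vec.sum m ≡ 0 → (𝔽[G].oneGR ▷ monomial m) (𝟘 n) ≡ sign 0 * (factorial m * coeff p (polyOne p n) m)
    on-monomial m Σm≡0 rewrite sum≡0⇒≡0 m Σm≡0 = begin
      (𝔽[G].oneGR ▷ monomial (replicate n 0)) (𝟘 n)        ≡⟨ oneGR▷ (monomial (replicate n 0)) (𝟘 n) ⟩
      monomial (replicate n 0) (𝟘 n)                        ≡⟨ monomial-0 (𝟘 n) ⟩
      1#                                                    ≡⟨ solve 0 (con (ℤ.+ 1) := con (ℤ.+ 1) :* (con (ℤ.+ 1) :* (con (ℤ.+ 1) :+ con (ℤ.+ 0)))) refl ⟩
      1# * (1# * (1# + 0#))                                 ≡⟨ cong₂ (λ a b → 1# * (a * b)) (factorial-0 n) (coeff-∷-≡ 1# (replicate n 0) [] _ refl) ⟨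
      sign 0 * (factorial (replicate n 0) * coeff p (polyOne p n) (replicate n 0)) ∎

  Dual-cong : ∀ {Q Ψ Ψ′ k} → Ψ ≗ Ψ′ → Dual Q Ψ k → Dual Q Ψ′ k
  Dual-cong {Q} {Ψ} {Ψ′} Ψ≗Ψ′ dual = record
    { annihilates = λ f df → trans (sym (▷-cong {Ψ} {Ψ′} {f} Ψ≗Ψ′ (λ _ → refl) (𝟘 n))) (Dual.annihilates dual f df)
    ; on-monomial = λ m Σm≡k → trans (sym (▷-cong {Ψ} {Ψ′} {monomial m} Ψ≗Ψ′ (λ _ → refl) (𝟘 n))) (Dual.on-monomial dual m Σm≡k)
    ; homogeneous = Dual.homogeneous dual }

  module _ {L Q Ψ k} (u : V n) (L-linear : IsLinearForm L u) (dual : Dual Q Ψ k) where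
    open Dual dual

    private
      1-gᵘ⋆Ψ▷ : ∀ f → ((1-gᵘ u ⋆ Ψ) ▷ f) (𝟘 n) ≡ (Ψ ▷ (λ y → f y - f (y ⊕ u))) (𝟘 n)
      1-gᵘ⋆Ψ▷ f = trans (▷-⋆ (1-gᵘ u) Ψ f (𝟘 n)) (▷-cong {Ψ} {Ψ} (λ _ → refl) (1-gᵘ▷ u f) (𝟘 n))

      ∂-term : ∀ m j → Vec.sum m ≡ suc k →
               (lookup u j * ⟦ lookup m j ⟧) * (Ψ ▷ monomial (decrement j m)) (𝟘 n) ≡ sign k * (factorial m * (lookup u j * coeff÷x Q m j))
      ∂-term m j Σm≡1+k with lookup m j in mⱼ
      ... | zero  = solve 4 (λ a A s f → (a :* con (ℤ.+ 0)) :* A := s :* (f :* (a :* con (ℤ.+ 0)))) refl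
                          (lookup u j) ((Ψ ▷ monomial (decrement j m)) (𝟘 n)) (sign k) (factorial m)
      ... | suc r = begin
        (lookup u j * ⟦ suc r ⟧) * (Ψ ▷ monomial (decrement j m)) (𝟘 n)
          ≡⟨ cong ((lookup u j * ⟦ suc r ⟧) *_) (on-monomial (decrement j m) (ℕₚ.suc-injective (trans (sym (sum-decrement j m r mⱼ)) Σm≡1+k))) ⟩
        (lookup u j * ⟦ suc r ⟧) * (sign k * (factorial (decrement j m) * coeff p Q (decrement j m)))
          ≡⟨ solve 5 (λ a K s f c → (a :* K) :* (s :* (f :* c)) := s :* ((K :* f) :* (a :* c))) refl
                     (lookup u j) ⟦ suc r ⟧ (sign k) (factorial (decrement j m)) (coeff p Q (decrement j m)) ⟩
        sign k * ((⟦ suc r ⟧ * factorial (decrement j m)) * (lookup u j * coeff p Q (decrement j m)))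
          ≡⟨ cong (λ z → sign k * (z * (lookup u j * coeff p Q (decrement j m)))) (factorial-decrement j m r mⱼ) ⟨
        sign k * (factorial m * (lookup u j * coeff p Q (decrement j m))) ∎

      Ψ▷∂ : ∀ m → Vec.sum m ≡ suc k → (Ψ ▷ ∂ u m) (𝟘 n) ≡ sign k * (factorial m * coeff p (polyMul p L Q) m)
      Ψ▷∂ m Σm≡1+k = begin
        (Ψ ▷ ∂ u m) (𝟘 n)
          ≡⟨ ▷-Sum (allFin n) Ψ (λ j → lookup u j * ⟦ lookup m j ⟧) (λ j → monomial (decrement j m)) (𝟘 n) ⟩
        sumₚ p n (λ j → (lookup u j * ⟦ lookup m j ⟧) * (Ψ ▷ monomial (decrement j m)) (𝟘 n))
          ≡⟨ Sum-cong (allFin n) (λ j → ∂-term m j Σm≡1+k) ⟩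
        sumₚ p n (λ j → sign k * (factorial m * (lookup u j * coeff÷x Q m j)))
          ≡⟨ Sum-*ˡ (allFin n) (sign k) _ ⟨
        sign k * sumₚ p n (λ j → factorial m * (lookup u j * coeff÷x Q m j))
          ≡⟨ cong (sign k *_) (Sum-*ˡ (allFin n) (factorial m) _) ⟨
        sign k * (factorial m * sumₚ p n (λ j → lookup u j * coeff÷x Q m j))
          ≡⟨ cong (λ z → sign k * (factorial m * z)) (L-linear Q m) ⟨
        sign k * (factorial m * coeff p (polyMul p L Q) m) ∎

    Dual-linear : Homogeneous 1 L → Dual (polyMul p L Q) (1-gᵘ u ⋆ Ψ) (suc k)
    Dual-linear L-homogeneous = record
      { annihilates = annihilates′
      ; on-monomial = on-monomial′
      ; homogeneous = Homogeneous-polyMul L-homogeneous homogeneous }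
      where
      annihilates′ : ∀ f → DegreeBelow (suc k) f → ((1-gᵘ u ⋆ Ψ) ▷ f) (𝟘 n) ≡ 0#
      annihilates′ f df = trans (1-gᵘ⋆Ψ▷ f) (annihilates _ (deg-ext (λ y → solve 2 (λ a b → :- (b :- a) := a :- b) refl (f y) (f (y ⊕ u)))
                                                                 (DegreeBelow-neg (DegreeBelow-Δ u df))))
      on-monomial′ : ∀ m → Vec.sum m ≡ suc k → ((1-gᵘ u ⋆ Ψ) ▷ monomial m) (𝟘 n) ≡ sign (suc k) * (factorial m * coeff p (polyMul p L Q) m)
      on-monomial′ m Σm≡1+k = begin
        ((1-gᵘ u ⋆ Ψ) ▷ monomial m) (𝟘 n)
          ≡⟨ 1-gᵘ⋆Ψ▷ (monomial m) ⟩
        (Ψ ▷ (λ y → monomial m y - monomial m (y ⊕ u))) (𝟘 n)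
          ≡⟨ ▷-cong {Ψ} {Ψ} (λ _ → refl) (λ y → solve 3 (λ a b d → a :- b := :- d :+ :- ((b :- a) :- d)) refl
                                                        (monomial m y) (monomial m (y ⊕ u)) (∂ u m y)) (𝟘 n) ⟩
        (Ψ ▷ (λ y → - ∂ u m y + - remainder y)) (𝟘 n)
          ≡⟨ ▷-+ Ψ (λ y → - ∂ u m y) (λ y → - remainder y) (𝟘 n) ⟩
        (Ψ ▷ (λ y → - ∂ u m y)) (𝟘 n) + (Ψ ▷ (λ y → - remainder y)) (𝟘 n)
          ≡⟨ cong₂ _+_ (▷-neg Ψ (∂ u m) (𝟘 n)) (▷-neg Ψ remainder (𝟘 n)) ⟩
        - (Ψ ▷ ∂ u m) (𝟘 n) + - (Ψ ▷ remainder) (𝟘 n)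
          ≡⟨ cong₂ (λ a b → - a + - b) (Ψ▷∂ m Σm≡1+k) (annihilates remainder remainder-degree) ⟩
        - (sign k * (factorial m * coeff p (polyMul p L Q) m)) + - 0#
          ≡⟨ solve 2 (λ s x → :- (s :* x) :+ :- con (ℤ.+ 0) := (:- s) :* x) refl (sign k) _ ⟩
        sign (suc k) * (factorial m * coeff p (polyMul p L Q) m) ∎
        where
        remainder : V n → F
        remainder y = Δ u (monomial m) y - ∂ u m y
        remainder-degree : DegreeBelow k remainder
        remainder-degree = subst (λ s → DegreeBelow (ℕ.pred s) remainder) Σm≡1+k (DegreeBelow-Δ-monomial-∂ u m)

  data LinearProduct : P → R[G] → ℕ → Set where
    one     : LinearProduct (polyOne p n) 𝔽[G].oneGR 0
    linear  : ∀ {L Q Ψ k} u → IsLinearForm L u → Homogeneous 1 L → LinearProduct Q Ψ k →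
              LinearProduct (polyMul p L Q) (1-gᵘ u ⋆ Ψ) (suc k)
    cong-Ψ  : ∀ {Q Ψ Ψ′ k} → Ψ ≗ Ψ′ → LinearProduct Q Ψ k → LinearProduct Q Ψ′ k

  LinearProduct⇒Dual : ∀ {Q Ψ k} → LinearProduct Q Ψ k → Dual Q Ψ k
  LinearProduct⇒Dual one                           = Dual-polyOne
  LinearProduct⇒Dual (linear u L-linear L-hom lp)  = Dual-linear u L-linear (LinearProduct⇒Dual lp) L-hom
  LinearProduct⇒Dual (cong-Ψ Ψ≗Ψ′ lp)              = Dual-cong Ψ≗Ψ′ (LinearProduct⇒Dual lp)

  LinearProduct-polyMul : ∀ {Q₁ Ψ₁ k₁ Q₂ Ψ₂ k₂} → LinearProduct Q₁ Ψ₁ k₁ → LinearProduct Q₂ Ψ₂ k₂ →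
                          LinearProduct (polyMul p Q₁ Q₂) (Ψ₁ ⋆ Ψ₂) (k₁ ℕ.+ k₂)
  LinearProduct-polyMul {Q₂ = Q₂} {Ψ₂} one lp₂ =
    subst (λ Q → LinearProduct Q _ _) (sym (polyMul-identityˡ Q₂))
          (cong-Ψ (λ v → sym (⋆-identityˡ (isScaledGen 1# (𝟘 n)) Ψ₂ v)) lp₂)
  LinearProduct-polyMul {Q₂ = Q₂} {Ψ₂} (linear {L} {Q} {Ψ} u L-linear L-hom lp₁) lp₂ =
    subst (λ Q′ → LinearProduct Q′ _ _) (sym (polyMul-assoc L Q Q₂))
          (cong-Ψ (λ v → sym (⋆-assoc (1-gᵘ u) Ψ Ψ₂ v)) (linear u L-linear L-hom (LinearProduct-polyMul lp₁ lp₂)))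
  LinearProduct-polyMul {Ψ₂ = Ψ₂} (cong-Ψ Ψ≗Ψ′ lp₁) lp₂ = cong-Ψ (⋆-cong {B = Ψ₂} Ψ≗Ψ′ (λ _ → refl)) (LinearProduct-polyMul lp₁ lp₂)

  LinearProduct-polyPow : ∀ {L u} → IsLinearForm L u → Homogeneous 1 L → ∀ t →
                          LinearProduct (polyPow p L t) (𝔽[G].powGR (1-gᵘ u) t) t
  LinearProduct-polyPow L-linear L-hom zero    = one
  LinearProduct-polyPow L-linear L-hom (suc t) = linear _ L-linear L-hom (LinearProduct-polyPow L-linear L-hom t)

  LinearProduct-polyProd : ∀ m (Qs : Fin m → P) (Ψs : Fin m → R[G]) (ks : Fin m → ℕ) → (∀ j → LinearProduct (Qs j) (Ψs j) (ks j)) →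
                           LinearProduct (polyProd p n m Qs) (𝔽[G].prodGR m Ψs) (foldFin ℕ._+_ 0 m ks)
  LinearProduct-polyProd zero    Qs Ψs ks lps = one
  LinearProduct-polyProd (suc m) Qs Ψs ks lps
    rewrite foldFin-suc (polyMul p) (polyOne p n) m Qs | foldFin-suc 𝔽[G].mulGR 𝔽[G].oneGR m Ψs | foldFin-suc ℕ._+_ 0 m ks =
    LinearProduct-polyMul (lps zero) (LinearProduct-polyProd m (Qs ∘ suc) (Ψs ∘ suc) (ks ∘ suc) (lps ∘ suc))

-- (P4) ⇒ (P5)

module ReducedExponents (p : ℕ) .{{_ : NonZero p}} (prime : Prime p) where
  open PrimeFieldArithmetic p prime using (1<p)
  open ≡ using (refl; sym; trans)

  redExp-≤ : ∀ e → redExp p e ≤ e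
  redExp-≤ e with p ∸ 1
  ... | zero  = ℕₚ.≤-refl
  ... | suc q with e
  ...   | zero  = z≤n
  ...   | suc k = s≤s (m%n≤m k (suc q))

  redExp-≤p-1 : ∀ e → redExp p e ≤ p ∸ 1
  redExp-≤p-1 e with p ∸ 1 in p-1≡
  ... | zero  = ⊥-elim (ℕₚ.<⇒≢ 1<p (sym (trans (sym (ℕₚ.m+[n∸m]≡n {1} {p} (ℕₚ.<⇒≤ 1<p))) (cong suc p-1≡))))
  ... | suc q with e
  ...   | zero  = z≤n
  ...   | suc k = s≤s (ℕₚ.≤-pred (m%n<n k (suc q)))

  redExp-id : ∀ e → e ≤ p ∸ 1 → redExp p e ≡ e
  redExp-id e e≤p-1 with p ∸ 1
  ... | zero  = refl
  ... | suc q with e | e≤p-1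
  ...   | zero  | _         = refl
  ...   | suc k | s≤s k≤q   = cong suc (m<n⇒m%n≡m (s≤s k≤q))

  Reduced : ∀ {n} → Vec ℕ n → Set
  Reduced = VecAll.All (_≤ p ∸ 1)

  reduceExp : ∀ {n} → Vec ℕ n → Vec ℕ n
  reduceExp = Vec.map (redExp p)

  sum-reduceExp-≤ : ∀ {n} (e : Vec ℕ n) → Vec.sum (reduceExp e) ≤ Vec.sum e
  sum-reduceExp-≤ []      = z≤n
  sum-reduceExp-≤ (x ∷ e) = ℕₚ.+-mono-≤ (redExp-≤ x) (sum-reduceExp-≤ e)

  sum-reduceExp-≥⇒≡ : ∀ {n} (e : Vec ℕ n) → Vec.sum e ≤ Vec.sum (reduceExp e) → reduceExp e ≡ e
  sum-reduceExp-≥⇒≡ []      _ = refl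
  sum-reduceExp-≥⇒≡ (x ∷ e) ≥ = cong₂ _∷_ head-fixed (sum-reduceExp-≥⇒≡ e tail-≥)
    where
    head-fixed : redExp p x ≡ x
    head-fixed = ℕₚ.≤-antisym (redExp-≤ x) (ℕₚ.+-cancelʳ-≤ (Vec.sum e) x (redExp p x)
                   (ℕₚ.≤-trans ≥ (ℕₚ.+-monoʳ-≤ (redExp p x) (sum-reduceExp-≤ e))))
    tail-≥ : Vec.sum e ≤ Vec.sum (reduceExp e)
    tail-≥ = ℕₚ.+-cancelˡ-≤ x (Vec.sum e) (Vec.sum (reduceExp e)) (ℕₚ.≤-trans ≥ (ℕₚ.+-monoˡ-≤ (Vec.sum (reduceExp e)) (redExp-≤ x)))

  Reduced-reduceExp : ∀ {n} (e : Vec ℕ n) → Reduced (reduceExp e)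
  Reduced-reduceExp []      = VecAll.[]
  Reduced-reduceExp (x ∷ e) = redExp-≤p-1 x VecAll.∷ Reduced-reduceExp e

  reduceExp-id : ∀ {n} (e : Vec ℕ n) → Reduced e → reduceExp e ≡ e
  reduceExp-id []      VecAll.[]           = refl
  reduceExp-id (x ∷ e) (x≤p-1 VecAll.∷ e-reduced) = cong₂ _∷_ (redExp-id x x≤p-1) (reduceExp-id e e-reduced)

module CoefficientsOfReduction (p : ℕ) .{{_ : NonZero p}} (prime : Prime p) (n : ℕ) where
  open PrimeField p
  open Polynomials p n
  open ReducedExponents p prime
  open ≡ using (refl; sym; trans)

  coeff-reduce-reduced : ∀ {D} (Q : P) → Homogeneous D Q → ∀ m → D ≤ Vec.sum m → Reduced m → coeff p (reduce p Q) m ≡ coeff p Q m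
  coeff-reduce-reduced []            _          m _    _         = refl
  coeff-reduce-reduced {D} ((a , e) ∷ Q) (Σe≡D ∷ hQ) m D≤Σm m-reduced with Vecₚ.≡-dec ℕ._≟_ e m
  ... | yes e≡m = trans (coeff-∷-≡ a (reduceExp e) (reduce p Q) m (trans (reduceExp-id e (subst Reduced (sym e≡m) m-reduced)) e≡m))
                        (cong (a +_) (coeff-reduce-reduced Q hQ m D≤Σm m-reduced))
  ... | no  e≢m = trans (coeff-∷-≢ a (reduceExp e) (reduce p Q) m (e≢m ∘ reduceExp-e≡m⇒e≡m))
                        (coeff-reduce-reduced Q hQ m D≤Σm m-reduced)
    where
    reduceExp-e≡m⇒e≡m : reduceExp e ≡ m → e ≡ m
    reduceExp-e≡m⇒e≡m r≡m = trans (sym (sum-reduceExp-≥⇒≡ e (subst (_≤ Vec.sum (reduceExp e)) (sym Σe≡D)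
                                  (subst (λ z → D ≤ Vec.sum z) (sym r≡m) D≤Σm)))) r≡m

  coeff-reduce-unreduced : ∀ (Q : P) m → ¬ Reduced m → coeff p (reduce p Q) m ≡ 0#
  coeff-reduce-unreduced []            m _           = refl
  coeff-reduce-unreduced ((a , e) ∷ Q) m m-unreduced =
    trans (coeff-∷-≢ a (reduceExp e) (reduce p Q) m (λ r≡m → m-unreduced (subst Reduced r≡m (Reduced-reduceExp e))))
          (coeff-reduce-unreduced Q m m-unreduced)

  coeff-homogeneous : ∀ {D} (Q : P) → Homogeneous D Q → ∀ m → Vec.sum m ≢ D → coeff p Q m ≡ 0#
  coeff-homogeneous []            _           m _      = refl
  coeff-homogeneous ((a , e) ∷ Q) (Σe≡D ∷ hQ) m Σm≢D =
    trans (coeff-∷-≢ a e Q m (λ e≡m → Σm≢D (trans (cong Vec.sum (sym e≡m)) Σe≡D))) (coeff-homogeneous Q hQ m Σm≢D)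

module DegreeCriterion (p : ℕ) .{{_ : NonZero p}} (prime : Prime p) (n : ℕ) (M : Matrix p n) (t t′ : Fin n → ℕ)
                       (c : (i : Fin n) → Fin (t i) → Fp p) (d : (i : Fin n) → Fin (t′ i) → Fp p) where
  open Props p n M t t′ c d
  open PrimeField p using (0#; _*_)
  open PrimeFieldArithmetic p prime using (x*y≡0⇒x≡0⊎y≡0)
  open Polynomials p n
  open ExponentVectors p
  open ReducedExponents p prime
  open CoefficientsOfReduction p prime n
  open Duality p n
  open GroupAlgebra (PrimeField.ring p) (VectorSpace.group p n) using (_⋆_; _▷_; ⋆-comm)
  open ≡ using (sym; trans)

  D : ℕ
  D = foldFin ℕ._+_ 0 n t′ ℕ.+ foldFin ℕ._+_ 0 n t

  rows coordinates : F.GR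
  rows        = F.prodGR n λ i → F.powGR (1-gᵘ (row p n M i)) (t′ i)
  coordinates = F.prodGR n λ i → F.powGR (1-gᵘ (basis p n i)) (t i)

  fPoly-dual : Dual fPoly (rows ⋆ coordinates) D
  fPoly-dual = LinearProduct⇒Dual (LinearProduct-polyMul
    (LinearProduct-polyProd n (λ i → polyPow p (linForm p n (M i)) (t′ i)) (λ i → F.powGR (1-gᵘ (row p n M i)) (t′ i)) t′
       λ i → LinearProduct-polyPow (linForm-isLinearForm (M i)) (Homogeneous-linForm (M i)) (t′ i))
    (LinearProduct-polyProd n (λ i → polyPow p (var p n i) (t i)) (λ i → F.powGR (1-gᵘ (basis p n i)) (t i)) t
       λ i → LinearProduct-polyPow (var-isLinearForm i) (Homogeneous-var i) (t i)))

  private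
    p-1<p : p ∸ 1 < p
    p-1<p = ℕₚ.∸-monoʳ-< {p} {1} {0} (s≤s z≤n) (ℕₚ.<⇒≤ (PrimeFieldArithmetic.1<p p prime))

  coeff-fPoly-top : P4 → ∀ m → Reduced m → Vec.sum m ≡ D → coeff p fPoly m ≡ 0#
  coeff-fPoly-top vanishes m m-reduced Σm≡D =
    [ (λ sign≡0 → ⊥-elim (sign≢0 prime D sign≡0))
    , (λ m!c≡0 → [ (λ m!≡0 → ⊥-elim (factorial≢0 prime m m<p m!≡0)) , id ] (x*y≡0⇒x≡0⊎y≡0 (factorial m) (coeff p fPoly m) m!c≡0)) ]
    (x*y≡0⇒x≡0⊎y≡0 (sign D) (factorial m * coeff p fPoly m) (trans (sym (Dual.on-monomial fPoly-dual m Σm≡D)) ▷monomial≡0))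
    where
    m<p : ∀ i → lookup m i < p
    m<p i = ℕₚ.≤-<-trans (VecAllₚ.lookup⁺ m-reduced i) p-1<p
    ▷monomial≡0 : ((rows ⋆ coordinates) ▷ MonomialFunctions.monomial p m) (VectorSpace.𝟘 p n) ≡ 0#
    ▷monomial≡0 = RingListSum.Sum-zero (PrimeField.ring p) (allVecs p n) λ w →
      trans (cong (_* MonomialFunctions.monomial p m (VectorSpace._⊕_ p (VectorSpace.𝟘 p n) w)) (trans (⋆-comm rows coordinates w) (vanishes w)))
            (PrimeField.zeroˡ p (MonomialFunctions.monomial p m (VectorSpace._⊕_ p (VectorSpace.𝟘 p n) w)))

  P4⇒P5 : P4 → P5
  P4⇒P5 vanishes m D≤Σm with VecAll.all? (λ e → e ℕ.≤? p ∸ 1) m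
  ... | no  m-unreduced = coeff-reduce-unreduced fPoly m m-unreduced
  ... | yes m-reduced   = trans (coeff-reduce-reduced fPoly (Dual.homogeneous fPoly-dual) m D′≤Σm m-reduced) coeff≡0
    where
    D′≤Σm : D ≤ Vec.sum m
    D′≤Σm = subst (_≤ Vec.sum m) (ℕₚ.+-comm (foldFin ℕ._+_ 0 n t) (foldFin ℕ._+_ 0 n t′)) D≤Σm
    coeff≡0 : coeff p fPoly m ≡ 0#
    coeff≡0 with Vec.sum m ℕ.≟ D
    ... | no  Σm≢D = coeff-homogeneous fPoly (Dual.homogeneous fPoly-dual) m Σm≢D
    ... | yes Σm≡D = coeff-fPoly-top vanishes m m-reduced Σm≡D

proposition1 : (p : ℕ) .{{_ : NonZero p}} → Prime p → 3 < p →
    (n : ℕ) → 1 ≤ n →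
    (M : Matrix p n) → Nonsingular p n M →
    (t t' : Fin n → ℕ) →
    ((i : Fin n) → t i ≤ p ∸ 1) → ((i : Fin n) → t' i ≤ p ∸ 1) →
    (c : (i : Fin n) → Fin (t i) → Fp p) →
    (d : (i : Fin n) → Fin (t' i) → Fp p) →
    ((i : Fin n) (k l : Fin (t i)) → c i k ≡ c i l → k ≡ l) →
    ((i : Fin n) (k l : Fin (t' i)) → d i k ≡ d i l → k ≡ l) →
    let open Props p n M t t' c d in
    (P1 ⇔ P2) × (P2 ⇔ P3) × (P3 → P4) × (P4 → P5)
proposition1 p p-prime _ n _ M _ t t′ _ _ c d _ _ =
  PolynomialCriterion.P1⇔P2 p p-prime n M t t′ c d ,
  CharacterCriterion.P2⇔P3 p p-prime n M t t′ c d ,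
  AugmentationCriterion.P3⇒P4 p p-prime n M t t′ c d ,
  DegreeCriterion.P4⇒P5 p p-prime n M t t′ c d
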